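{- In the standing setting below, suppose that $\langle B^A\rangle\le BM$ (in particular, this holds if $BM\trianglelefteq G$). Then $n$ is a prime power, $BM\trianglelefteq G$, and $\pi$ is a translation plane whose translation group is $\Gamma(L_\infty)$, with $\Gamma(L_\infty)\le BM$.
   Context: Standing setting: $n>1$ is an integer and $G$ is a finite group with subgroups $A,B,M$ such that (1) $|A|=|B|=|M|=nk$ and $|G|=n^3k$, where $k=|A\cap B|$; (2) $AM$ and $BM$ are subgroups of order $n^2k$; (3) $G=AMB$; (4) $AB\cap BA=A\cup B$. $\pi$ is the projective plane of order $n$ whose points are a symbol $\infty$ and the right cosets $Ax$, $BMx$ ($x\in G$), and whose lines are a symbol $L_\infty$ and the right cosets $By$, $AMy$ ($y\in G$), with incidences: $Ax$ on $By$ iff $Ax\cap By\ne\emptyset$; $Ax$ on $AMy$ iff $Ax\subseteq AMy$; $BMx$ on $By$ iff $By\subseteq BMx$; all $BMx$ and $\infty$ on $L_\infty$; $\infty$ on all $AMy$; no other incidences. $G$ acts on $\pi$ by right multiplication, and it is assumed that this action is faithful, so $G$ is a collineation group of $\pi$. $\langle B^A\rangle$ is the subgroup generated by all $a^{ -1}ba$, $a\in A$, $b\in B$. An elation with axis $W$ (a line) and center $w$ (a point on $W$) is a collineation fixing every point of $W$ and every line through $w$. $\Gamma(L_\infty)$ is the set of elements of $G$ that are elations with axis $L_\infty$ (including the identity). $\pi$ is a translation plane if the group of all elations of $\pi$ with axis $L_\infty$ is transitive on the $n^2$ points not on $L_\infty$; that group is then called the translation group. -}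

module Defs where

open import Data.Nat using (ℕ; _^_)
open import Data.Nat.Primality using (Prime)
open import Data.Fin using (Fin)
open import Data.Fin.Properties using (any?; _≟_)
open import Data.Fin.Subset using (Subset; _∈_)
open import Data.Fin.Subset.Properties using (_∈?_)
open import Data.Vec using (tabulate)
open import Data.Product using (Σ; ∃; _×_; _,_)
open import Data.Sum using (_⊎_)
open import Data.Unit using (⊤)
open import Data.Empty using (⊥)
open import Relation.Nullary using (¬_; does; _×-dec_)
open import Relation.Binary.PropositionalEquality using (_≡_)
open import Function.Bundles using (_⇔_)

record FinGroup : Set where
  infixl 7 _·_
  field
    order : ℕ
    _·_   : Fin order → Fin order → Fin order
    e     : Fin order
    _⁻¹   : Fin order → Fin order
    assoc : ∀ x y z → (x · y) · z ≡ x · (y · z)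
    idˡ   : ∀ x → e · x ≡ x
    idʳ   : ∀ x → x · e ≡ x
    invˡ  : ∀ x → (x ⁻¹) · x ≡ e
    invʳ  : ∀ x → x · (x ⁻¹) ≡ e

module GroupNotions (G : FinGroup) where
  open FinGroup G

  El : Set
  El = Fin order

  SubsetG : Set
  SubsetG = Subset order

  IsSubgroup : SubsetG → Set
  IsSubgroup S = (e ∈ S) × (∀ x y → x ∈ S → y ∈ S → (x · y) ∈ S)
                 × (∀ x → x ∈ S → (x ⁻¹) ∈ S)

  _⋆_ : SubsetG → SubsetG → SubsetG
  S ⋆ T = tabulate λ g → does (any? λ s → any? λ t → (s ∈? S) ×-dec ((t ∈? T) ×-dec (s · t ≟ g)))

  IsNormal : SubsetG → Set
  IsNormal S = ∀ g h → h ∈ S → ((g ⁻¹) · h · g) ∈ S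

  data ⟨_⟩ (P : El → Set) : El → Set where
    gen : ∀ {x} → P x → ⟨ P ⟩ x
    one : ⟨ P ⟩ e
    mul : ∀ {x y} → ⟨ P ⟩ x → ⟨ P ⟩ y → ⟨ P ⟩ (x · y)
    inv : ∀ {x} → ⟨ P ⟩ x → ⟨ P ⟩ (x ⁻¹)

  Conj : SubsetG → SubsetG → El → Set
  Conj B A g = ∃ λ a → ∃ λ b → (a ∈ A) × (b ∈ B) × (g ≡ (a ⁻¹) · b · a)

  _∈RC_,_ : El → SubsetG → El → Set
  g ∈RC S , x = ∃ λ s → (s ∈ S) × (g ≡ s · x)

  CosetEq : SubsetG → El → El → Set
  CosetEq S x y = ∀ g → (g ∈RC S , x) ⇔ (g ∈RC S , y)

module Plane (G : FinGroup) (A B M : Subset (FinGroup.order G)) where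
  open FinGroup G
  open GroupNotions G

  AM BM : SubsetG
  AM = A ⋆ M
  BM = B ⋆ M

  data Point : Set where
    ∞    : Point
    Aco  : El → Point   -- A x
    BMco : El → Point   -- BM x

  data Line : Set where
    L∞   : Line
    Bco  : El → Line    -- B y
    AMco : El → Line    -- AM y

  _≈P_ : Point → Point → Set
  ∞ ≈P ∞ = ⊤
  Aco x ≈P Aco y = CosetEq A x y
  BMco x ≈P BMco y = CosetEq BM x y
  _ ≈P _ = ⊥

  _≈L_ : Line → Line → Set
  L∞ ≈L L∞ = ⊤
  Bco x ≈L Bco y = CosetEq B x y
  AMco x ≈L AMco y = CosetEq AM x y
  _ ≈L _ = ⊥

  _I_ : Point → Line → Set
  Aco x I Bco y = ∃ λ g → (g ∈RC A , x) × (g ∈RC B , y)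
  Aco x I AMco y = ∀ g → g ∈RC A , x → g ∈RC AM , y
  BMco x I Bco y = ∀ g → g ∈RC B , y → g ∈RC BM , x
  BMco x I L∞ = ⊤
  ∞ I L∞ = ⊤
  ∞ I AMco y = ⊤
  _ I _ = ⊥

  actP : El → Point → Point
  actP g ∞ = ∞
  actP g (Aco x) = Aco (x · g)
  actP g (BMco x) = BMco (x · g)

  actL : El → Line → Line
  actL g L∞ = L∞
  actL g (Bco y) = Bco (y · g)
  actL g (AMco y) = AMco (y · g)

  Faithful : Set
  Faithful = ∀ g → (∀ P → actP g P ≈P P) → (∀ L → actL g L ≈L L) → g ≡ e

  record Collineation : Set where
    field
      fP : Point → Point
      fL : Line → Line
      fP-resp : ∀ P Q → P ≈P Q → fP P ≈P fP Q
      fL-resp : ∀ K L → K ≈L L → fL K ≈L fL L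
      fP-inj  : ∀ P Q → fP P ≈P fP Q → P ≈P Q
      fL-inj  : ∀ K L → fL K ≈L fL L → K ≈L L
      fP-surj : ∀ Q → ∃ λ P → fP P ≈P Q
      fL-surj : ∀ L → ∃ λ K → fL K ≈L L
      incid   : ∀ P L → (P I L) ⇔ (fP P I fL L)

  IsElationMaps : (Point → Point) → (Line → Line) → Line → Set
  IsElationMaps fP fL W =
    ∃ λ w → (w I W) × (∀ P → P I W → fP P ≈P P) × (∀ L → w I L → fL L ≈L L)

  IsElation : Collineation → Line → Set
  IsElation c W = IsElationMaps (Collineation.fP c) (Collineation.fL c) W

  InΓ∞ : El → Set
  InΓ∞ g = IsElationMaps (actP g) (actL g) L∞

  IsTranslationPlane : Set
  IsTranslationPlane = ∀ P Q → ¬ (P I L∞) → ¬ (Q I L∞) →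
    ∃ λ c → IsElation c L∞ × (Collineation.fP c P ≈P Q)

  -- the group of all elations with axis L∞ equals Γ(L∞) (as collineations);
  -- elements of Γ(L∞) are elations by definition, so this states the other inclusion
  AllElationsInΓ∞ : Set
  AllElationsInΓ∞ = ∀ c → IsElation c L∞ → ∃ λ g → InΓ∞ g
    × (∀ P → Collineation.fP c P ≈P actP g P) × (∀ L → Collineation.fL c L ≈L actL g L)

IsPrimePower : ℕ → Set
IsPrimePower n = ∃ λ p → ∃ λ m → Prime p × (n ≡ p ^ m)

-- The product formula ∣XY∣ ∣X ∩ Y∣ = ∣X∣ ∣Y∣ gives A ∩ BM = A ∩ B = AM ∩ B, and condition (4) makes the double
-- cosets ABA and BAB so large that G = AM ∪ ABA = BM ∪ BAB; with these facts π is a projective plane.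
-- Since ⟨Bᴬ⟩ ≤ BM, the subgroup ⋂_{a ∈ A} a BM a⁻¹ contains B and is normalised by A, so A times it contains ABA;
-- it is therefore too large to have index two or more in BM, hence equals BM, and BM is normal in G = A · BM.
-- Being normal, BM fixes L∞ pointwise.  Let T be the set of elements of BM fixing no affine point, together
-- with 1.  Every non-trivial t ∈ T has a centre, which makes T a group, and double counting the affine points
-- fixed by elements of BM gives ∣T∣ ≥ n²; hence G = A · T, ∣T∣ = n², and T is regular on the affine points.
-- An elation with axis L∞ agrees with the element of T that moves one affine point as it does, so T = Γ(L∞)
-- is the translation group.  Elements of T with distinct centres commute, which makes T abelian of prime
-- exponent p; so ∣T∣ = n² is a power of p, and so is n.

module Submission where

open import Defs
open import Algebra.Bundles using (Group)
import Algebra.Properties.Group as GroupProperties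
import Algebra.Properties.Monoid.Mult as MonoidPowers
open import Data.Bool using (Bool; true; false; not; _∧_)
open import Data.Empty using (⊥; ⊥-elim)
open import Data.Fin using (Fin; zero; suc; toℕ; fromℕ<)
open import Data.Fin.Permutation using (permutation)
open import Data.Fin.Properties using (any?; all?; pigeonhole; toℕ<n; toℕ-fromℕ<; toℕ-injective) renaming (_≟_ to _≟ᶠ_)
open import Data.Fin.Subset using (Subset; _∈_; _∉_; _⊆_; _∩_; _∪_; ∣_∣; ⁅_⁆)
open import Data.Fin.Subset.Properties
  using (_∈?_; ⊆⊤; ⊆-antisym; ∣⊤∣≡n; p⊆q⇒∣p∣≤∣q∣; p⊂q⇒∣p∣<∣q∣; ∣p∣≤n; ∣p∣≡n⇒p≡⊤; ∈⊤; x∈⁅x⁆; x∈⁅y⁆⇒x≡y; ∣⁅x⁆∣≡1;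
         x∈p∩q⁺; x∈p∩q⁻; x∈p∪q⁻; ∩-comm)
open import Data.List using (List; []; _∷_; _++_; foldr)
open import Data.Nat using (ℕ; zero; suc; _+_; _*_; _^_; _∸_; _≤_; _<_; _%_; _/_; z≤n; z<s; NonZero; >-nonZero; >-nonZero⁻¹; nonTrivial⇒n>1)
open import Data.Nat.Coprimality as Coprimality using (Coprime; coprime-Bézout; prime⇒coprime; coprime-divisor)
open import Data.Nat.DivMod using (m%n<n; m≡m%n+[m/n]*n)
open import Data.Nat.Divisibility using (_∣_; _∣?_; divides; ∣1⇒≡1; *-cancelʳ-∣)
open import Data.Nat.GCD using (module Bézout)
open import Data.Nat.Induction using (<-rec)
open import Data.Nat.Primality using (Prime; prime; composite; composite?; prime⇒nonZero; prime⇒nonTrivial; prime⇒irreducible)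
open import Data.Nat.Properties
open import Algebra.Properties.Semiring.Sum +-*-semiring
  using (sum; sum-cong-≗; ∑-comm; ∑-distrib-+; *-distribˡ-sum; *-distribʳ-sum; sum-permute)
open import Data.Nat.Solver using (module +-*-Solver)
open import Data.Product using (∃; ∃₂; _×_; _,_; proj₁; proj₂)
open import Data.Sum using (_⊎_; inj₁; inj₂; swap)
open import Data.Unit using (tt)
open import Data.Vec using (Vec; []; _∷_; lookup; tabulate)
open import Data.Vec.Properties using (lookup∘tabulate; lookup-zipWith; []=⇒lookup; lookup⇒[]=)
open import Function.Bundles using (_⇔_; Equivalence; mk⇔)
open import Function.Construct.Composition using (_⇔-∘_)
open import Function.Construct.Identity using (⇔-id)
open import Function.Construct.Symmetry using (⇔-sym)
open import Level using (0ℓ)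
open import Relation.Binary.Bundles using (Setoid)
open import Relation.Binary.Definitions using (tri<; tri≈; tri>)
open import Relation.Binary.PropositionalEquality
import Relation.Binary.Reasoning.Setoid as SetoidReasoning
import Relation.Binary.Reflection as Reflection
open import Relation.Nullary using (¬_; Dec; yes; no; does)
open import Relation.Nullary.Decidable using (dec-true; map′; ¬?; _×-dec_; _→-dec_)
open import Relation.Unary using (Decidable)

open +-*-Solver using (_:*_; _:+_; _:^_; _:=_; con) renaming (solve to ring-solve)

module GroupWords where
  infixl 7 _⊗_
  infix 8 _⁻

  data Word (k : ℕ) : Set where
    var : Fin k → Word k
    ι   : Word k
    _⊗_ : Word k → Word k → Word k
    _⁻  : Word k → Word k

  -- (i , true) is the letter xᵢ⁻¹.
  Letter : ℕ → Set
  Letter k = Fin k × Bool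

  _◁_ : ∀ {k} → Letter k → List (Letter k) → List (Letter k)
  l ◁ [] = l ∷ []
  (i , b) ◁ ((j , c) ∷ w) with i ≟ᶠ j | b | c
  ... | yes _ | true  | false = w
  ... | yes _ | false | true  = w
  ... | _     | _     | _     = (i , b) ∷ (j , c) ∷ w

  invert : ∀ {k} → List (Letter k) → List (Letter k)
  invert []            = []
  invert ((i , b) ∷ w) = invert w ++ ((i , not b) ∷ [])

  normalise : ∀ {k} → Word k → List (Letter k)
  normalise (var i) = (i , false) ∷ []
  normalise ι       = []
  normalise (u ⊗ v) = foldr _◁_ (normalise v) (normalise u)
  normalise (u ⁻)   = invert (normalise u)

χ : Bool → ℕ
χ true  = 1
χ false = 0

𝟙 : ∀ {m} → Subset m → Fin m → ℕ
𝟙 S x = χ (lookup S x)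

𝟙-∈ : ∀ {m} {S : Subset m} {x} → x ∈ S → 𝟙 S x ≡ 1
𝟙-∈ p = cong χ ([]=⇒lookup p)

𝟙-∉ : ∀ {m} {S : Subset m} {x} → x ∉ S → 𝟙 S x ≡ 0
𝟙-∉ {S = S} {x} p with lookup S x in eq
... | true  = ⊥-elim (p (lookup⇒[]= x S eq))
... | false = refl

𝟙-⇔ : ∀ {m m′} {S : Subset m} {T : Subset m′} {x y} → (x ∈ S → y ∈ T) → (y ∈ T → x ∈ S) → 𝟙 S x ≡ 𝟙 T y
𝟙-⇔ {S = S} {T} {x} {y} to from with x ∈? S
... | yes p = trans (𝟙-∈ p) (sym (𝟙-∈ (to p)))
... | no ¬p = trans (𝟙-∉ ¬p) (sym (𝟙-∉ (λ q → ¬p (from q))))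

𝟙-mono : ∀ {m m′} {S : Subset m} {T : Subset m′} {x y} → (x ∈ S → y ∈ T) → 𝟙 S x ≤ 𝟙 T y
𝟙-mono {S = S} {T} {x} {y} to with x ∈? S
... | yes p = ≤-reflexive (trans (𝟙-∈ p) (sym (𝟙-∈ (to p))))
... | no ¬p = ≤-trans (≤-reflexive (𝟙-∉ ¬p)) z≤n

𝟙-∩ : ∀ {m} (S T : Subset m) x → 𝟙 (S ∩ T) x ≡ 𝟙 S x * 𝟙 T x
𝟙-∩ S T x rewrite lookup-zipWith _∧_ x S T with lookup S x
... | true  = sym (+-identityʳ _)
... | false = refl

𝟙*𝟙≤𝟙 : ∀ {m m′ m″} {S : Subset m} {T : Subset m′} {U : Subset m″} {x y z} →
         (x ∈ S → y ∈ T → z ∈ U) → 𝟙 S x * 𝟙 T y ≤ 𝟙 U z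
𝟙*𝟙≤𝟙 {S = S} {T} {x = x} {y} h with x ∈? S | y ∈? T
... | yes p | yes q = ≤-reflexive (trans (cong₂ _*_ (𝟙-∈ p) (𝟙-∈ q)) (sym (𝟙-∈ (h p q))))
... | yes _ | no ¬q = ≤-trans (≤-reflexive (trans (cong (𝟙 S x *_) (𝟙-∉ ¬q)) (*-zeroʳ (𝟙 S x)))) z≤n
... | no ¬p | _     = ≤-trans (≤-reflexive (cong (_* 𝟙 T y) (𝟙-∉ ¬p))) z≤n

𝟙*𝟙≡0 : ∀ {m m′} {S : Subset m} {T : Subset m′} {x y} → (x ∈ S → y ∈ T → ⊥) → 𝟙 S x * 𝟙 T y ≡ 0
𝟙*𝟙≡0 {S = S} {T} {x} {y} h with x ∈? S | y ∈? T
... | yes p | yes q = ⊥-elim (h p q)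
... | yes _ | no ¬q = trans (cong (𝟙 S x *_) (𝟙-∉ ¬q)) (*-zeroʳ (𝟙 S x))
... | no ¬p | _     = cong (_* 𝟙 T y) (𝟙-∉ ¬p)

∣∣≡∑𝟙 : ∀ {m} (S : Subset m) → ∣ S ∣ ≡ sum (𝟙 S)
∣∣≡∑𝟙 []          = refl
∣∣≡∑𝟙 (true ∷ S)  = cong suc (∣∣≡∑𝟙 S)
∣∣≡∑𝟙 (false ∷ S) = ∣∣≡∑𝟙 S

sum-const : ∀ m c → sum {m} (λ _ → c) ≡ m * c
sum-const zero    c = refl
sum-const (suc m) c = cong (c +_) (sum-const m c)

sum-mono-≤ : ∀ {m} {f g : Fin m → ℕ} → (∀ i → f i ≤ g i) → sum f ≤ sum g
sum-mono-≤ {zero}  f≤g = z≤n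
sum-mono-≤ {suc m} f≤g = +-mono-≤ (f≤g zero) (sum-mono-≤ (λ i → f≤g (suc i)))

∣∪∣+∣∩∣ : ∀ {m} (S T : Subset m) → ∣ S ∪ T ∣ + ∣ S ∩ T ∣ ≡ ∣ S ∣ + ∣ T ∣
∣∪∣+∣∩∣ []          []          = refl
∣∪∣+∣∩∣ (true ∷ S)  (true ∷ T)  = cong suc (trans (+-suc _ _) (trans (cong suc (∣∪∣+∣∩∣ S T)) (sym (+-suc _ _))))
∣∪∣+∣∩∣ (true ∷ S)  (false ∷ T) = cong suc (∣∪∣+∣∩∣ S T)
∣∪∣+∣∩∣ (false ∷ S) (true ∷ T)  = trans (cong suc (∣∪∣+∣∩∣ S T)) (sym (+-suc _ _))
∣∪∣+∣∩∣ (false ∷ S) (false ∷ T) = ∣∪∣+∣∩∣ S T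

module _ {m : ℕ} where

  ∈⇒∣∣>0 : ∀ {S : Subset m} {x} → x ∈ S → 0 < ∣ S ∣
  ∈⇒∣∣>0 {S} {x} p = subst (_≤ ∣ S ∣) (∣⁅x⁆∣≡1 x) (p⊆q⇒∣p∣≤∣q∣ λ q → subst (_∈ S) (sym (x∈⁅y⁆⇒x≡y x q)) p)

  ∉⇒∣∣<m : ∀ {S : Subset m} {x} → x ∉ S → ∣ S ∣ < m
  ∉⇒∣∣<m {S} {x} x∉S = ≤∧≢⇒< (∣p∣≤n S) λ ∣S∣≡m → x∉S (subst (x ∈_) (sym (∣p∣≡n⇒p≡⊤ ∣S∣≡m)) ∈⊤)

  ∀∈⇒∣∣≡m : ∀ {S : Subset m} → (∀ x → x ∈ S) → ∣ S ∣ ≡ m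
  ∀∈⇒∣∣≡m {S} all = trans (cong ∣_∣ (⊆-antisym ⊆⊤ (λ {x} _ → all x))) (∣⊤∣≡n m)

  m≤∣∣⇒∈ : ∀ {S : Subset m} {x} → m ≤ ∣ S ∣ → x ∈ S
  m≤∣∣⇒∈ {S} {x} m≤∣S∣ with x ∈? S
  ... | yes p = p
  ... | no ¬p = ⊥-elim (<⇒≱ (∉⇒∣∣<m ¬p) m≤∣S∣)

  ∣∣<⇒∃∈∖ : ∀ {S T : Subset m} → ∣ S ∣ < ∣ T ∣ → ∃ λ x → x ∈ T × x ∉ S
  ∣∣<⇒∃∈∖ {S} {T} ∣S∣<∣T∣ with any? (λ x → (x ∈? T) ×-dec ¬? (x ∈? S))
  ... | yes found = found
  ... | no none = ⊥-elim (<⇒≱ ∣S∣<∣T∣ (p⊆q⇒∣p∣≤∣q∣ T⊆S))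
    where
    T⊆S : T ⊆ S
    T⊆S {x} x∈T with x ∈? S
    ... | yes x∈S = x∈S
    ... | no x∉S  = ⊥-elim (none (x , x∈T , x∉S))

  ⊆∧∣∣≤⇒⊇ : ∀ {S T : Subset m} → S ⊆ T → ∣ T ∣ ≤ ∣ S ∣ → T ⊆ S
  ⊆∧∣∣≤⇒⊇ {S} {T} S⊆T ∣T∣≤∣S∣ {x} x∈T with x ∈? S
  ... | yes x∈S = x∈S
  ... | no x∉S  = ⊥-elim (<⇒≱ (p⊂q⇒∣p∣<∣q∣ (S⊆T , x , x∈T , x∉S)) ∣T∣≤∣S∣)

module GroupTheory (G : FinGroup) where
  open FinGroup G
  open GroupNotions G

  group : Group 0ℓ 0ℓ
  group = record
    { Carrier = El ; _≈_ = _≡_ ; _∙_ = _·_ ; ε = e ; _⁻¹ = _⁻¹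
    ; isGroup = record
      { isMonoid = record
        { isSemigroup = record
          { isMagma = record { isEquivalence = isEquivalence ; ∙-cong = cong₂ _·_ }
          ; assoc = assoc }
        ; identity = idˡ , idʳ }
      ; inverse = invˡ , invʳ
      ; ⁻¹-cong = cong _⁻¹ } }

  open GroupProperties group public
    using (⁻¹-involutive; ⁻¹-anti-homo-∙; ε⁻¹≈ε; inverseʳ-unique; ∙-cancelˡ; ∙-cancelʳ;
           \\-leftDividesˡ; \\-leftDividesʳ; //-rightDividesˡ; //-rightDividesʳ)

  -- Identities in G are proved by comparing free-group normal forms of words.
  module Solver where
    open GroupWords public using (Word; var; ι; _⊗_; _⁻)
    open GroupWords using (Letter; _◁_; invert; normalise)

    ⟦_⟧ : ∀ {k} → Word k → Vec El k → El
    ⟦ var i ⟧ ρ = lookup ρ i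
    ⟦ ι ⟧     ρ = e
    ⟦ u ⊗ v ⟧ ρ = ⟦ u ⟧ ρ · ⟦ v ⟧ ρ
    ⟦ u ⁻ ⟧   ρ = ⟦ u ⟧ ρ ⁻¹

    ⟦_⟧ˡ : ∀ {k} → Letter k → Vec El k → El
    ⟦ i , false ⟧ˡ ρ = lookup ρ i
    ⟦ i , true ⟧ˡ  ρ = lookup ρ i ⁻¹

    ⟦_⟧ʷ : ∀ {k} → List (Letter k) → Vec El k → El
    ⟦ [] ⟧ʷ    ρ = e
    ⟦ l ∷ w ⟧ʷ ρ = ⟦ l ⟧ˡ ρ · ⟦ w ⟧ʷ ρ

    ◁-correct : ∀ {k} (l : Letter k) w ρ → ⟦ l ◁ w ⟧ʷ ρ ≡ ⟦ l ⟧ˡ ρ · ⟦ w ⟧ʷ ρ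
    ◁-correct l [] ρ = refl
    ◁-correct (i , b) ((j , c) ∷ w) ρ with i ≟ᶠ j | b | c
    ... | yes refl | true  | false = sym (\\-leftDividesʳ (lookup ρ i) (⟦ w ⟧ʷ ρ))
    ... | yes refl | false | true  = sym (\\-leftDividesˡ (lookup ρ i) (⟦ w ⟧ʷ ρ))
    ... | yes refl | true  | true  = refl
    ... | yes refl | false | false = refl
    ... | no _     | true  | _     = refl
    ... | no _     | false | _     = refl

    foldr-◁-correct : ∀ {k} (u v : List (Letter k)) ρ → ⟦ foldr _◁_ v u ⟧ʷ ρ ≡ ⟦ u ⟧ʷ ρ · ⟦ v ⟧ʷ ρ
    foldr-◁-correct []      v ρ = sym (idˡ _)
    foldr-◁-correct (l ∷ u) v ρ = begin
      ⟦ l ◁ foldr _◁_ v u ⟧ʷ ρ           ≡⟨ ◁-correct l (foldr _◁_ v u) ρ ⟩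
      ⟦ l ⟧ˡ ρ · ⟦ foldr _◁_ v u ⟧ʷ ρ    ≡⟨ cong (⟦ l ⟧ˡ ρ ·_) (foldr-◁-correct u v ρ) ⟩
      ⟦ l ⟧ˡ ρ · (⟦ u ⟧ʷ ρ · ⟦ v ⟧ʷ ρ)   ≡⟨ assoc _ _ _ ⟨
      ⟦ l ⟧ˡ ρ · ⟦ u ⟧ʷ ρ · ⟦ v ⟧ʷ ρ     ∎
      where open ≡-Reasoning

    ++-correct : ∀ {k} (u v : List (Letter k)) ρ → ⟦ u ++ v ⟧ʷ ρ ≡ ⟦ u ⟧ʷ ρ · ⟦ v ⟧ʷ ρ
    ++-correct []      v ρ = sym (idˡ _)
    ++-correct (l ∷ u) v ρ = trans (cong (⟦ l ⟧ˡ ρ ·_) (++-correct u v ρ)) (sym (assoc _ _ _))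

    invert-correct : ∀ {k} (w : List (Letter k)) ρ → ⟦ invert w ⟧ʷ ρ ≡ ⟦ w ⟧ʷ ρ ⁻¹
    invert-correct []            ρ = sym ε⁻¹≈ε
    invert-correct ((i , b) ∷ w) ρ = begin
      ⟦ invert w ++ ((i , not b) ∷ []) ⟧ʷ ρ      ≡⟨ ++-correct (invert w) _ ρ ⟩
      ⟦ invert w ⟧ʷ ρ · (⟦ i , not b ⟧ˡ ρ · e)   ≡⟨ cong₂ _·_ (invert-correct w ρ) (trans (idʳ _) (flip b)) ⟩
      ⟦ w ⟧ʷ ρ ⁻¹ · ⟦ i , b ⟧ˡ ρ ⁻¹              ≡⟨ ⁻¹-anti-homo-∙ _ _ ⟨
      (⟦ i , b ⟧ˡ ρ · ⟦ w ⟧ʷ ρ) ⁻¹                ∎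
      where
      open ≡-Reasoning
      flip : ∀ b → ⟦ i , not b ⟧ˡ ρ ≡ ⟦ i , b ⟧ˡ ρ ⁻¹
      flip false = refl
      flip true  = sym (⁻¹-involutive _)

    ⟦_⇓⟧ : ∀ {k} → Word k → Vec El k → El
    ⟦ w ⇓⟧ = ⟦ normalise w ⟧ʷ

    correct : ∀ {k} (w : Word k) ρ → ⟦ w ⇓⟧ ρ ≡ ⟦ w ⟧ ρ
    correct (var i) ρ = idʳ _
    correct ι       ρ = refl
    correct (u ⊗ v) ρ = trans (foldr-◁-correct (normalise u) (normalise v) ρ) (cong₂ _·_ (correct u ρ) (correct v ρ))
    correct (u ⁻)   ρ = trans (invert-correct (normalise u) ρ) (cong _⁻¹ (correct u ρ))

    open Reflection (setoid El) var ⟦_⟧ ⟦_⇓⟧ correct public using (solve; _⊜_)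

  open Solver using (solve; _⊜_; _⊗_; _⁻; ι)


  module Subgroup {S : SubsetG} (S≤G : IsSubgroup S) where
    e∈ : e ∈ S
    e∈ = proj₁ S≤G

    ·∈ : ∀ {x y} → x ∈ S → y ∈ S → x · y ∈ S
    ·∈ = proj₁ (proj₂ S≤G) _ _

    ⁻¹∈ : ∀ {x} → x ∈ S → x ⁻¹ ∈ S
    ⁻¹∈ = proj₂ (proj₂ S≤G) _

    ⁻¹∈⁻ : ∀ {x} → x ⁻¹ ∈ S → x ∈ S
    ⁻¹∈⁻ {x} p = subst (_∈ S) (⁻¹-involutive x) (⁻¹∈ p)

    ·⁻¹∈ : ∀ {x y} → x ∈ S → y ∈ S → x · y ⁻¹ ∈ S
    ·⁻¹∈ p q = ·∈ p (⁻¹∈ q)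

    ⁻¹·∈ : ∀ {x y} → x ∈ S → y ∈ S → x ⁻¹ · y ∈ S
    ⁻¹·∈ p q = ·∈ (⁻¹∈ p) q

    ∈-cancelˡ : ∀ {x y} → x ∈ S → x · y ∈ S → y ∈ S
    ∈-cancelˡ {x} {y} p q = subst (_∈ S) (\\-leftDividesʳ x y) (⁻¹·∈ p q)

    ∈-cancelʳ : ∀ {x y} → y ∈ S → x · y ∈ S → x ∈ S
    ∈-cancelʳ {x} {y} p q = subst (_∈ S) (//-rightDividesʳ y x) (·⁻¹∈ q p)

    ∈-cancel-sandwich : ∀ {x y z} → x ∈ S → z ∈ S → x · y · z ∈ S → y ∈ S
    ∈-cancel-sandwich x∈S z∈S xyz∈S = ∈-cancelˡ x∈S (∈-cancelʳ z∈S xyz∈S)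

    ·⁻¹∈-sym : ∀ {x y} → x · y ⁻¹ ∈ S → y · x ⁻¹ ∈ S
    ·⁻¹∈-sym {x} {y} p = subst (_∈ S) (solve 2 (λ x y → (x ⊗ y ⁻) ⁻ ⊜ y ⊗ x ⁻) refl x y) (⁻¹∈ p)

    ·⁻¹∈-trans : ∀ {x y z} → x · y ⁻¹ ∈ S → y · z ⁻¹ ∈ S → x · z ⁻¹ ∈ S
    ·⁻¹∈-trans {x} {y} {z} p q = subst (_∈ S) (solve 3 (λ x y z → x ⊗ y ⁻ ⊗ (y ⊗ z ⁻) ⊜ x ⊗ z ⁻) refl x y z) (·∈ p q)

    ∈RC⇒·⁻¹∈ : ∀ {g x} → g ∈RC S , x → g · x ⁻¹ ∈ S
    ∈RC⇒·⁻¹∈ {g} {x} (s , s∈ , refl) = subst (_∈ S) (sym (//-rightDividesʳ x s)) s∈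

    ·⁻¹∈⇒∈RC : ∀ {g x} → g · x ⁻¹ ∈ S → g ∈RC S , x
    ·⁻¹∈⇒∈RC {g} {x} p = g · x ⁻¹ , p , sym (//-rightDividesˡ x g)

    CosetEq⇒·⁻¹∈ : ∀ {x y} → CosetEq S x y → x · y ⁻¹ ∈ S
    CosetEq⇒·⁻¹∈ {x} c = ∈RC⇒·⁻¹∈ (Equivalence.to (c x) (e , e∈ , sym (idˡ x)))

    ·⁻¹∈⇒CosetEq : ∀ {x y} → x · y ⁻¹ ∈ S → CosetEq S x y
    ·⁻¹∈⇒CosetEq p g = mk⇔ (λ r → ·⁻¹∈⇒∈RC (·⁻¹∈-trans (∈RC⇒·⁻¹∈ r) p))
                           (λ r → ·⁻¹∈⇒∈RC (·⁻¹∈-trans (∈RC⇒·⁻¹∈ r) (·⁻¹∈-sym p)))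

  ∑ : (El → ℕ) → ℕ
  ∑ = sum

  subsetOf : {P : El → Set} → Decidable P → SubsetG
  subsetOf P? = tabulate (λ g → does (P? g))

  ∈subsetOf⁺ : ∀ {P : El → Set} (P? : Decidable P) {g} → P g → g ∈ subsetOf P?
  ∈subsetOf⁺ P? {g} p = lookup⇒[]= g _ (trans (lookup∘tabulate _ g) (dec-true (P? g) p))

  ∈subsetOf⁻ : ∀ {P : El → Set} (P? : Decidable P) {g} → g ∈ subsetOf P? → P g
  ∈subsetOf⁻ P? {g} p with P? g | trans (sym (lookup∘tabulate (λ g → does (P? g)) g)) ([]=⇒lookup p)
  ... | yes q | _ = q

  Factorisation : SubsetG → SubsetG → El → Set
  Factorisation S T g = ∃₂ λ s t → s ∈ S × t ∈ T × s · t ≡ g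

  -- S ⋆ T in Defs is, by definition, subsetOf (factorisation? S T).
  factorisation? : ∀ S T → Decidable (Factorisation S T)
  factorisation? S T g = any? λ s → any? λ t → (s ∈? S) ×-dec ((t ∈? T) ×-dec (s · t ≟ᶠ g))

  ∈⋆⁺ : ∀ {S T s t} → s ∈ S → t ∈ T → s · t ∈ S ⋆ T
  ∈⋆⁺ {S} {T} p q = ∈subsetOf⁺ (factorisation? S T) (_ , _ , p , q , refl)

  ∈⋆⁻ : ∀ {S T g} → g ∈ S ⋆ T → Factorisation S T g
  ∈⋆⁻ {S} {T} = ∈subsetOf⁻ (factorisation? S T)

  -- Double counting in G

  ∑-translateʳ : ∀ (F : El → ℕ) c → ∑ (λ g → F (g · c)) ≡ ∑ F
  ∑-translateʳ F c = sym (sum-permute F (permutation (_· c) (_· c ⁻¹) (//-rightDividesˡ c) (//-rightDividesʳ c)))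

  ∑-translateˡ : ∀ (F : El → ℕ) c → ∑ (λ g → F (c · g)) ≡ ∑ F
  ∑-translateˡ F c = sym (sum-permute F (permutation (c ·_) (c ⁻¹ ·_) (\\-leftDividesˡ c) (\\-leftDividesʳ c)))

  ∑-conjugate : ∀ (F : El → ℕ) c → ∑ (λ g → F (c · g · c ⁻¹)) ≡ ∑ F
  ∑-conjugate F c = trans (∑-translateˡ (λ h → F (h · c ⁻¹)) c) (∑-translateʳ F (c ⁻¹))

  ∑𝟙·c : ∀ S c → ∑ (λ g → 𝟙 S g * c) ≡ ∣ S ∣ * c
  ∑𝟙·c S c = trans (sym (*-distribʳ-sum c (𝟙 S))) (cong (_* c) (sym (∣∣≡∑𝟙 S)))

  module _ {X Y : SubsetG} (X≤G : IsSubgroup X) (Y≤G : IsSubgroup Y) where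
    private
      module X = Subgroup X≤G
      module Y = Subgroup Y≤G

      F : El → El → ℕ
      F g x = 𝟙 X x * 𝟙 Y (x ⁻¹ · g)

      row : ∀ x → ∑ (λ g → F g x) ≡ 𝟙 X x * ∣ Y ∣
      row x = begin
        ∑ (λ g → 𝟙 X x * 𝟙 Y (x ⁻¹ · g))  ≡⟨ *-distribˡ-sum (𝟙 X x) (λ g → 𝟙 Y (x ⁻¹ · g)) ⟨
        𝟙 X x * ∑ (λ g → 𝟙 Y (x ⁻¹ · g))  ≡⟨ cong (𝟙 X x *_) (∑-translateˡ (𝟙 Y) (x ⁻¹)) ⟩
        𝟙 X x * ∑ (𝟙 Y)                    ≡⟨ cong (𝟙 X x *_) (∣∣≡∑𝟙 Y) ⟨
        𝟙 X x * ∣ Y ∣                        ∎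
        where open ≡-Reasoning

      column : ∀ g → ∑ (λ x → F g x) ≡ 𝟙 (X ⋆ Y) g * ∣ X ∩ Y ∣
      column g with g ∈? (X ⋆ Y)
      ... | no g∉XY = begin
        ∑ (λ x → F g x)   ≡⟨ sum-cong-≗ vanish ⟩
        ∑ (λ _ → 0) ≡⟨ sum-const order 0 ⟩
        order * 0           ≡⟨ *-zeroʳ order ⟩
        0                   ≡⟨ cong (_* ∣ X ∩ Y ∣) (𝟙-∉ g∉XY) ⟨
        𝟙 (X ⋆ Y) g * ∣ X ∩ Y ∣ ∎
        where
        open ≡-Reasoning
        vanish : ∀ x → F g x ≡ 0
        vanish x with x ∈? X | x ⁻¹ · g ∈? Y
        ... | yes x∈X | yes y∈Y = ⊥-elim (g∉XY (subst (_∈ X ⋆ Y) (\\-leftDividesˡ x g) (∈⋆⁺ x∈X y∈Y)))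
        ... | yes _   | no y∉Y  = trans (cong (𝟙 X x *_) (𝟙-∉ y∉Y)) (*-zeroʳ (𝟙 X x))
        ... | no x∉X  | _       = cong (_* 𝟙 Y (x ⁻¹ · g)) (𝟙-∉ x∉X)
      ... | yes g∈XY with ∈⋆⁻ g∈XY
      ... | x₀ , y₀ , x₀∈X , y₀∈Y , refl = begin
        ∑ (λ x → F g x)                ≡⟨ ∑-translateˡ (F g) x₀ ⟨
        ∑ (λ z → F g (x₀ · z))         ≡⟨ sum-cong-≗ shift ⟩
        ∑ (𝟙 (X ∩ Y))                  ≡⟨ ∣∣≡∑𝟙 (X ∩ Y) ⟨
        ∣ X ∩ Y ∣                        ≡⟨ +-identityʳ _ ⟨
        1 * ∣ X ∩ Y ∣                    ≡⟨ cong (_* ∣ X ∩ Y ∣) (𝟙-∈ g∈XY) ⟨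
        𝟙 (X ⋆ Y) g * ∣ X ∩ Y ∣          ∎
        where
        open ≡-Reasoning
        shift : ∀ z → F g (x₀ · z) ≡ 𝟙 (X ∩ Y) z
        shift z = begin
          𝟙 X (x₀ · z) * 𝟙 Y ((x₀ · z) ⁻¹ · (x₀ · y₀))
            ≡⟨ cong₂ _*_ (𝟙-⇔ (X.∈-cancelˡ x₀∈X) (X.·∈ x₀∈X))
                         (cong (𝟙 Y) (solve 3 (λ x z y → (x ⊗ z) ⁻ ⊗ (x ⊗ y) ⊜ z ⁻ ⊗ y) refl x₀ z y₀)) ⟩
          𝟙 X z * 𝟙 Y (z ⁻¹ · y₀)
            ≡⟨ cong (𝟙 X z *_) (𝟙-⇔ (λ p → Y.⁻¹∈⁻ (Y.∈-cancelʳ y₀∈Y p)) (λ q → Y.·∈ (Y.⁻¹∈ q) y₀∈Y)) ⟩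
          𝟙 X z * 𝟙 Y z
            ≡⟨ 𝟙-∩ X Y z ⟨
          𝟙 (X ∩ Y) z ∎

    product-formula : ∣ X ⋆ Y ∣ * ∣ X ∩ Y ∣ ≡ ∣ X ∣ * ∣ Y ∣
    product-formula = begin
      ∣ X ⋆ Y ∣ * ∣ X ∩ Y ∣                   ≡⟨ ∑𝟙·c (X ⋆ Y) _ ⟨
      ∑ (λ g → 𝟙 (X ⋆ Y) g * ∣ X ∩ Y ∣)     ≡⟨ sum-cong-≗ column ⟨
      ∑ (λ g → ∑ (λ x → F g x))           ≡⟨ ∑-comm (λ g x → F g x) ⟩
      ∑ (λ x → ∑ (λ g → F g x))           ≡⟨ sum-cong-≗ row ⟩
      ∑ (λ x → 𝟙 X x * ∣ Y ∣)               ≡⟨ ∑𝟙·c X _ ⟩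
      ∣ X ∣ * ∣ Y ∣                           ∎
      where open ≡-Reasoning

  module _ {X Y : SubsetG} (X≤G : IsSubgroup X) (Y≤G : IsSubgroup Y)
           (XY∩YX⊆X∪Y : ∀ {g} → g ∈ X ⋆ Y → g ∈ Y ⋆ X → g ∈ X ⊎ g ∈ Y) where
    private
      module X = Subgroup X≤G
      module Y = Subgroup Y≤G

      XYX : SubsetG
      XYX = (X ⋆ Y) ⋆ X

      X⊆XYX : X ⊆ XYX
      X⊆XYX {g} g∈X = subst (_∈ XYX) (trans (cong (_· g) (idˡ e)) (idˡ g)) (∈⋆⁺ (∈⋆⁺ X.e∈ Y.e∈) g∈X)

      term : El → El → ℕ
      term g x = 𝟙 X x * 𝟙 (X ⋆ Y) (g · x ⁻¹)

      f : El → ℕ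
      f g = ∑ (term g)

      ∑f : ∑ f ≡ ∣ X ∣ * ∣ X ⋆ Y ∣
      ∑f = begin
        ∑ (λ g → ∑ (λ x → 𝟙 X x * 𝟙 (X ⋆ Y) (g · x ⁻¹)))   ≡⟨ ∑-comm (λ g x → 𝟙 X x * 𝟙 (X ⋆ Y) (g · x ⁻¹)) ⟩
        ∑ (λ x → ∑ (λ g → 𝟙 X x * 𝟙 (X ⋆ Y) (g · x ⁻¹)))   ≡⟨ sum-cong-≗ row ⟩
        ∑ (λ x → 𝟙 X x * ∣ X ⋆ Y ∣)                         ≡⟨ ∑𝟙·c X _ ⟩
        ∣ X ∣ * ∣ X ⋆ Y ∣                                   ∎
        where
        open ≡-Reasoning
        row : ∀ x → ∑ (λ g → 𝟙 X x * 𝟙 (X ⋆ Y) (g · x ⁻¹)) ≡ 𝟙 X x * ∣ X ⋆ Y ∣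
        row x = trans (sym (*-distribˡ-sum (𝟙 X x) (λ g → 𝟙 (X ⋆ Y) (g · x ⁻¹))))
                      (cong (𝟙 X x *_) (trans (∑-translateʳ (𝟙 (X ⋆ Y)) (x ⁻¹)) (sym (∣∣≡∑𝟙 (X ⋆ Y)))))

      -- For g ∉ X the x ∈ X with g ∈ XY·x form a single coset of X ∩ Y; this is where XY ∩ YX ⊆ X ∪ Y enters.
      same-fibre : ∀ {g x₀ x} → g ∉ X → x₀ ∈ X → g · x₀ ⁻¹ ∈ X ⋆ Y → x ∈ X → g · x ⁻¹ ∈ X ⋆ Y → x · x₀ ⁻¹ ∈ X ∩ Y
      same-fibre {g} {x₀} {x} g∉X x₀∈X p x∈X q = compare (∈⋆⁻ p) (∈⋆⁻ q)
        where
        compare : Factorisation X Y (g · x₀ ⁻¹) → Factorisation X Y (g · x ⁻¹) → x · x₀ ⁻¹ ∈ X ∩ Y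
        compare (a₁ , b₁ , a₁∈X , b₁∈Y , a₁b₁≡gx₀⁻¹) (a₂ , b₂ , a₂∈X , b₂∈Y , a₂b₂≡gx⁻¹) =
          conclude (XY∩YX⊆X∪Y (∈⋆⁺ (X.⁻¹·∈ a₂∈X a₁∈X) b₁∈Y) (subst (_∈ Y ⋆ X) (sym w≡b₂xx₀⁻¹) (∈⋆⁺ b₂∈Y (X.·⁻¹∈ x∈X x₀∈X))))
          where
          w≡b₂xx₀⁻¹ : a₂ ⁻¹ · a₁ · b₁ ≡ b₂ · (x · x₀ ⁻¹)
          w≡b₂xx₀⁻¹ = begin
            a₂ ⁻¹ · a₁ · b₁                     ≡⟨ assoc _ a₁ b₁ ⟩
            a₂ ⁻¹ · (a₁ · b₁)                   ≡⟨ cong (a₂ ⁻¹ ·_) a₁b₁≡gx₀⁻¹ ⟩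
            a₂ ⁻¹ · (g · x₀ ⁻¹)
              ≡⟨ solve 4 (λ a g x x₀ → a ⁻ ⊗ (g ⊗ x₀ ⁻) ⊜ a ⁻ ⊗ (g ⊗ x ⁻) ⊗ (x ⊗ x₀ ⁻)) refl a₂ g x x₀ ⟩
            a₂ ⁻¹ · (g · x ⁻¹) · (x · x₀ ⁻¹)    ≡⟨ cong (λ u → a₂ ⁻¹ · u · (x · x₀ ⁻¹)) a₂b₂≡gx⁻¹ ⟨
            a₂ ⁻¹ · (a₂ · b₂) · (x · x₀ ⁻¹)     ≡⟨ cong (_· (x · x₀ ⁻¹)) (\\-leftDividesʳ a₂ b₂) ⟩
            b₂ · (x · x₀ ⁻¹)                    ∎
            where open ≡-Reasoning
          conclude : a₂ ⁻¹ · a₁ · b₁ ∈ X ⊎ a₂ ⁻¹ · a₁ · b₁ ∈ Y → x · x₀ ⁻¹ ∈ X ∩ Y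
          conclude (inj₂ w∈Y) = x∈p∩q⁺ (X.·⁻¹∈ x∈X x₀∈X , Y.∈-cancelˡ b₂∈Y (subst (_∈ Y) w≡b₂xx₀⁻¹ w∈Y))
          conclude (inj₁ w∈X) = ⊥-elim (g∉X (subst (_∈ X) (trans (cong (_· x₀) a₁b₁≡gx₀⁻¹) (//-rightDividesˡ x₀ g))
                                                    (X.·∈ (X.·∈ a₁∈X b₁∈X) x₀∈X)))
            where
            b₁∈X : b₁ ∈ X
            b₁∈X = X.∈-cancelˡ (X.⁻¹·∈ a₂∈X a₁∈X) w∈X

      fibre-bound : ∀ g → f g + 𝟙 X g * ∣ X ∩ Y ∣ ≤ 𝟙 X g * ∣ X ∣ + 𝟙 XYX g * ∣ X ∩ Y ∣
      fibre-bound g with g ∈? X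
      ... | yes g∈X = begin
        f g + 𝟙 X g * ∣ X ∩ Y ∣            ≡⟨ cong (λ i → f g + i * ∣ X ∩ Y ∣) (𝟙-∈ g∈X) ⟩
        f g + 1 * ∣ X ∩ Y ∣                ≤⟨ +-monoˡ-≤ _ (begin
          f g
            ≤⟨ sum-mono-≤ {f = term g} (λ x → 𝟙*𝟙≤𝟙 {S = X} {X ⋆ Y} {X} {x} {g · x ⁻¹} (λ x∈X _ → x∈X)) ⟩
          ∑ (𝟙 X)                            ≡⟨ ∣∣≡∑𝟙 X ⟨
          ∣ X ∣                              ≡⟨ *-identityˡ _ ⟨
          1 * ∣ X ∣                          ∎) ⟩
        1 * ∣ X ∣ + 1 * ∣ X ∩ Y ∣          ≡⟨ cong₂ (λ i j → i * ∣ X ∣ + j * ∣ X ∩ Y ∣) (𝟙-∈ g∈X) (𝟙-∈ (X⊆XYX g∈X)) ⟨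
        𝟙 X g * ∣ X ∣ + 𝟙 XYX g * ∣ X ∩ Y ∣ ∎
        where open ≤-Reasoning
      ... | no g∉X with g ∈? XYX
      ...   | no g∉XYX = begin
        f g + 𝟙 X g * ∣ X ∩ Y ∣            ≡⟨ cong (λ i → f g + i * ∣ X ∩ Y ∣) (𝟙-∉ g∉X) ⟩
        f g + 0                            ≡⟨ +-identityʳ _ ⟩
        f g
          ≡⟨ sum-cong-≗ {x = term g} (λ x → 𝟙*𝟙≡0 {S = X} {X ⋆ Y} {x} {g · x ⁻¹} λ x∈X gx⁻¹∈XY →
               g∉XYX (subst (_∈ XYX) (//-rightDividesˡ x g) (∈⋆⁺ gx⁻¹∈XY x∈X))) ⟩
        ∑ (λ _ → 0)                        ≡⟨ trans (sum-const order 0) (*-zeroʳ order) ⟩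
        0                                  ≤⟨ z≤n ⟩
        𝟙 X g * ∣ X ∣ + 𝟙 XYX g * ∣ X ∩ Y ∣ ∎
        where open ≤-Reasoning
      ...   | yes g∈XYX with ∈⋆⁻ g∈XYX
      ...     | s , x₀ , s∈XY , x₀∈X , refl = begin
        f g + 𝟙 X g * ∣ X ∩ Y ∣            ≡⟨ cong (λ i → f g + i * ∣ X ∩ Y ∣) (𝟙-∉ g∉X) ⟩
        f g + 0                            ≡⟨ +-identityʳ _ ⟩
        f g
          ≤⟨ sum-mono-≤ {f = term (s · x₀)} (λ x → 𝟙*𝟙≤𝟙 {S = X} {X ⋆ Y} {X ∩ Y} {x} {s · x₀ · x ⁻¹} λ x∈X gx⁻¹∈XY →
               same-fibre g∉X x₀∈X gx₀⁻¹∈XY x∈X gx⁻¹∈XY) ⟩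
        ∑ (λ x → 𝟙 (X ∩ Y) (x · x₀ ⁻¹))    ≡⟨ ∑-translateʳ (𝟙 (X ∩ Y)) (x₀ ⁻¹) ⟩
        ∑ (𝟙 (X ∩ Y))                      ≡⟨ ∣∣≡∑𝟙 (X ∩ Y) ⟨
        ∣ X ∩ Y ∣                          ≡⟨ *-identityˡ _ ⟨
        1 * ∣ X ∩ Y ∣                      ≡⟨ cong₂ (λ i j → i * ∣ X ∣ + j * ∣ X ∩ Y ∣) (𝟙-∉ g∉X) (𝟙-∈ g∈XYX) ⟨
        𝟙 X g * ∣ X ∣ + 𝟙 XYX g * ∣ X ∩ Y ∣ ∎
        where
        open ≤-Reasoning
        gx₀⁻¹∈XY : s · x₀ · x₀ ⁻¹ ∈ X ⋆ Y
        gx₀⁻¹∈XY = subst (_∈ X ⋆ Y) (sym (//-rightDividesʳ x₀ s)) s∈XY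

    double-coset-bound : ∣ X ∣ * ∣ X ⋆ Y ∣ + ∣ X ∣ * ∣ X ∩ Y ∣ ≤ ∣ X ∣ * ∣ X ∣ + ∣ (X ⋆ Y) ⋆ X ∣ * ∣ X ∩ Y ∣
    double-coset-bound = begin
      ∣ X ∣ * ∣ X ⋆ Y ∣ + ∣ X ∣ * ∣ X ∩ Y ∣                      ≡⟨ cong₂ _+_ ∑f (∑𝟙·c X _) ⟨
      ∑ f + ∑ (λ g → 𝟙 X g * ∣ X ∩ Y ∣)                          ≡⟨ ∑-distrib-+ f (λ g → 𝟙 X g * ∣ X ∩ Y ∣) ⟨
      ∑ (λ g → f g + 𝟙 X g * ∣ X ∩ Y ∣)                          ≤⟨ sum-mono-≤ fibre-bound ⟩
      ∑ (λ g → 𝟙 X g * ∣ X ∣ + 𝟙 XYX g * ∣ X ∩ Y ∣)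
        ≡⟨ ∑-distrib-+ (λ g → 𝟙 X g * ∣ X ∣) (λ g → 𝟙 XYX g * ∣ X ∩ Y ∣) ⟩
      ∑ (λ g → 𝟙 X g * ∣ X ∣) + ∑ (λ g → 𝟙 XYX g * ∣ X ∩ Y ∣)    ≡⟨ cong₂ _+_ (∑𝟙·c X _) (∑𝟙·c XYX _) ⟩
      ∣ X ∣ * ∣ X ∣ + ∣ XYX ∣ * ∣ X ∩ Y ∣                        ∎
      where open ≤-Reasoning

  index≥2 : ∀ {K H} → IsSubgroup K → IsSubgroup H → K ⊆ H → ∀ {g} → g ∈ H → g ∉ K → ∣ K ∣ + ∣ K ∣ ≤ ∣ H ∣
  index≥2 {K} {H} K≤G H≤G K⊆H {g} g∈H g∉K = begin
    ∣ K ∣ + ∣ K ∣                            ≡⟨ cong₂ _+_ (∣∣≡∑𝟙 K) (trans (∣∣≡∑𝟙 K) (sym (∑-translateʳ (𝟙 K) (g ⁻¹)))) ⟩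
    ∑ (𝟙 K) + ∑ (λ x → 𝟙 K (x · g ⁻¹))      ≡⟨ ∑-distrib-+ (𝟙 K) (λ x → 𝟙 K (x · g ⁻¹)) ⟨
    ∑ (λ x → 𝟙 K x + 𝟙 K (x · g ⁻¹))        ≤⟨ sum-mono-≤ two-cosets ⟩
    ∑ (𝟙 H)                                  ≡⟨ ∣∣≡∑𝟙 H ⟨
    ∣ H ∣                                    ∎
    where
    open ≤-Reasoning
    module K = Subgroup K≤G
    module H = Subgroup H≤G
    two-cosets : ∀ x → 𝟙 K x + 𝟙 K (x · g ⁻¹) ≤ 𝟙 H x
    two-cosets x with x ∈? K | x · g ⁻¹ ∈? K
    ... | yes x∈K | yes y∈K = ⊥-elim (g∉K (K.⁻¹∈⁻ (K.∈-cancelˡ x∈K y∈K)))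
    ... | yes x∈K | no y∉K  = ≤-reflexive (trans (cong₂ _+_ (𝟙-∈ x∈K) (𝟙-∉ y∉K)) (sym (𝟙-∈ (K⊆H x∈K))))
    ... | no x∉K  | yes y∈K = ≤-reflexive (trans (cong₂ _+_ (𝟙-∉ x∉K) (𝟙-∈ y∈K)) (sym (𝟙-∈ x∈H)))
      where
      x∈H : x ∈ H
      x∈H = H.∈-cancelʳ (H.⁻¹∈ g∈H) (K⊆H y∈K)
    ... | no x∉K  | no y∉K  = ≤-trans (≤-reflexive (cong₂ _+_ (𝟙-∉ x∉K) (𝟙-∉ y∉K))) z≤n

  -- Powers and p-groups

  private
    module Powers = MonoidPowers (Group.monoid group)

  infixl 8 _^ᵍ_
  _^ᵍ_ : El → ℕ → El
  x ^ᵍ i = i Powers.× x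

  ^ᵍ-+ : ∀ x i j → x ^ᵍ (i + j) ≡ x ^ᵍ i · x ^ᵍ j
  ^ᵍ-+ x i j = Powers.×-homo-+ x i j

  ^ᵍ-* : ∀ x i j → x ^ᵍ (i * j) ≡ x ^ᵍ j ^ᵍ i
  ^ᵍ-* x i j = sym (Powers.×-assocˡ x i j)

  ^ᵍ-1 : ∀ x → x ^ᵍ 1 ≡ x
  ^ᵍ-1 = idʳ

  e^ᵍ : ∀ i → e ^ᵍ i ≡ e
  e^ᵍ zero    = refl
  e^ᵍ (suc i) = trans (idˡ _) (e^ᵍ i)

  ^ᵍ-multiple : ∀ x {m} i → x ^ᵍ m ≡ e → x ^ᵍ (i * m) ≡ e
  ^ᵍ-multiple x {m} i xᵐ≡e = trans (^ᵍ-* x i m) (trans (cong (_^ᵍ i) xᵐ≡e) (e^ᵍ i))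

  ^ᵍ-∈ : ∀ {S} → IsSubgroup S → ∀ {x} → x ∈ S → ∀ i → x ^ᵍ i ∈ S
  ^ᵍ-∈ S≤G x∈S zero    = Subgroup.e∈ S≤G
  ^ᵍ-∈ S≤G x∈S (suc i) = Subgroup.·∈ S≤G x∈S (^ᵍ-∈ S≤G x∈S i)

  ^ᵍ-distrib-commuting : ∀ x y → x · y ≡ y · x → ∀ i → (x · y) ^ᵍ i ≡ x ^ᵍ i · y ^ᵍ i
  ^ᵍ-distrib-commuting x y xy≡yx zero    = sym (idˡ e)
  ^ᵍ-distrib-commuting x y xy≡yx (suc i) = begin
    x · y · (x · y) ^ᵍ i       ≡⟨ cong (x · y ·_) (^ᵍ-distrib-commuting x y xy≡yx i) ⟩
    x · y · (x ^ᵍ i · y ^ᵍ i)  ≡⟨ solve 4 (λ x y a b → x ⊗ y ⊗ (a ⊗ b) ⊜ x ⊗ (y ⊗ a) ⊗ b) refl x y _ _ ⟩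
    x · (y · x ^ᵍ i) · y ^ᵍ i  ≡⟨ cong (λ z → x · z · y ^ᵍ i) (y-commutes i) ⟩
    x · (x ^ᵍ i · y) · y ^ᵍ i  ≡⟨ solve 4 (λ x y a b → x ⊗ (a ⊗ y) ⊗ b ⊜ x ⊗ a ⊗ (y ⊗ b)) refl x y _ _ ⟩
    x · x ^ᵍ i · (y · y ^ᵍ i)  ∎
    where
    open ≡-Reasoning
    y-commutes : ∀ i → y · x ^ᵍ i ≡ x ^ᵍ i · y
    y-commutes zero    = trans (idʳ y) (sym (idˡ y))
    y-commutes (suc i) = begin
      y · (x · x ^ᵍ i)  ≡⟨ assoc y x _ ⟨
      y · x · x ^ᵍ i    ≡⟨ cong (_· x ^ᵍ i) (sym xy≡yx) ⟩
      x · y · x ^ᵍ i    ≡⟨ assoc x y _ ⟩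
      x · (y · x ^ᵍ i)  ≡⟨ cong (x ·_) (y-commutes i) ⟩
      x · (x ^ᵍ i · y)  ≡⟨ assoc x _ y ⟨
      x · x ^ᵍ i · y    ∎

  finite-order : ∀ x → ∃ λ m → 0 < m × x ^ᵍ m ≡ e
  finite-order x with pigeonhole (n<1+n order) (λ (i : Fin (suc order)) → x ^ᵍ toℕ i)
  ... | i , j , i<j , xⁱ≡xʲ = toℕ j ∸ toℕ i , m<n⇒0<n∸m i<j , ∙-cancelˡ (x ^ᵍ toℕ i) _ _ (begin
    x ^ᵍ toℕ i · x ^ᵍ (toℕ j ∸ toℕ i)  ≡⟨ ^ᵍ-+ x (toℕ i) _ ⟨
    x ^ᵍ (toℕ i + (toℕ j ∸ toℕ i))     ≡⟨ cong (x ^ᵍ_) (m+[n∸m]≡n (<⇒≤ i<j)) ⟩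
    x ^ᵍ toℕ j                          ≡⟨ xⁱ≡xʲ ⟨
    x ^ᵍ toℕ i                          ≡⟨ idʳ _ ⟨
    x ^ᵍ toℕ i · e                      ∎)
    where open ≡-Reasoning

  PrimeOrderElement : SubsetG → Set
  PrimeOrderElement S = ∃₂ λ u p → Prime p × u ∈ S × u ≢ e × u ^ᵍ p ≡ e

  prime-order-element : ∀ {S} → IsSubgroup S → ∀ {x} → x ∈ S → x ≢ e → PrimeOrderElement S
  prime-order-element {S} S≤G {x} x∈S x≢e with finite-order x
  ... | m , 0<m , xᵐ≡e = <-rec P descend m x∈S x≢e 0<m xᵐ≡e
    where
    P : ℕ → Set
    P m = ∀ {x} → x ∈ S → x ≢ e → 0 < m → x ^ᵍ m ≡ e → PrimeOrderElement S
    descend : ∀ m → (∀ {d} → d < m → P d) → P m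
    descend (suc zero)        _   {x} _   x≢e _   x¹≡e = ⊥-elim (x≢e (trans (sym (^ᵍ-1 x)) x¹≡e))
    descend m@(suc (suc _)) rec {x} x∈S x≢e 0<m xᵐ≡e with composite? m
    ... | no ¬composite = x , m , prime ¬composite , x∈S , x≢e , xᵐ≡e
    ... | yes (composite {d} d<m (divides q m≡q*d)) with x ^ᵍ d ≟ᶠ e
    ...   | yes xᵈ≡e = rec d<m x∈S x≢e (<-trans z<s (nonTrivial⇒n>1 d)) xᵈ≡e
    ...   | no xᵈ≢e  = rec q<m (^ᵍ-∈ S≤G x∈S d) xᵈ≢e 0<q
                           (trans (sym (^ᵍ-* x q d)) (trans (cong (x ^ᵍ_) (sym m≡q*d)) xᵐ≡e))
      where
      0<q : 0 < q
      0<q = n≢0⇒n>0 λ { refl → 1+n≢0 m≡q*d }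
      q<m : q < m
      q<m = subst (q <_) (sym m≡q*d) (m<m*n q d {{>-nonZero 0<q}} (nonTrivial⇒n>1 d))

  prime-power-∈ : ∀ {S} → IsSubgroup S → ∀ {p} → Prime p → ∀ {u d} → u ^ᵍ p ≡ e → 0 < d → d < p → u ^ᵍ d ∈ S → u ∈ S
  prime-power-∈ {S} S≤G {p} p-prime {u} {d} uᵖ≡e 0<d d<p uᵈ∈S
    with coprime-Bézout (Coprimality.sym (prime⇒coprime p-prime {{>-nonZero 0<d}} d<p))
  ... | Bézout.+- i j 1+jp≡id = subst (_∈ S) (begin
    u ^ᵍ d ^ᵍ i           ≡⟨ ^ᵍ-* u i d ⟨
    u ^ᵍ (i * d)          ≡⟨ cong (u ^ᵍ_) 1+jp≡id ⟨
    u ^ᵍ (1 + j * p)      ≡⟨ ^ᵍ-+ u 1 (j * p) ⟩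
    u ^ᵍ 1 · u ^ᵍ (j * p) ≡⟨ cong₂ _·_ (^ᵍ-1 u) (^ᵍ-multiple u j uᵖ≡e) ⟩
    u · e                 ≡⟨ idʳ u ⟩
    u                     ∎) (^ᵍ-∈ S≤G uᵈ∈S i)
    where open ≡-Reasoning
  ... | Bézout.-+ i j 1+id≡jp = subst (_∈ S) (begin
    (u ^ᵍ d ^ᵍ i) ⁻¹      ≡⟨ cong _⁻¹ (inverseʳ-unique u _ u·uⁱᵈ≡e) ⟩
    u ⁻¹ ⁻¹               ≡⟨ ⁻¹-involutive u ⟩
    u                     ∎) (Subgroup.⁻¹∈ S≤G (^ᵍ-∈ S≤G uᵈ∈S i))
    where
    open ≡-Reasoning
    u·uⁱᵈ≡e : u · u ^ᵍ d ^ᵍ i ≡ e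
    u·uⁱᵈ≡e = begin
      u · u ^ᵍ d ^ᵍ i          ≡⟨ cong₂ _·_ (^ᵍ-1 u) (^ᵍ-* u i d) ⟨
      u ^ᵍ 1 · u ^ᵍ (i * d)    ≡⟨ ^ᵍ-+ u 1 (i * d) ⟨
      u ^ᵍ (1 + i * d)         ≡⟨ cong (u ^ᵍ_) 1+id≡jp ⟩
      u ^ᵍ (j * p)             ≡⟨ ^ᵍ-multiple u j uᵖ≡e ⟩
      e                        ∎

  ⁅e⁆≤G : IsSubgroup ⁅ e ⁆
  ⁅e⁆≤G = x∈⁅x⁆ e
        , (λ x y x∈ y∈ → subst (_∈ ⁅ e ⁆) (sym (trans (cong₂ _·_ (x∈⁅y⁆⇒x≡y e x∈) (x∈⁅y⁆⇒x≡y e y∈)) (idˡ e))) (x∈⁅x⁆ e))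
        , (λ x x∈ → subst (_∈ ⁅ e ⁆) (sym (trans (cong _⁻¹ (x∈⁅y⁆⇒x≡y e x∈)) ε⁻¹≈ε)) (x∈⁅x⁆ e))

  module _ {T : SubsetG} (T≤G : IsSubgroup T) (T-abelian : ∀ {x y} → x ∈ T → y ∈ T → x · y ≡ y · x)
           {p} (p-prime : Prime p) (T-exponent : ∀ {x} → x ∈ T → x ^ᵍ p ≡ e) where

    private
      instance
        p-nonZero : NonZero p
        p-nonZero = prime⇒nonZero p-prime

      module T = Subgroup T≤G

    module Extension {H : SubsetG} (H≤G : IsSubgroup H) (H⊆T : H ⊆ T) {t} (t∈T : t ∈ T) (t∉H : t ∉ H) where
      private
        module H = Subgroup H≤G

        a : Fin p → El
        a i = t ^ᵍ toℕ i

      H⟨t⟩ : SubsetG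
      H⟨t⟩ = subsetOf (λ g → any? (λ i → g · a i ∈? H))

      ∈H⟨t⟩⁺ : ∀ {g} m → g · t ^ᵍ m ∈ H → g ∈ H⟨t⟩
      ∈H⟨t⟩⁺ {g} m gtᵐ∈H = ∈subsetOf⁺ (λ g → any? (λ i → g · a i ∈? H)) (i , subst (λ x → g · x ∈ H) tᵐ≡aᵢ gtᵐ∈H)
        where
        i : Fin p
        i = fromℕ< (m%n<n m p)
        tᵐ≡aᵢ : t ^ᵍ m ≡ a i
        tᵐ≡aᵢ = begin
          t ^ᵍ m                              ≡⟨ cong (t ^ᵍ_) (m≡m%n+[m/n]*n m p) ⟩
          t ^ᵍ (m % p + m / p * p)            ≡⟨ ^ᵍ-+ t (m % p) _ ⟩
          t ^ᵍ (m % p) · t ^ᵍ (m / p * p)     ≡⟨ cong (t ^ᵍ (m % p) ·_) (^ᵍ-multiple t (m / p) (T-exponent t∈T)) ⟩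
          t ^ᵍ (m % p) · e                    ≡⟨ idʳ _ ⟩
          t ^ᵍ (m % p)                        ≡⟨ cong (t ^ᵍ_) (toℕ-fromℕ< (m%n<n m p)) ⟨
          a i                                 ∎
          where open ≡-Reasoning

      ∈H⟨t⟩⁻ : ∀ {g} → g ∈ H⟨t⟩ → ∃ λ i → g · a i ∈ H
      ∈H⟨t⟩⁻ = ∈subsetOf⁻ (λ g → any? (λ i → g · a i ∈? H))

      private
        tᵏ∈T : ∀ m → t ^ᵍ m ∈ T
        tᵏ∈T = ^ᵍ-∈ T≤G t∈T

        no-two-indices : ∀ {g} (i j : Fin p) → toℕ i < toℕ j → g · a i ∈ H → g · a j ∈ H → ⊥
        no-two-indices {g} i j i<j gaᵢ∈H gaⱼ∈H =
          t∉H (prime-power-∈ H≤G p-prime (T-exponent t∈T) (m<n⇒0<n∸m i<j) d<p (subst (_∈ H) quotient (H.⁻¹·∈ gaᵢ∈H gaⱼ∈H)))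
          where
          d = toℕ j ∸ toℕ i
          d<p : d < p
          d<p = ≤-<-trans (m∸n≤m (toℕ j) (toℕ i)) (toℕ<n j)
          quotient : (g · a i) ⁻¹ · (g · a j) ≡ t ^ᵍ d
          quotient = begin
            (g · a i) ⁻¹ · (g · a j)                 ≡⟨ cong (λ x → (g · a i) ⁻¹ · (g · t ^ᵍ x)) (m+[n∸m]≡n (<⇒≤ i<j)) ⟨
            (g · a i) ⁻¹ · (g · t ^ᵍ (toℕ i + d))    ≡⟨ cong (λ x → (g · a i) ⁻¹ · (g · x)) (^ᵍ-+ t (toℕ i) d) ⟩
            (g · a i) ⁻¹ · (g · (a i · t ^ᵍ d))
              ≡⟨ solve 3 (λ g a x → (g ⊗ a) ⁻ ⊗ (g ⊗ (a ⊗ x)) ⊜ x) refl g (a i) (t ^ᵍ d) ⟩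
            t ^ᵍ d                                   ∎
            where open ≡-Reasoning

        unique-index : ∀ {g} (i j : Fin p) → g · a i ∈ H → g · a j ∈ H → i ≡ j
        unique-index i j gaᵢ∈H gaⱼ∈H with <-cmp (toℕ i) (toℕ j)
        ... | tri< i<j _ _ = ⊥-elim (no-two-indices i j i<j gaᵢ∈H gaⱼ∈H)
        ... | tri≈ _ i≡j _ = toℕ-injective i≡j
        ... | tri> _ _ j<i = ⊥-elim (no-two-indices j i j<i gaⱼ∈H gaᵢ∈H)

        𝟙H⟨t⟩ : ∀ g → 𝟙 H⟨t⟩ g ≡ sum (λ i → 𝟙 H (g · a i))
        𝟙H⟨t⟩ g with g ∈? H⟨t⟩
        ... | yes g∈ with ∈H⟨t⟩⁻ g∈
        ...   | i₀ , gaᵢ₀∈H = begin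
          𝟙 H⟨t⟩ g                 ≡⟨ 𝟙-∈ g∈ ⟩
          1                        ≡⟨ ∣⁅x⁆∣≡1 i₀ ⟨
          ∣ ⁅ i₀ ⁆ ∣               ≡⟨ ∣∣≡∑𝟙 ⁅ i₀ ⁆ ⟩
          sum (𝟙 ⁅ i₀ ⁆)           ≡⟨ sum-cong-≗ (λ i → 𝟙-⇔ (λ i∈ → subst (λ j → g · a j ∈ H) (sym (x∈⁅y⁆⇒x≡y i₀ i∈)) gaᵢ₀∈H)
                                                          (λ gaᵢ∈H → subst (_∈ ⁅ i₀ ⁆) (unique-index i₀ i gaᵢ₀∈H gaᵢ∈H) (x∈⁅x⁆ i₀))) ⟩
          sum (λ i → 𝟙 H (g · a i)) ∎
          where open ≡-Reasoning
        𝟙H⟨t⟩ g | no g∉ = begin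
          𝟙 H⟨t⟩ g                  ≡⟨ 𝟙-∉ g∉ ⟩
          0                         ≡⟨ *-zeroʳ p ⟨
          p * 0                     ≡⟨ sum-const p 0 ⟨
          sum {p} (λ _ → 0)         ≡⟨ sum-cong-≗ (λ (i : Fin p) → sym (𝟙-∉ λ gaᵢ∈H → g∉ (∈H⟨t⟩⁺ (toℕ i) gaᵢ∈H))) ⟩
          sum (λ i → 𝟙 H (g · a i)) ∎
          where open ≡-Reasoning

      ∣H⟨t⟩∣≡p∣H∣ : ∣ H⟨t⟩ ∣ ≡ p * ∣ H ∣
      ∣H⟨t⟩∣≡p∣H∣ = begin
        ∣ H⟨t⟩ ∣                              ≡⟨ ∣∣≡∑𝟙 H⟨t⟩ ⟩
        ∑ (𝟙 H⟨t⟩)                             ≡⟨ sum-cong-≗ 𝟙H⟨t⟩ ⟩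
        ∑ (λ g → sum (λ i → 𝟙 H (g · a i)))   ≡⟨ ∑-comm (λ g i → 𝟙 H (g · a i)) ⟩
        sum (λ i → ∑ (λ g → 𝟙 H (g · a i)))   ≡⟨ sum-cong-≗ (λ i → trans (∑-translateʳ (𝟙 H) (a i)) (sym (∣∣≡∑𝟙 H))) ⟩
        sum {p} (λ _ → ∣ H ∣)                  ≡⟨ sum-const p ∣ H ∣ ⟩
        p * ∣ H ∣                              ∎
        where open ≡-Reasoning

      H⟨t⟩⊆T : H⟨t⟩ ⊆ T
      H⟨t⟩⊆T g∈ with ∈H⟨t⟩⁻ g∈
      ... | i , gaᵢ∈H = T.∈-cancelʳ (tᵏ∈T (toℕ i)) (H⊆T gaᵢ∈H)

      H⟨t⟩≤G : IsSubgroup H⟨t⟩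
      H⟨t⟩≤G = ∈H⟨t⟩⁺ 0 (subst (_∈ H) (sym (idˡ e)) H.e∈) , product , inverse
        where
        product : ∀ g h → g ∈ H⟨t⟩ → h ∈ H⟨t⟩ → g · h ∈ H⟨t⟩
        product g h g∈ h∈ with ∈H⟨t⟩⁻ g∈ | ∈H⟨t⟩⁻ h∈
        ... | i , gaᵢ∈H | j , haⱼ∈H = ∈H⟨t⟩⁺ (toℕ i + toℕ j) (subst (_∈ H) (sym regroup) (H.·∈ gaᵢ∈H haⱼ∈H))
          where
          regroup : g · h · t ^ᵍ (toℕ i + toℕ j) ≡ g · a i · (h · a j)
          regroup = begin
            g · h · t ^ᵍ (toℕ i + toℕ j)  ≡⟨ cong (g · h ·_) (^ᵍ-+ t (toℕ i) (toℕ j)) ⟩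
            g · h · (a i · a j)           ≡⟨ solve 4 (λ g h x y → g ⊗ h ⊗ (x ⊗ y) ⊜ g ⊗ (h ⊗ x) ⊗ y) refl g h (a i) (a j) ⟩
            g · (h · a i) · a j           ≡⟨ cong (λ x → g · x · a j) (T-abelian (H⟨t⟩⊆T h∈) (tᵏ∈T (toℕ i))) ⟩
            g · (a i · h) · a j           ≡⟨ solve 4 (λ g h x y → g ⊗ (x ⊗ h) ⊗ y ⊜ g ⊗ x ⊗ (h ⊗ y)) refl g h (a i) (a j) ⟩
            g · a i · (h · a j)           ∎
            where open ≡-Reasoning
        inverse : ∀ g → g ∈ H⟨t⟩ → g ⁻¹ ∈ H⟨t⟩
        inverse g g∈ with ∈H⟨t⟩⁻ g∈
        ... | i , gaᵢ∈H = ∈H⟨t⟩⁺ (toℕ i * (p ∸ 1)) (subst (_∈ H) (sym flip) (H.⁻¹∈ gaᵢ∈H))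
          where
          aᵢ⁻¹ : t ^ᵍ (toℕ i * (p ∸ 1)) ≡ a i ⁻¹
          aᵢ⁻¹ = inverseʳ-unique (a i) _ (begin
            a i · t ^ᵍ (toℕ i * (p ∸ 1))       ≡⟨ ^ᵍ-+ t (toℕ i) _ ⟨
            t ^ᵍ (toℕ i + toℕ i * (p ∸ 1))     ≡⟨ cong (t ^ᵍ_) (solve-mult (toℕ i)) ⟩
            t ^ᵍ (toℕ i * p)                   ≡⟨ ^ᵍ-multiple t (toℕ i) (T-exponent t∈T) ⟩
            e                                  ∎)
            where
            open ≡-Reasoning
            solve-mult : ∀ m → m + m * (p ∸ 1) ≡ m * p
            solve-mult m = trans (cong (m +_) (*-distribˡ-∸ m p 1)) (trans (cong (λ x → m + (m * p ∸ x)) (*-identityʳ m))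
                             (m+[n∸m]≡n (subst (_≤ m * p) (*-identityʳ m) (*-monoʳ-≤ m (>-nonZero⁻¹ p)))))
          flip : g ⁻¹ · t ^ᵍ (toℕ i * (p ∸ 1)) ≡ (g · a i) ⁻¹
          flip = begin
            g ⁻¹ · t ^ᵍ (toℕ i * (p ∸ 1))  ≡⟨ cong (g ⁻¹ ·_) aᵢ⁻¹ ⟩
            g ⁻¹ · a i ⁻¹                  ≡⟨ T-abelian (T.⁻¹∈ (H⟨t⟩⊆T g∈)) (T.⁻¹∈ (tᵏ∈T (toℕ i))) ⟩
            a i ⁻¹ · g ⁻¹                  ≡⟨ ⁻¹-anti-homo-∙ g (a i) ⟨
            (g · a i) ⁻¹                   ∎
            where open ≡-Reasoning

    private
      grow : ∀ slack {H} → IsSubgroup H → H ⊆ T → ∀ j → ∣ H ∣ ≡ p ^ j → ∣ T ∣ ≤ ∣ H ∣ + slack → ∃ λ r → ∣ T ∣ ≡ p ^ r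
      grow slack {H} H≤G H⊆T j ∣H∣≡pʲ ∣T∣≤ with ∣ H ∣ <? ∣ T ∣
      ... | no ∣H∣≮∣T∣ = j , trans (≤-antisym (≮⇒≥ ∣H∣≮∣T∣) (p⊆q⇒∣p∣≤∣q∣ H⊆T)) ∣H∣≡pʲ
      ... | yes ∣H∣<∣T∣ with ∣∣<⇒∃∈∖ ∣H∣<∣T∣ | slack | ∣T∣≤
      ...   | _ , _ , _       | zero      | ∣T∣≤∣H∣ = ⊥-elim (<⇒≱ ∣H∣<∣T∣ (subst (∣ T ∣ ≤_) (+-identityʳ _) ∣T∣≤∣H∣))
      ...   | t , t∈T , t∉H   | suc slack | ∣T∣≤ =
        grow slack E.H⟨t⟩≤G E.H⟨t⟩⊆T (suc j) (trans E.∣H⟨t⟩∣≡p∣H∣ (cong (p *_) ∣H∣≡pʲ)) (begin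
          ∣ T ∣                  ≤⟨ ∣T∣≤ ⟩
          ∣ H ∣ + suc slack      ≡⟨ +-suc ∣ H ∣ slack ⟩
          suc ∣ H ∣ + slack      ≤⟨ +-monoˡ-≤ slack ∣H∣<∣H⟨t⟩∣ ⟩
          ∣ E.H⟨t⟩ ∣ + slack     ∎)
        where
        open ≤-Reasoning
        module E = Extension H≤G H⊆T t∈T t∉H
        ∣H∣<∣H⟨t⟩∣ : ∣ H ∣ < ∣ E.H⟨t⟩ ∣
        ∣H∣<∣H⟨t⟩∣ = subst (∣ H ∣ <_) (sym E.∣H⟨t⟩∣≡p∣H∣)
          (subst (_< p * ∣ H ∣) (*-identityˡ _)
            (*-monoˡ-< ∣ H ∣ {{>-nonZero (∈⇒∣∣>0 (Subgroup.e∈ H≤G))}} (nonTrivial⇒n>1 p {{prime⇒nonTrivial p-prime}})))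

    p-group : ∃ λ r → ∣ T ∣ ≡ p ^ r
    p-group = grow ∣ T ∣ ⁅e⁆≤G (λ x∈ → subst (_∈ T) (sym (x∈⁅y⁆⇒x≡y e x∈)) T.e∈) 0 (∣⁅x⁆∣≡1 e) (m≤n+m ∣ T ∣ ∣ ⁅ e ⁆ ∣)

divisor-of-prime-power : ∀ {p} → Prime p → ∀ r {d} → d ∣ p ^ r → ∃ λ j → d ≡ p ^ j
divisor-of-prime-power p-prime zero    {d} d∣1 = 0 , ∣1⇒≡1 d∣1
divisor-of-prime-power {p} p-prime (suc r) {d} d∣pʳ⁺¹ with p ∣? d
... | yes (divides q d≡qp) with divisor-of-prime-power p-prime r {q} (*-cancelʳ-∣ p {{prime⇒nonZero p-prime}} q·p∣pʳ·p)
  where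
  q·p∣pʳ·p : q * p ∣ p ^ r * p
  q·p∣pʳ·p = subst₂ _∣_ d≡qp (*-comm p (p ^ r)) d∣pʳ⁺¹
...   | j , q≡pʲ = suc j , trans d≡qp (trans (cong (_* p) q≡pʲ) (*-comm (p ^ j) p))
divisor-of-prime-power {p} p-prime (suc r) {d} d∣pʳ⁺¹ | no p∤d =
  divisor-of-prime-power p-prime r {d} (coprime-divisor d⊥p d∣pʳ⁺¹)
  where
  d⊥p : Coprime d p
  d⊥p (i∣d , i∣p) with prime⇒irreducible p-prime i∣p
  ... | inj₁ i≡1 = i≡1
  ... | inj₂ refl = ⊥-elim (p∤d i∣d)

-- Used with K = ∣Core∣ below: a subgroup of index at least two in BM cannot absorb the large double coset ABA.
no-index-two : ∀ n k K → 0 < n * k → n ^ 3 * k + n * k ≤ n ^ 2 * k + n * K → K + K ≤ n ^ 2 * k → ⊥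
no-index-two (suc m) k K nk>0 big small = m+1+n≰m (2 * n) {m * m} (begin
  2 * n + suc (m * m)
    ≡⟨ ring-solve 1 (λ m → con 2 :* (con 1 :+ m) :+ (con 1 :+ m :* m) := (con 1 :+ m) :^ 2 :+ con 2) refl m ⟩
  n ^ 2 + 2             ≤⟨ +-cancelˡ-≤ (n ^ 2) _ _ squares ⟩
  2 * n                 ∎)
  where
  open ≤-Reasoning
  n = suc m
  squares : n ^ 2 + (n ^ 2 + 2) ≤ n ^ 2 + 2 * n
  squares = *-cancelˡ-≤ (n * k) {{>-nonZero nk>0}} (begin
    n * k * (n ^ 2 + (n ^ 2 + 2))
      ≡⟨ ring-solve 2 (λ n k → n :* k :* (n :^ 2 :+ (n :^ 2 :+ con 2)) := con 2 :* (n :^ 3 :* k :+ n :* k)) refl n k ⟩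
    2 * (n ^ 3 * k + n * k)         ≤⟨ *-monoʳ-≤ 2 big ⟩
    2 * (n ^ 2 * k + n * K)
      ≡⟨ ring-solve 3 (λ n k K → con 2 :* (n :^ 2 :* k :+ n :* K) := con 2 :* (n :^ 2 :* k) :+ n :* (K :+ K)) refl n k K ⟩
    2 * (n ^ 2 * k) + n * (K + K)   ≤⟨ +-monoʳ-≤ (2 * (n ^ 2 * k)) (*-monoʳ-≤ n small) ⟩
    2 * (n ^ 2 * k) + n * (n ^ 2 * k)
      ≡⟨ ring-solve 2 (λ n k → con 2 :* (n :^ 2 :* k) :+ n :* (n :^ 2 :* k) := n :* k :* (n :^ 2 :+ con 2 :* n)) refl n k ⟩
    n * k * (n ^ 2 + 2 * n)         ∎)

record Standing (G : FinGroup) (A B M : Subset (FinGroup.order G)) (n : ℕ) : Set where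
  constructor standing
  open FinGroup G
  open GroupNotions G
  field
    n>1        : 1 < n
    A≤G        : IsSubgroup A
    B≤G        : IsSubgroup B
    M≤G        : IsSubgroup M
    ∣A∣≡nk     : ∣ A ∣ ≡ n * ∣ A ∩ B ∣
    ∣B∣≡nk     : ∣ B ∣ ≡ n * ∣ A ∩ B ∣
    ∣M∣≡nk     : ∣ M ∣ ≡ n * ∣ A ∩ B ∣
    ∣G∣≡n³k    : order ≡ n ^ 3 * ∣ A ∩ B ∣
    AM≤G       : IsSubgroup (A ⋆ M)
    BM≤G       : IsSubgroup (B ⋆ M)
    ∣AM∣≡n²k   : ∣ A ⋆ M ∣ ≡ n ^ 2 * ∣ A ∩ B ∣
    ∣BM∣≡n²k   : ∣ B ⋆ M ∣ ≡ n ^ 2 * ∣ A ∩ B ∣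
    G≡AMB      : ∀ g → g ∈ (A ⋆ M) ⋆ B
    AB∩BA≡A∪B  : ∀ g → (g ∈ A ⋆ B × g ∈ B ⋆ A) ⇔ (g ∈ A ⊎ g ∈ B)
    faithful   : Plane.Faithful G A B M
    ⟨Bᴬ⟩⊆BM    : ∀ g → ⟨ Conj B A ⟩ g → g ∈ B ⋆ M

module Setting {G : FinGroup} {A B M : Subset (FinGroup.order G)} {n : ℕ} (S : Standing G A B M n) where
  open Standing S
  open FinGroup G
  open GroupNotions G
  open GroupTheory G
  open Solver using (solve; _⊜_; _⊗_; _⁻; ι)
  open Plane G A B M

  k : ℕ
  k = ∣ A ∩ B ∣

  module A = Subgroup A≤G
  module B = Subgroup B≤G
  module M = Subgroup M≤G
  module AM = Subgroup AM≤G
  module BM = Subgroup BM≤G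

  k>0 : 0 < k
  k>0 = ∈⇒∣∣>0 (x∈p∩q⁺ (A.e∈ , B.e∈))

  n>0 : 0 < n
  n>0 = <-trans z<s n>1

  nk>0 : 0 < n * k
  nk>0 = *-mono-< n>0 k>0

  ∣G∣>0 : 0 < order
  ∣G∣>0 = ≤-<-trans z≤n (toℕ<n e)

  A⊆AM : A ⊆ AM
  A⊆AM {a} a∈A = subst (_∈ AM) (idʳ a) (∈⋆⁺ a∈A M.e∈)

  M⊆AM : M ⊆ AM
  M⊆AM {m} m∈M = subst (_∈ AM) (idˡ m) (∈⋆⁺ A.e∈ m∈M)

  B⊆BM : B ⊆ BM
  B⊆BM {b} b∈B = subst (_∈ BM) (idʳ b) (∈⋆⁺ b∈B M.e∈)

  M⊆BM : M ⊆ BM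
  M⊆BM {m} m∈M = subst (_∈ BM) (idˡ m) (∈⋆⁺ B.e∈ m∈M)

  A∩B⊆A : A ∩ B ⊆ A
  A∩B⊆A p = proj₁ (x∈p∩q⁻ A B p)

  A∩B⊆B : A ∩ B ⊆ B
  A∩B⊆B p = proj₂ (x∈p∩q⁻ A B p)

  G≡A·BM : ∀ g → g ∈ A ⋆ BM
  G≡A·BM g with ∈⋆⁻ (G≡AMB g)
  ... | x , b , x∈AM , b∈B , refl with ∈⋆⁻ x∈AM
  ...   | a , m , a∈A , m∈M , refl = subst (_∈ A ⋆ BM) (sym (assoc a m b)) (∈⋆⁺ a∈A (BM.·∈ (M⊆BM m∈M) (B⊆BM b∈B)))

  G≡B·AM : ∀ g → g ∈ B ⋆ AM
  G≡B·AM g with ∈⋆⁻ (G≡AMB (g ⁻¹))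
  ... | x , b , x∈AM , b∈B , xb≡g⁻¹ = subst (_∈ B ⋆ AM) b⁻¹x⁻¹≡g (∈⋆⁺ (B.⁻¹∈ b∈B) (AM.⁻¹∈ x∈AM))
    where
    b⁻¹x⁻¹≡g : b ⁻¹ · x ⁻¹ ≡ g
    b⁻¹x⁻¹≡g = trans (sym (⁻¹-anti-homo-∙ x b)) (trans (cong _⁻¹ xb≡g⁻¹) (⁻¹-involutive g))

  AB∩BA⊆A∪B : ∀ {g} → g ∈ A ⋆ B → g ∈ B ⋆ A → g ∈ A ⊎ g ∈ B
  AB∩BA⊆A∪B {g} p q = Equivalence.to (AB∩BA≡A∪B g) (p , q)

  intersection-size : ∀ {X Y} → IsSubgroup X → IsSubgroup Y → (∀ g → g ∈ X ⋆ Y) → ∣ X ∣ * ∣ Y ∣ ≡ order * k → ∣ X ∩ Y ∣ ≡ k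
  intersection-size {X} {Y} X≤G Y≤G XY≡G ∣X∣∣Y∣≡∣G∣k = *-cancelˡ-≡ _ _ order {{>-nonZero ∣G∣>0}} (begin
    order * ∣ X ∩ Y ∣       ≡⟨ cong (_* ∣ X ∩ Y ∣) (∀∈⇒∣∣≡m XY≡G) ⟨
    ∣ X ⋆ Y ∣ * ∣ X ∩ Y ∣   ≡⟨ product-formula X≤G Y≤G ⟩
    ∣ X ∣ * ∣ Y ∣           ≡⟨ ∣X∣∣Y∣≡∣G∣k ⟩
    order * k               ∎)
    where open ≡-Reasoning

  ∣A∩BM∣≡k : ∣ A ∩ BM ∣ ≡ k
  ∣A∩BM∣≡k = intersection-size A≤G BM≤G G≡A·BM (begin
    ∣ A ∣ * ∣ BM ∣            ≡⟨ cong₂ _*_ ∣A∣≡nk ∣BM∣≡n²k ⟩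
    n * k * (n ^ 2 * k)       ≡⟨ ring-solve 2 (λ n k → n :* k :* (n :^ 2 :* k) := n :^ 3 :* k :* k) refl n k ⟩
    n ^ 3 * k * k             ≡⟨ cong (_* k) ∣G∣≡n³k ⟨
    order * k                 ∎)
    where open ≡-Reasoning

  ∣AM∩B∣≡k : ∣ AM ∩ B ∣ ≡ k
  ∣AM∩B∣≡k = intersection-size AM≤G B≤G G≡AMB (begin
    ∣ AM ∣ * ∣ B ∣            ≡⟨ cong₂ _*_ ∣AM∣≡n²k ∣B∣≡nk ⟩
    n ^ 2 * k * (n * k)       ≡⟨ ring-solve 2 (λ n k → n :^ 2 :* k :* (n :* k) := n :^ 3 :* k :* k) refl n k ⟩
    n ^ 3 * k * k             ≡⟨ cong (_* k) ∣G∣≡n³k ⟨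
    order * k                 ∎)
    where open ≡-Reasoning

  A∩BM⊆B : ∀ {g} → g ∈ A → g ∈ BM → g ∈ B
  A∩BM⊆B g∈A g∈BM = A∩B⊆B (⊆∧∣∣≤⇒⊇ A∩B⊆A∩BM (≤-reflexive ∣A∩BM∣≡k) (x∈p∩q⁺ (g∈A , g∈BM)))
    where
    A∩B⊆A∩BM : A ∩ B ⊆ A ∩ BM
    A∩B⊆A∩BM p = x∈p∩q⁺ (A∩B⊆A p , B⊆BM (A∩B⊆B p))

  AM∩B⊆A : ∀ {g} → g ∈ AM → g ∈ B → g ∈ A
  AM∩B⊆A g∈AM g∈B = A∩B⊆A (⊆∧∣∣≤⇒⊇ A∩B⊆AM∩B (≤-reflexive ∣AM∩B∣≡k) (x∈p∩q⁺ (g∈AM , g∈B)))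
    where
    A∩B⊆AM∩B : A ∩ B ⊆ AM ∩ B
    A∩B⊆AM∩B p = x∈p∩q⁺ (A⊆AM (A∩B⊆A p) , A∩B⊆B p)

  ∣AB∣≡n²k : ∣ A ⋆ B ∣ ≡ n ^ 2 * k
  ∣AB∣≡n²k = *-cancelʳ-≡ _ _ k {{>-nonZero k>0}} (begin
    ∣ A ⋆ B ∣ * k       ≡⟨ product-formula A≤G B≤G ⟩
    ∣ A ∣ * ∣ B ∣       ≡⟨ cong₂ _*_ ∣A∣≡nk ∣B∣≡nk ⟩
    n * k * (n * k)     ≡⟨ ring-solve 2 (λ n k → n :* k :* (n :* k) := n :^ 2 :* k :* k) refl n k ⟩
    n ^ 2 * k * k       ∎)
    where open ≡-Reasoning

  ∣BA∣≡n²k : ∣ B ⋆ A ∣ ≡ n ^ 2 * k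
  ∣BA∣≡n²k = *-cancelʳ-≡ _ _ k {{>-nonZero k>0}} (begin
    ∣ B ⋆ A ∣ * k           ≡⟨ cong (∣ B ⋆ A ∣ *_) (cong ∣_∣ (∩-comm B A)) ⟨
    ∣ B ⋆ A ∣ * ∣ B ∩ A ∣   ≡⟨ product-formula B≤G A≤G ⟩
    ∣ B ∣ * ∣ A ∣           ≡⟨ cong₂ _*_ ∣B∣≡nk ∣A∣≡nk ⟩
    n * k * (n * k)         ≡⟨ ring-solve 2 (λ n k → n :* k :* (n :* k) := n :^ 2 :* k :* k) refl n k ⟩
    n ^ 2 * k * k           ∎)
    where open ≡-Reasoning

  -- Large double cosets

  module _ {X Y Z : SubsetG} (X≤G : IsSubgroup X) (Y≤G : IsSubgroup Y) (Z≤G : IsSubgroup Z)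
           (XY∩YX⊆X∪Y : ∀ {g} → g ∈ X ⋆ Y → g ∈ Y ⋆ X → g ∈ X ⊎ g ∈ Y)
           (X⊆Z : X ⊆ Z) (Z∩Y⊆X : ∀ {g} → g ∈ Z → g ∈ Y → g ∈ X)
           (∣X∣≡nk : ∣ X ∣ ≡ n * k) (∣XY∣≡n²k : ∣ X ⋆ Y ∣ ≡ n ^ 2 * k) (∣X∩Y∣≡k : ∣ X ∩ Y ∣ ≡ k) (∣Z∣≡n²k : ∣ Z ∣ ≡ n ^ 2 * k) where

    ∣XYX∣-bound : n ^ 3 * k + n * k ≤ n ^ 2 * k + ∣ (X ⋆ Y) ⋆ X ∣
    ∣XYX∣-bound = *-cancelʳ-≤ _ _ k {{>-nonZero k>0}} (begin
      (n ^ 3 * k + n * k) * k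
        ≡⟨ ring-solve 2 (λ n k → (n :^ 3 :* k :+ n :* k) :* k := n :* k :* (n :^ 2 :* k) :+ n :* k :* k) refl n k ⟩
      n * k * (n ^ 2 * k) + n * k * k                       ≡⟨ cong₂ (λ a b → a * b + a * k) ∣X∣≡nk ∣XY∣≡n²k ⟨
      ∣ X ∣ * ∣ X ⋆ Y ∣ + ∣ X ∣ * k                         ≡⟨ cong (λ c → ∣ X ∣ * ∣ X ⋆ Y ∣ + ∣ X ∣ * c) ∣X∩Y∣≡k ⟨
      ∣ X ∣ * ∣ X ⋆ Y ∣ + ∣ X ∣ * ∣ X ∩ Y ∣                 ≤⟨ double-coset-bound X≤G Y≤G XY∩YX⊆X∪Y ⟩
      ∣ X ∣ * ∣ X ∣ + ∣ (X ⋆ Y) ⋆ X ∣ * ∣ X ∩ Y ∣           ≡⟨ cong₂ (λ a c → a * a + ∣ (X ⋆ Y) ⋆ X ∣ * c) ∣X∣≡nk ∣X∩Y∣≡k ⟩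
      n * k * (n * k) + ∣ (X ⋆ Y) ⋆ X ∣ * k
        ≡⟨ cong (_+ ∣ (X ⋆ Y) ⋆ X ∣ * k) (ring-solve 2 (λ n k → n :* k :* (n :* k) := n :^ 2 :* k :* k) refl n k) ⟩
      n ^ 2 * k * k + ∣ (X ⋆ Y) ⋆ X ∣ * k                   ≡⟨ *-distribʳ-+ k (n ^ 2 * k) _ ⟨
      (n ^ 2 * k + ∣ (X ⋆ Y) ⋆ X ∣) * k                     ∎)
      where open ≤-Reasoning

    G≡Z∪XYX : ∀ g → g ∈ Z ⊎ g ∈ (X ⋆ Y) ⋆ X
    G≡Z∪XYX g = x∈p∪q⁻ Z ((X ⋆ Y) ⋆ X) (m≤∣∣⇒∈ (+-cancelʳ-≤ (n * k) order _ (begin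
      order + n * k                                         ≡⟨ cong (_+ n * k) ∣G∣≡n³k ⟩
      n ^ 3 * k + n * k                                     ≤⟨ ∣XYX∣-bound ⟩
      n ^ 2 * k + ∣ (X ⋆ Y) ⋆ X ∣                           ≡⟨ cong (_+ ∣ (X ⋆ Y) ⋆ X ∣) ∣Z∣≡n²k ⟨
      ∣ Z ∣ + ∣ (X ⋆ Y) ⋆ X ∣                               ≡⟨ ∣∪∣+∣∩∣ Z ((X ⋆ Y) ⋆ X) ⟨
      ∣ Z ∪ (X ⋆ Y) ⋆ X ∣ + ∣ Z ∩ (X ⋆ Y) ⋆ X ∣
        ≤⟨ +-monoʳ-≤ _ (subst (∣ Z ∩ (X ⋆ Y) ⋆ X ∣ ≤_) ∣X∣≡nk (p⊆q⇒∣p∣≤∣q∣ Z∩XYX⊆X)) ⟩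
      ∣ Z ∪ (X ⋆ Y) ⋆ X ∣ + n * k                           ∎)))
      where
      open ≤-Reasoning
      module X = Subgroup X≤G
      module Z = Subgroup Z≤G
      Z∩XYX⊆X : Z ∩ (X ⋆ Y) ⋆ X ⊆ X
      Z∩XYX⊆X p with x∈p∩q⁻ Z _ p
      ... | g∈Z , g∈XYX with ∈⋆⁻ g∈XYX
      ...   | s , x₂ , s∈XY , x₂∈X , refl with ∈⋆⁻ s∈XY
      ...     | x₁ , y , x₁∈X , y∈Y , refl = X.·∈ (X.·∈ x₁∈X (Z∩Y⊆X y∈Z y∈Y)) x₂∈X
        where
        y∈Z : y ∈ Z
        y∈Z = Z.∈-cancelˡ (X⊆Z x₁∈X) (Z.∈-cancelʳ (X⊆Z x₂∈X) g∈Z)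

  G≡AM∪ABA : ∀ g → g ∈ AM ⊎ g ∈ (A ⋆ B) ⋆ A
  G≡AM∪ABA = G≡Z∪XYX A≤G B≤G AM≤G AB∩BA⊆A∪B A⊆AM AM∩B⊆A ∣A∣≡nk ∣AB∣≡n²k refl ∣AM∣≡n²k

  G≡BM∪BAB : ∀ g → g ∈ BM ⊎ g ∈ (B ⋆ A) ⋆ B
  G≡BM∪BAB = G≡Z∪XYX B≤G A≤G BM≤G BA∩AB⊆B∪A B⊆BM (λ g∈BM g∈A → A∩BM⊆B g∈A g∈BM) ∣B∣≡nk ∣BA∣≡n²k (cong ∣_∣ (∩-comm B A)) ∣BM∣≡n²k
    where
    BA∩AB⊆B∪A : ∀ {g} → g ∈ B ⋆ A → g ∈ A ⋆ B → g ∈ B ⊎ g ∈ A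
    BA∩AB⊆B∪A p q = swap (AB∩BA⊆A∪B q p)

  ∣ABA∣-bound : n ^ 3 * k + n * k ≤ n ^ 2 * k + ∣ (A ⋆ B) ⋆ A ∣
  ∣ABA∣-bound = ∣XYX∣-bound A≤G B≤G AM≤G AB∩BA⊆A∪B A⊆AM AM∩B⊆A ∣A∣≡nk ∣AB∣≡n²k refl ∣AM∣≡n²k


  -- Normality of BM

  private
    InCore : El → Set
    InCore g = g ∈ BM × (∀ a → a ∈ A → a ⁻¹ · g · a ∈ BM)

    inCore? : Decidable InCore
    inCore? g = (g ∈? BM) ×-dec all? (λ a → (a ∈? A) →-dec (a ⁻¹ · g · a ∈? BM))

    -- Core = ⋂_{a ∈ A} a · BM · a⁻¹, the largest subgroup of BM normalised by A.
    Core : SubsetG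
    Core = subsetOf inCore?

    ∈Core⁺ : ∀ {g} → InCore g → g ∈ Core
    ∈Core⁺ = ∈subsetOf⁺ inCore?

    ∈Core⁻ : ∀ {g} → g ∈ Core → InCore g
    ∈Core⁻ = ∈subsetOf⁻ inCore?

    Core⊆BM : Core ⊆ BM
    Core⊆BM p = proj₁ (∈Core⁻ p)

    Core≤G : IsSubgroup Core
    Core≤G = ∈Core⁺ (BM.e∈ , λ a _ → subst (_∈ BM) (sym (solve 1 (λ a → a ⁻ ⊗ ι ⊗ a ⊜ ι) refl a)) BM.e∈)
           , (λ g h g∈ h∈ → ∈Core⁺ (BM.·∈ (Core⊆BM g∈) (Core⊆BM h∈) , λ a a∈A →
                subst (_∈ BM) (conj-· a g h) (BM.·∈ (proj₂ (∈Core⁻ g∈) a a∈A) (proj₂ (∈Core⁻ h∈) a a∈A))))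
           , (λ g g∈ → ∈Core⁺ (BM.⁻¹∈ (Core⊆BM g∈) , λ a a∈A →
                subst (_∈ BM) (conj-⁻¹ a g) (BM.⁻¹∈ (proj₂ (∈Core⁻ g∈) a a∈A))))
      where
      conj-· : ∀ a g h → a ⁻¹ · g · a · (a ⁻¹ · h · a) ≡ a ⁻¹ · (g · h) · a
      conj-· = solve 3 (λ a g h → a ⁻ ⊗ g ⊗ a ⊗ (a ⁻ ⊗ h ⊗ a) ⊜ a ⁻ ⊗ (g ⊗ h) ⊗ a) refl
      conj-⁻¹ : ∀ a g → (a ⁻¹ · g · a) ⁻¹ ≡ a ⁻¹ · g ⁻¹ · a
      conj-⁻¹ = solve 2 (λ a g → (a ⁻ ⊗ g ⊗ a) ⁻ ⊜ a ⁻ ⊗ g ⁻ ⊗ a) refl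

    B⊆Core : B ⊆ Core
    B⊆Core {b} b∈B = ∈Core⁺ (B⊆BM b∈B , λ a a∈A → ⟨Bᴬ⟩⊆BM _ (gen (a , b , a∈A , b∈B , refl)))

    A-normalises-Core : ∀ {a g} → a ∈ A → g ∈ Core → a ⁻¹ · g · a ∈ Core
    A-normalises-Core {a} {g} a∈A g∈ with ∈Core⁻ g∈
    ... | _ , conj∈BM = ∈Core⁺ (conj∈BM a a∈A , λ a′ a′∈A →
      subst (_∈ BM) (solve 3 (λ a a′ g → (a ⊗ a′) ⁻ ⊗ g ⊗ (a ⊗ a′) ⊜ a′ ⁻ ⊗ (a ⁻ ⊗ g ⊗ a) ⊗ a′) refl a a′ g)
                    (conj∈BM (a · a′) (A.·∈ a∈A a′∈A)))

    ABA⊆A·Core : (A ⋆ B) ⋆ A ⊆ A ⋆ Core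
    ABA⊆A·Core g∈ABA with ∈⋆⁻ g∈ABA
    ... | s , a₂ , s∈AB , a₂∈A , refl with ∈⋆⁻ s∈AB
    ...   | a₁ , b , a₁∈A , b∈B , refl =
      subst (_∈ A ⋆ Core) (solve 3 (λ a₁ b a₂ → a₁ ⊗ a₂ ⊗ (a₂ ⁻ ⊗ b ⊗ a₂) ⊜ a₁ ⊗ b ⊗ a₂) refl a₁ b a₂)
            (∈⋆⁺ (A.·∈ a₁∈A a₂∈A) (A-normalises-Core a₂∈A (B⊆Core b∈B)))

    ∣A·Core∣≡n∣Core∣ : ∣ A ⋆ Core ∣ ≡ n * ∣ Core ∣
    ∣A·Core∣≡n∣Core∣ = *-cancelʳ-≡ _ _ k {{>-nonZero k>0}} (begin
      ∣ A ⋆ Core ∣ * k               ≡⟨ cong (∣ A ⋆ Core ∣ *_) ∣A∩Core∣≡k ⟨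
      ∣ A ⋆ Core ∣ * ∣ A ∩ Core ∣    ≡⟨ product-formula A≤G Core≤G ⟩
      ∣ A ∣ * ∣ Core ∣               ≡⟨ cong (_* ∣ Core ∣) ∣A∣≡nk ⟩
      n * k * ∣ Core ∣               ≡⟨ ring-solve 3 (λ n k c → n :* k :* c := n :* c :* k) refl n k ∣ Core ∣ ⟩
      n * ∣ Core ∣ * k               ∎)
      where
      open ≡-Reasoning
      ∣A∩Core∣≡k : ∣ A ∩ Core ∣ ≡ k
      ∣A∩Core∣≡k = ≤-antisym
        (p⊆q⇒∣p∣≤∣q∣ λ p → let a∈A , a∈Core = x∈p∩q⁻ A Core p in x∈p∩q⁺ (a∈A , A∩BM⊆B a∈A (Core⊆BM a∈Core)))
        (p⊆q⇒∣p∣≤∣q∣ λ p → x∈p∩q⁺ (A∩B⊆A p , B⊆Core (A∩B⊆B p)))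

    BM⊆Core : BM ⊆ Core
    BM⊆Core {g} g∈BM with g ∈? Core
    ... | yes g∈Core = g∈Core
    ... | no g∉Core = ⊥-elim (no-index-two n k ∣ Core ∣ nk>0 (begin
      n ^ 3 * k + n * k              ≤⟨ ∣ABA∣-bound ⟩
      n ^ 2 * k + ∣ (A ⋆ B) ⋆ A ∣    ≤⟨ +-monoʳ-≤ _ (p⊆q⇒∣p∣≤∣q∣ ABA⊆A·Core) ⟩
      n ^ 2 * k + ∣ A ⋆ Core ∣       ≡⟨ cong (n ^ 2 * k +_) ∣A·Core∣≡n∣Core∣ ⟩
      n ^ 2 * k + n * ∣ Core ∣       ∎)
      (subst (∣ Core ∣ + ∣ Core ∣ ≤_) ∣BM∣≡n²k (index≥2 Core≤G BM≤G Core⊆BM g∈BM g∉Core)))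
      where open ≤-Reasoning

  A-normalises-BM : ∀ {a h} → a ∈ A → h ∈ BM → a ⁻¹ · h · a ∈ BM
  A-normalises-BM a∈A h∈BM = proj₂ (∈Core⁻ (BM⊆Core h∈BM)) _ a∈A

  BM-normal : IsNormal BM
  BM-normal g h h∈BM with ∈⋆⁻ (G≡A·BM g)
  ... | a , m , a∈A , m∈BM , refl =
    subst (_∈ BM) (solve 3 (λ a m h → m ⁻ ⊗ (a ⁻ ⊗ h ⊗ a) ⊗ m ⊜ (a ⊗ m) ⁻ ⊗ h ⊗ (a ⊗ m)) refl a m h)
          (BM.·∈ (BM.⁻¹·∈ m∈BM (A-normalises-BM a∈A h∈BM)) m∈BM)

  I-AB⁻ : ∀ {x y} → Aco x I Bco y → x · y ⁻¹ ∈ A ⋆ B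
  I-AB⁻ {x} {y} (g , g∈Ax , g∈By) =
    subst (_∈ A ⋆ B) (solve 3 (λ g x y → (g ⊗ x ⁻) ⁻ ⊗ (g ⊗ y ⁻) ⊜ x ⊗ y ⁻) refl g x y)
          (∈⋆⁺ (A.⁻¹∈ (A.∈RC⇒·⁻¹∈ g∈Ax)) (B.∈RC⇒·⁻¹∈ g∈By))

  I-AB⁺ : ∀ {x y} → x · y ⁻¹ ∈ A ⋆ B → Aco x I Bco y
  I-AB⁺ {x} {y} xy⁻¹∈AB with ∈⋆⁻ xy⁻¹∈AB
  ... | a , b , a∈A , b∈B , ab≡xy⁻¹ =
    a ⁻¹ · x , A.·⁻¹∈⇒∈RC (subst (_∈ A) (sym (//-rightDividesʳ x (a ⁻¹))) (A.⁻¹∈ a∈A)) , B.·⁻¹∈⇒∈RC (subst (_∈ B) b≡ b∈B)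
    where
    b≡ : b ≡ a ⁻¹ · x · y ⁻¹
    b≡ = trans (sym (\\-leftDividesʳ a b)) (trans (cong (a ⁻¹ ·_) ab≡xy⁻¹) (sym (assoc _ x _)))

  I-AAM⁻ : ∀ {x y} → Aco x I AMco y → x · y ⁻¹ ∈ AM
  I-AAM⁻ {x} Ax⊆AMy = AM.∈RC⇒·⁻¹∈ (Ax⊆AMy x (e , A.e∈ , sym (idˡ x)))

  I-AAM⁺ : ∀ {x y} → x · y ⁻¹ ∈ AM → Aco x I AMco y
  I-AAM⁺ {x} {y} xy⁻¹∈AM g g∈Ax = AM.·⁻¹∈⇒∈RC
    (subst (_∈ AM) (solve 3 (λ g x y → g ⊗ x ⁻ ⊗ (x ⊗ y ⁻) ⊜ g ⊗ y ⁻) refl g x y) (AM.·∈ (A⊆AM (A.∈RC⇒·⁻¹∈ g∈Ax)) xy⁻¹∈AM))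

  I-BMB⁻ : ∀ {x y} → BMco x I Bco y → y · x ⁻¹ ∈ BM
  I-BMB⁻ {x} {y} By⊆BMx = BM.∈RC⇒·⁻¹∈ (By⊆BMx y (e , B.e∈ , sym (idˡ y)))

  I-BMB⁺ : ∀ {x y} → y · x ⁻¹ ∈ BM → BMco x I Bco y
  I-BMB⁺ {x} {y} yx⁻¹∈BM g g∈By = BM.·⁻¹∈⇒∈RC
    (subst (_∈ BM) (solve 3 (λ g y x → g ⊗ y ⁻ ⊗ (y ⊗ x ⁻) ⊜ g ⊗ x ⁻) refl g y x) (BM.·∈ (B⊆BM (B.∈RC⇒·⁻¹∈ g∈By)) yx⁻¹∈BM))

  ≈P-refl : ∀ P → P ≈P P
  ≈P-refl ∞        = tt
  ≈P-refl (Aco x)  = λ _ → ⇔-id _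
  ≈P-refl (BMco x) = λ _ → ⇔-id _

  ≈P-sym : ∀ {P Q} → P ≈P Q → Q ≈P P
  ≈P-sym {∞}      {∞}      _ = tt
  ≈P-sym {Aco _}  {Aco _}  p = λ g → ⇔-sym (p g)
  ≈P-sym {BMco _} {BMco _} p = λ g → ⇔-sym (p g)

  ≈P-trans : ∀ {P Q R} → P ≈P Q → Q ≈P R → P ≈P R
  ≈P-trans {∞}      {∞}      {∞}      _ _ = tt
  ≈P-trans {Aco _}  {Aco _}  {Aco _}  p q = λ g → q g ⇔-∘ p g
  ≈P-trans {BMco _} {BMco _} {BMco _} p q = λ g → q g ⇔-∘ p g

  ≈L-refl : ∀ L → L ≈L L
  ≈L-refl L∞       = tt
  ≈L-refl (Bco y)  = λ _ → ⇔-id _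
  ≈L-refl (AMco y) = λ _ → ⇔-id _

  ≈L-sym : ∀ {K L} → K ≈L L → L ≈L K
  ≈L-sym {L∞}     {L∞}     _ = tt
  ≈L-sym {Bco _}  {Bco _}  p = λ g → ⇔-sym (p g)
  ≈L-sym {AMco _} {AMco _} p = λ g → ⇔-sym (p g)

  ≈L-trans : ∀ {K L N} → K ≈L L → L ≈L N → K ≈L N
  ≈L-trans {L∞}     {L∞}     {L∞}     _ _ = tt
  ≈L-trans {Bco _}  {Bco _}  {Bco _}  p q = λ g → q g ⇔-∘ p g
  ≈L-trans {AMco _} {AMco _} {AMco _} p q = λ g → q g ⇔-∘ p g

  _≈P?_ : ∀ P Q → Dec (P ≈P Q)
  ∞      ≈P? ∞      = yes tt
  Aco x  ≈P? Aco y  = map′ A.·⁻¹∈⇒CosetEq A.CosetEq⇒·⁻¹∈ (x · y ⁻¹ ∈? A)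
  BMco x ≈P? BMco y = map′ BM.·⁻¹∈⇒CosetEq BM.CosetEq⇒·⁻¹∈ (x · y ⁻¹ ∈? BM)
  ∞      ≈P? Aco _  = no λ ()
  ∞      ≈P? BMco _ = no λ ()
  Aco _  ≈P? ∞      = no λ ()
  Aco _  ≈P? BMco _ = no λ ()
  BMco _ ≈P? ∞      = no λ ()
  BMco _ ≈P? Aco _  = no λ ()

  _≈L?_ : ∀ K L → Dec (K ≈L L)
  L∞     ≈L? L∞     = yes tt
  Bco x  ≈L? Bco y  = map′ B.·⁻¹∈⇒CosetEq B.CosetEq⇒·⁻¹∈ (x · y ⁻¹ ∈? B)
  AMco x ≈L? AMco y = map′ AM.·⁻¹∈⇒CosetEq AM.CosetEq⇒·⁻¹∈ (x · y ⁻¹ ∈? AM)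
  L∞     ≈L? Bco _  = no λ ()
  L∞     ≈L? AMco _ = no λ ()
  Bco _  ≈L? L∞     = no λ ()
  Bco _  ≈L? AMco _ = no λ ()
  AMco _ ≈L? L∞     = no λ ()
  AMco _ ≈L? Bco _  = no λ ()

  _I?_ : ∀ P L → Dec (P I L)
  ∞      I? L∞     = yes tt
  ∞      I? Bco _  = no λ ()
  ∞      I? AMco _ = yes tt
  Aco _  I? L∞     = no λ ()
  Aco x  I? Bco y  = map′ I-AB⁺ I-AB⁻ (x · y ⁻¹ ∈? A ⋆ B)
  Aco x  I? AMco y = map′ I-AAM⁺ I-AAM⁻ (x · y ⁻¹ ∈? AM)
  BMco _ I? L∞     = yes tt
  BMco x I? Bco y  = map′ I-BMB⁺ I-BMB⁻ (y · x ⁻¹ ∈? BM)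
  BMco _ I? AMco _ = no λ ()

  I-respˡ : ∀ {P Q L} → P ≈P Q → P I L → Q I L
  I-respˡ {∞}      {∞}      {L}      _ P∈L = P∈L
  I-respˡ {Aco _}  {Aco _}  {Bco _}  P≈Q (g , g∈P , g∈L) = g , Equivalence.to (P≈Q g) g∈P , g∈L
  I-respˡ {Aco _}  {Aco _}  {AMco _} P≈Q P⊆L = λ g g∈Q → P⊆L g (Equivalence.from (P≈Q g) g∈Q)
  I-respˡ {BMco _} {BMco _} {L∞}     _ _ = tt
  I-respˡ {BMco _} {BMco _} {Bco _}  P≈Q L⊆P = λ g g∈L → Equivalence.to (P≈Q g) (L⊆P g g∈L)

  I-respʳ : ∀ {P K L} → K ≈L L → P I K → P I L
  I-respʳ {∞}      {L∞}     {L∞}     _ P∈K = P∈K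
  I-respʳ {∞}      {AMco _} {AMco _} _ P∈K = P∈K
  I-respʳ {Aco _}  {Bco _}  {Bco _}  K≈L (g , g∈P , g∈K) = g , g∈P , Equivalence.to (K≈L g) g∈K
  I-respʳ {Aco _}  {AMco _} {AMco _} K≈L P⊆K = λ g g∈P → Equivalence.to (K≈L g) (P⊆K g g∈P)
  I-respʳ {BMco _} {L∞}     {L∞}     _ _ = tt
  I-respʳ {BMco _} {Bco _}  {Bco _}  K≈L K⊆P = λ g g∈L → K⊆P g (Equivalence.from (K≈L g) g∈L)

  -- π is a projective plane

  private
    left-quotient : ∀ {a₁ b₁ a₂ b₂ x y y₂} → a₁ · b₁ ≡ x · y ⁻¹ → a₂ · b₂ ≡ x · y₂ ⁻¹ → a₁ ⁻¹ · a₂ ≡ b₁ · (y · y₂ ⁻¹) · b₂ ⁻¹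
    left-quotient {a₁} {b₁} {a₂} {b₂} {x} {y} {y₂} e₁ e₂ = begin
      a₁ ⁻¹ · a₂
        ≡⟨ solve 4 (λ a₁ b₁ a₂ b₂ → a₁ ⁻ ⊗ a₂ ⊜ b₁ ⊗ ((a₁ ⊗ b₁) ⁻ ⊗ (a₂ ⊗ b₂)) ⊗ b₂ ⁻) refl a₁ b₁ a₂ b₂ ⟩
      b₁ · ((a₁ · b₁) ⁻¹ · (a₂ · b₂)) · b₂ ⁻¹     ≡⟨ cong₂ (λ u v → b₁ · (u ⁻¹ · v) · b₂ ⁻¹) e₁ e₂ ⟩
      b₁ · ((x · y ⁻¹) ⁻¹ · (x · y₂ ⁻¹)) · b₂ ⁻¹
        ≡⟨ solve 5 (λ b₁ b₂ x y y₂ → b₁ ⊗ ((x ⊗ y ⁻) ⁻ ⊗ (x ⊗ y₂ ⁻)) ⊗ b₂ ⁻ ⊜ b₁ ⊗ (y ⊗ y₂ ⁻) ⊗ b₂ ⁻) refl b₁ b₂ x y y₂ ⟩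
      b₁ · (y · y₂ ⁻¹) · b₂ ⁻¹                    ∎
      where open ≡-Reasoning

    right-quotient : ∀ {a₁ b₁ a₂ b₂ x₁ x₂ y} → a₁ · b₁ ≡ x₁ · y ⁻¹ → a₂ · b₂ ≡ x₂ · y ⁻¹ → x₁ · x₂ ⁻¹ ≡ a₁ · (b₁ · b₂ ⁻¹) · a₂ ⁻¹
    right-quotient {a₁} {b₁} {a₂} {b₂} {x₁} {x₂} {y} e₁ e₂ = begin
      x₁ · x₂ ⁻¹                     ≡⟨ solve 3 (λ x₁ x₂ y → x₁ ⊗ x₂ ⁻ ⊜ x₁ ⊗ y ⁻ ⊗ (x₂ ⊗ y ⁻) ⁻) refl x₁ x₂ y ⟩
      x₁ · y ⁻¹ · (x₂ · y ⁻¹) ⁻¹     ≡⟨ cong₂ (λ u v → u · v ⁻¹) e₁ e₂ ⟨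
      a₁ · b₁ · (a₂ · b₂) ⁻¹
        ≡⟨ solve 4 (λ a₁ b₁ a₂ b₂ → a₁ ⊗ b₁ ⊗ (a₂ ⊗ b₂) ⁻ ⊜ a₁ ⊗ (b₁ ⊗ b₂ ⁻) ⊗ a₂ ⁻) refl a₁ b₁ a₂ b₂ ⟩
      a₁ · (b₁ · b₂ ⁻¹) · a₂ ⁻¹      ∎
      where open ≡-Reasoning

  B-lines-through-A-and-BM-point : ∀ {z x y y₂} → Aco z I Bco y → Aco z I Bco y₂ → BMco x I Bco y → BMco x I Bco y₂ → Bco y ≈L Bco y₂
  B-lines-through-A-and-BM-point {z} {x} {y} {y₂} p q r s with ∈⋆⁻ (I-AB⁻ p) | ∈⋆⁻ (I-AB⁻ q)
  ... | a₁ , b₁ , a₁∈A , b₁∈B , e₁ | a₂ , b₂ , a₂∈A , b₂∈B , e₂ =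
    B.·⁻¹∈⇒CosetEq (B.∈-cancel-sandwich b₁∈B (B.⁻¹∈ b₂∈B) (subst (_∈ B) (left-quotient e₁ e₂) (A∩BM⊆B (A.⁻¹·∈ a₁∈A a₂∈A) w∈BM)))
    where
    w∈BM : a₁ ⁻¹ · a₂ ∈ BM
    w∈BM = subst (_∈ BM) (sym (left-quotient e₁ e₂))
             (BM.·∈ (BM.·∈ (B⊆BM b₁∈B) (BM.·⁻¹∈-trans (I-BMB⁻ r) (BM.·⁻¹∈-sym (I-BMB⁻ s)))) (B⊆BM (B.⁻¹∈ b₂∈B)))

  B-lines-through-two-A-points : ∀ {x₁ x₂ y y₂} → ¬ Aco x₁ ≈P Aco x₂ →
    Aco x₁ I Bco y → Aco x₁ I Bco y₂ → Aco x₂ I Bco y → Aco x₂ I Bco y₂ → Bco y ≈L Bco y₂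
  B-lines-through-two-A-points {x₁} {x₂} {y} {y₂} x₁≉x₂ p q r s
    with ∈⋆⁻ (I-AB⁻ p) | ∈⋆⁻ (I-AB⁻ q) | ∈⋆⁻ (I-AB⁻ r) | ∈⋆⁻ (I-AB⁻ s)
  ... | a₁ , b₁ , a₁∈A , b₁∈B , e₁ | a₂ , b₂ , a₂∈A , b₂∈B , e₂ | a₃ , b₃ , a₃∈A , b₃∈B , e₃ | a₄ , b₄ , a₄∈A , b₄∈B , e₄ =
    conclude (AB∩BA⊆A∪B w∈AB w∈BA)
    where
    -- Both sides equal b₃ · (y · y₂⁻¹) · b₂⁻¹.
    two-forms : b₃ · b₁ ⁻¹ · (a₁ ⁻¹ · a₂) ≡ a₃ ⁻¹ · a₄ · (b₄ · b₂ ⁻¹)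
    two-forms = begin
      b₃ · b₁ ⁻¹ · (a₁ ⁻¹ · a₂)                   ≡⟨ cong (b₃ · b₁ ⁻¹ ·_) (left-quotient e₁ e₂) ⟩
      b₃ · b₁ ⁻¹ · (b₁ · (y · y₂ ⁻¹) · b₂ ⁻¹)
        ≡⟨ solve 5 (λ b₁ b₂ b₃ b₄ u → b₃ ⊗ b₁ ⁻ ⊗ (b₁ ⊗ u ⊗ b₂ ⁻) ⊜ b₃ ⊗ u ⊗ b₄ ⁻ ⊗ (b₄ ⊗ b₂ ⁻)) refl b₁ b₂ b₃ b₄ (y · y₂ ⁻¹) ⟩
      b₃ · (y · y₂ ⁻¹) · b₄ ⁻¹ · (b₄ · b₂ ⁻¹)     ≡⟨ cong (_· (b₄ · b₂ ⁻¹)) (left-quotient e₃ e₄) ⟨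
      a₃ ⁻¹ · a₄ · (b₄ · b₂ ⁻¹)                   ∎
      where open ≡-Reasoning
    w∈AB : b₃ · b₁ ⁻¹ · (a₁ ⁻¹ · a₂) ∈ A ⋆ B
    w∈AB = subst (_∈ A ⋆ B) (sym two-forms) (∈⋆⁺ (A.⁻¹·∈ a₃∈A a₄∈A) (B.·⁻¹∈ b₄∈B b₂∈B))
    w∈BA : b₃ · b₁ ⁻¹ · (a₁ ⁻¹ · a₂) ∈ B ⋆ A
    w∈BA = ∈⋆⁺ (B.·⁻¹∈ b₃∈B b₁∈B) (A.⁻¹·∈ a₁∈A a₂∈A)
    conclude : b₃ · b₁ ⁻¹ · (a₁ ⁻¹ · a₂) ∈ A ⊎ b₃ · b₁ ⁻¹ · (a₁ ⁻¹ · a₂) ∈ B → Bco y ≈L Bco y₂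
    conclude (inj₂ w∈B) = B.·⁻¹∈⇒CosetEq (B.∈-cancel-sandwich b₁∈B (B.⁻¹∈ b₂∈B)
      (subst (_∈ B) (left-quotient e₁ e₂) (B.∈-cancelˡ (B.·⁻¹∈ b₃∈B b₁∈B) w∈B)))
    conclude (inj₁ w∈A) = ⊥-elim (x₁≉x₂ (A.·⁻¹∈⇒CosetEq (subst (_∈ A) (sym (right-quotient e₁ e₃))
      (A.·∈ (A.·∈ a₁∈A (A.·⁻¹∈-sym b₃b₁⁻¹∈A)) (A.⁻¹∈ a₃∈A)))))
      where
      b₃b₁⁻¹∈A : b₃ · b₁ ⁻¹ ∈ A
      b₃b₁⁻¹∈A = A.∈-cancelʳ (A.⁻¹·∈ a₁∈A a₂∈A) w∈A

  A-points-on-B-and-AM-line : ∀ {x₁ x₂ y y₂} → Aco x₁ I Bco y → Aco x₂ I Bco y → Aco x₁ I AMco y₂ → Aco x₂ I AMco y₂ → Aco x₁ ≈P Aco x₂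
  A-points-on-B-and-AM-line p q r s with ∈⋆⁻ (I-AB⁻ p) | ∈⋆⁻ (I-AB⁻ q)
  ... | a₁ , b₁ , a₁∈A , b₁∈B , e₁ | a₂ , b₂ , a₂∈A , b₂∈B , e₂ =
    A.·⁻¹∈⇒CosetEq (subst (_∈ A) (sym (right-quotient e₁ e₂)) (A.·∈ (A.·∈ a₁∈A b₁b₂⁻¹∈A) (A.⁻¹∈ a₂∈A)))
    where
    b₁b₂⁻¹∈A : b₁ · b₂ ⁻¹ ∈ A
    b₁b₂⁻¹∈A = AM∩B⊆A (AM.∈-cancel-sandwich (A⊆AM a₁∈A) (A⊆AM (A.⁻¹∈ a₂∈A))
                   (subst (_∈ AM) (right-quotient e₁ e₂) (AM.·⁻¹∈-trans (I-AAM⁻ r) (AM.·⁻¹∈-sym (I-AAM⁻ s)))))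
               (B.·⁻¹∈ b₁∈B b₂∈B)

  BM-points-on-B-line : ∀ {x₁ x₂ y} → BMco x₁ I Bco y → BMco x₂ I Bco y → BMco x₁ ≈P BMco x₂
  BM-points-on-B-line p q = BM.·⁻¹∈⇒CosetEq (BM.·⁻¹∈-trans (BM.·⁻¹∈-sym (I-BMB⁻ p)) (I-BMB⁻ q))

  AM-lines-through-A-point : ∀ {x y y₂} → Aco x I AMco y → Aco x I AMco y₂ → AMco y ≈L AMco y₂
  AM-lines-through-A-point p q = AM.·⁻¹∈⇒CosetEq (AM.·⁻¹∈-trans (AM.·⁻¹∈-sym (I-AAM⁻ p)) (I-AAM⁻ q))

  unique-line : ∀ {P Q K L} → ¬ P ≈P Q → P I K → Q I K → P I L → Q I L → K ≈L L
  unique-line {K = L∞} {L∞} _ _ _ _ _ = tt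
  unique-line {∞}       {∞}                           P≉Q _ _ _ _ = ⊥-elim (P≉Q tt)
  unique-line {BMco _}  {BMco _}  {L∞}      {Bco _}   P≉Q _ _ r s = ⊥-elim (P≉Q (BM-points-on-B-line r s))
  unique-line {BMco _}  {BMco _}  {Bco _}             P≉Q p q _ _ = ⊥-elim (P≉Q (BM-points-on-B-line p q))
  unique-line {BMco _}  {Aco _}   {Bco _}   {Bco _}   _   p q r s = B-lines-through-A-and-BM-point q s p r
  unique-line {Aco _}   {BMco _}  {Bco _}   {Bco _}   _   p q r s = B-lines-through-A-and-BM-point p r q s
  unique-line {Aco _}   {Aco _}   {Bco _}   {Bco _}   P≉Q p q r s = B-lines-through-two-A-points P≉Q p r q s
  unique-line {Aco _}   {Aco _}   {Bco _}   {AMco _}  P≉Q p q r s = ⊥-elim (P≉Q (A-points-on-B-and-AM-line p q r s))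
  unique-line {Aco _}   {Aco _}   {AMco _}  {Bco _}   P≉Q p q r s = ⊥-elim (P≉Q (A-points-on-B-and-AM-line r s p q))
  unique-line {∞}       {Aco _}   {AMco _}  {AMco _}  _   _ q _ s = AM-lines-through-A-point q s
  unique-line {Aco _}   {_}       {AMco _}  {AMco _}  _   p _ r _ = AM-lines-through-A-point p r

  private
    A∪B⊆AB : ∀ {g} → g ∈ A ⊎ g ∈ B → g ∈ A ⋆ B
    A∪B⊆AB {g} (inj₁ g∈A) = subst (_∈ A ⋆ B) (idʳ g) (∈⋆⁺ g∈A B.e∈)
    A∪B⊆AB {g} (inj₂ g∈B) = subst (_∈ A ⋆ B) (idˡ g) (∈⋆⁺ A.e∈ g∈B)

    B-translate-on-B-line : ∀ {b} y → b ∈ B → Aco (b ⁻¹ · y) I Bco y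
    B-translate-on-B-line {b} y b∈B = I-AB⁺ (subst (_∈ A ⋆ B) (sym (//-rightDividesʳ y (b ⁻¹))) (A∪B⊆AB (inj₂ (B.⁻¹∈ b∈B))))

  BMco-on-Bco : ∀ y → BMco y I Bco y
  BMco-on-Bco y = I-BMB⁺ (subst (_∈ BM) (sym (invʳ y)) BM.e∈)

  Aco-on-Bco : ∀ y → Aco y I Bco y
  Aco-on-Bco y = I-AB⁺ (subst (_∈ A ⋆ B) (sym (invʳ y)) (A∪B⊆AB (inj₁ A.e∈)))

  Aco-on-AMco : ∀ y → Aco y I AMco y
  Aco-on-AMco y = I-AAM⁺ (subst (_∈ AM) (sym (invʳ y)) AM.e∈)

  B-meets-AM : ∀ y y₂ → ∃ λ P → P I Bco y × P I AMco y₂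
  B-meets-AM y y₂ = from-factorisation (∈⋆⁻ (G≡B·AM (y · y₂ ⁻¹)))
    where
    from-factorisation : Factorisation B AM (y · y₂ ⁻¹) → ∃ λ P → P I Bco y × P I AMco y₂
    from-factorisation (b , s , b∈B , s∈AM , bs≡yy₂⁻¹) =
      Aco (b ⁻¹ · y) , B-translate-on-B-line y b∈B , I-AAM⁺ (subst (_∈ AM) s≡ s∈AM)
      where
      s≡ : s ≡ b ⁻¹ · y · y₂ ⁻¹
      s≡ = trans (sym (\\-leftDividesʳ b s)) (trans (cong (b ⁻¹ ·_) bs≡yy₂⁻¹) (sym (assoc _ y _)))

  A-joins-BM : ∀ x y → ∃ λ L → Aco x I L × BMco y I L
  A-joins-BM x y = from-factorisation (∈⋆⁻ (G≡A·BM (x · y ⁻¹)))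
    where
    from-factorisation : Factorisation A BM (x · y ⁻¹) → ∃ λ L → Aco x I L × BMco y I L
    from-factorisation (a , m , a∈A , m∈BM , am≡xy⁻¹) =
      Bco (m · y) , I-AB⁺ (subst (_∈ A ⋆ B) a≡ (A∪B⊆AB (inj₁ a∈A))) , I-BMB⁺ (subst (_∈ BM) (sym (//-rightDividesʳ y m)) m∈BM)
      where
      a≡ : a ≡ x · (m · y) ⁻¹
      a≡ = begin
        a                    ≡⟨ //-rightDividesʳ m a ⟨
        a · m · m ⁻¹         ≡⟨ cong (_· m ⁻¹) am≡xy⁻¹ ⟩
        x · y ⁻¹ · m ⁻¹      ≡⟨ solve 3 (λ x y m → x ⊗ y ⁻ ⊗ m ⁻ ⊜ x ⊗ (m ⊗ y) ⁻) refl x y m ⟩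
        x · (m · y) ⁻¹       ∎
        where open ≡-Reasoning

  B-lines-meet : ∀ y y₂ → ∃ λ P → P I Bco y × P I Bco y₂
  B-lines-meet y y₂ = from-cover (G≡BM∪BAB (y · y₂ ⁻¹))
    where
    from-cover : y · y₂ ⁻¹ ∈ BM ⊎ y · y₂ ⁻¹ ∈ (B ⋆ A) ⋆ B → ∃ λ P → P I Bco y × P I Bco y₂
    from-cover (inj₁ yy₂⁻¹∈BM)  = BMco y₂ , I-BMB⁺ yy₂⁻¹∈BM , BMco-on-Bco y₂
    from-cover (inj₂ yy₂⁻¹∈BAB) = from-factorisation (∈⋆⁻ yy₂⁻¹∈BAB)
      where
      from-factorisation : Factorisation (B ⋆ A) B (y · y₂ ⁻¹) → ∃ λ P → P I Bco y × P I Bco y₂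
      from-factorisation (s , b₂ , s∈BA , b₂∈B , sb₂≡yy₂⁻¹) with ∈⋆⁻ s∈BA
      ... | b₁ , a , b₁∈B , a∈A , refl =
        Aco (b₁ ⁻¹ · y) , B-translate-on-B-line y b₁∈B , I-AB⁺ (subst (_∈ A ⋆ B) ab₂≡ (∈⋆⁺ a∈A b₂∈B))
        where
        ab₂≡ : a · b₂ ≡ b₁ ⁻¹ · y · y₂ ⁻¹
        ab₂≡ = begin
          a · b₂                  ≡⟨ solve 3 (λ b₁ a b₂ → a ⊗ b₂ ⊜ b₁ ⁻ ⊗ (b₁ ⊗ a ⊗ b₂)) refl b₁ a b₂ ⟩
          b₁ ⁻¹ · (b₁ · a · b₂)   ≡⟨ cong (b₁ ⁻¹ ·_) sb₂≡yy₂⁻¹ ⟩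
          b₁ ⁻¹ · (y · y₂ ⁻¹)     ≡⟨ assoc _ y _ ⟨
          b₁ ⁻¹ · y · y₂ ⁻¹       ∎
          where open ≡-Reasoning

  A-points-joined : ∀ x y → ∃ λ L → Aco x I L × Aco y I L
  A-points-joined x y = from-cover (G≡AM∪ABA (x · y ⁻¹))
    where
    from-cover : x · y ⁻¹ ∈ AM ⊎ x · y ⁻¹ ∈ (A ⋆ B) ⋆ A → ∃ λ L → Aco x I L × Aco y I L
    from-cover (inj₁ xy⁻¹∈AM)  = AMco y , I-AAM⁺ xy⁻¹∈AM , Aco-on-AMco y
    from-cover (inj₂ xy⁻¹∈ABA) = from-factorisation (∈⋆⁻ xy⁻¹∈ABA)
      where
      from-factorisation : Factorisation (A ⋆ B) A (x · y ⁻¹) → ∃ λ L → Aco x I L × Aco y I L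
      from-factorisation (s , a , s∈AB , a∈A , sa≡xy⁻¹) =
        Bco (a · y) , I-AB⁺ (subst (_∈ A ⋆ B) s≡ s∈AB) , I-AB⁺ (subst (_∈ A ⋆ B) a⁻¹≡ (A∪B⊆AB (inj₁ (A.⁻¹∈ a∈A))))
        where
        s≡ : s ≡ x · (a · y) ⁻¹
        s≡ = begin
          s                        ≡⟨ //-rightDividesʳ a s ⟨
          s · a · a ⁻¹             ≡⟨ cong (_· a ⁻¹) sa≡xy⁻¹ ⟩
          x · y ⁻¹ · a ⁻¹          ≡⟨ solve 3 (λ x y a → x ⊗ y ⁻ ⊗ a ⁻ ⊜ x ⊗ (a ⊗ y) ⁻) refl x y a ⟩
          x · (a · y) ⁻¹           ∎
          where open ≡-Reasoning
        a⁻¹≡ : a ⁻¹ ≡ y · (a · y) ⁻¹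
        a⁻¹≡ = solve 2 (λ y a → a ⁻ ⊜ y ⊗ (a ⊗ y) ⁻) refl y a

  meet : ∀ K L → ¬ K ≈L L → ∃ λ P → P I K × P I L
  meet L∞        L∞        K≉L = ⊥-elim (K≉L tt)
  meet L∞        (Bco y)   _   = BMco y , tt , BMco-on-Bco y
  meet L∞        (AMco _)  _   = ∞ , tt , tt
  meet (Bco y)   L∞        _   = BMco y , BMco-on-Bco y , tt
  meet (AMco _)  L∞        _   = ∞ , tt , tt
  meet (AMco _)  (AMco _)  _   = ∞ , tt , tt
  meet (Bco y)   (Bco y₂)  _   = B-lines-meet y y₂
  meet (Bco y)   (AMco y₂) _   = B-meets-AM y y₂
  meet (AMco y₂) (Bco y)   _   = let P , P∈By , P∈AMy₂ = B-meets-AM y y₂ in P , P∈AMy₂ , P∈By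

  join : ∀ P Q → ¬ P ≈P Q → ∃ λ L → P I L × Q I L
  join ∞        ∞        P≉Q = ⊥-elim (P≉Q tt)
  join ∞        (Aco x)  _   = AMco x , tt , Aco-on-AMco x
  join ∞        (BMco _) _   = L∞ , tt , tt
  join (Aco x)  ∞        _   = AMco x , Aco-on-AMco x , tt
  join (BMco _) ∞        _   = L∞ , tt , tt
  join (BMco _) (BMco _) _   = L∞ , tt , tt
  join (Aco x)  (BMco y) _   = A-joins-BM x y
  join (BMco y) (Aco x)  _   = let L , Ax∈L , BMy∈L = A-joins-BM x y in L , BMy∈L , Ax∈L
  join (Aco x)  (Aco y)  _   = A-points-joined x y

  ≈P-reflexive : ∀ {P Q} → P ≡ Q → P ≈P Q
  ≈P-reflexive {P} refl = ≈P-refl P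

  ≈L-reflexive : ∀ {K L} → K ≡ L → K ≈L L
  ≈L-reflexive {K} refl = ≈L-refl K

  lineSetoid : Setoid 0ℓ 0ℓ
  lineSetoid = record { Carrier = Line ; _≈_ = _≈L_
                      ; isEquivalence = record { refl = ≈L-refl _ ; sym = ≈L-sym ; trans = ≈L-trans } }

  module LineReasoning = SetoidReasoning lineSetoid

  actP-· : ∀ g h P → actP (g · h) P ≡ actP h (actP g P)
  actP-· g h ∞        = refl
  actP-· g h (Aco x)  = cong Aco (sym (assoc x g h))
  actP-· g h (BMco x) = cong BMco (sym (assoc x g h))

  actL-· : ∀ g h L → actL (g · h) L ≡ actL h (actL g L)
  actL-· g h L∞       = refl
  actL-· g h (Bco y)  = cong Bco (sym (assoc y g h))
  actL-· g h (AMco y) = cong AMco (sym (assoc y g h))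

  actP-e : ∀ P → actP e P ≡ P
  actP-e ∞        = refl
  actP-e (Aco x)  = cong Aco (idʳ x)
  actP-e (BMco x) = cong BMco (idʳ x)

  actL-e : ∀ L → actL e L ≡ L
  actL-e L∞       = refl
  actL-e (Bco y)  = cong Bco (idʳ y)
  actL-e (AMco y) = cong AMco (idʳ y)

  actP-⁻¹ : ∀ g P → actP (g ⁻¹) (actP g P) ≡ P
  actP-⁻¹ g P = trans (sym (actP-· g (g ⁻¹) P)) (trans (cong (λ h → actP h P) (invʳ g)) (actP-e P))

  actL-⁻¹ : ∀ g L → actL (g ⁻¹) (actL g L) ≡ L
  actL-⁻¹ g L = trans (sym (actL-· g (g ⁻¹) L)) (trans (cong (λ h → actL h L) (invʳ g)) (actL-e L))

  actP-⁻¹′ : ∀ g P → actP g (actP (g ⁻¹) P) ≡ P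
  actP-⁻¹′ g P = trans (sym (actP-· (g ⁻¹) g P)) (trans (cong (λ h → actP h P) (invˡ g)) (actP-e P))

  actL-⁻¹′ : ∀ g L → actL g (actL (g ⁻¹) L) ≡ L
  actL-⁻¹′ g L = trans (sym (actL-· (g ⁻¹) g L)) (trans (cong (λ h → actL h L) (invˡ g)) (actL-e L))

  private
    shift : ∀ x y g → x · g · (y · g) ⁻¹ ≡ x · y ⁻¹
    shift = solve 3 (λ x y g → x ⊗ g ⊗ (y ⊗ g) ⁻ ⊜ x ⊗ y ⁻) refl

  act-respP : ∀ g {P Q} → P ≈P Q → actP g P ≈P actP g Q
  act-respP g {∞}      {∞}      _   = tt
  act-respP g {Aco x}  {Aco y}  P≈Q = A.·⁻¹∈⇒CosetEq (subst (_∈ A) (sym (shift x y g)) (A.CosetEq⇒·⁻¹∈ P≈Q))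
  act-respP g {BMco x} {BMco y} P≈Q = BM.·⁻¹∈⇒CosetEq (subst (_∈ BM) (sym (shift x y g)) (BM.CosetEq⇒·⁻¹∈ P≈Q))

  act-respL : ∀ g {K L} → K ≈L L → actL g K ≈L actL g L
  act-respL g {L∞}     {L∞}     _   = tt
  act-respL g {Bco x}  {Bco y}  K≈L = B.·⁻¹∈⇒CosetEq (subst (_∈ B) (sym (shift x y g)) (B.CosetEq⇒·⁻¹∈ K≈L))
  act-respL g {AMco x} {AMco y} K≈L = AM.·⁻¹∈⇒CosetEq (subst (_∈ AM) (sym (shift x y g)) (AM.CosetEq⇒·⁻¹∈ K≈L))

  act-I : ∀ g {P L} → P I L → actP g P I actL g L
  act-I g {∞}      {L∞}     _   = tt
  act-I g {∞}      {AMco _} _   = tt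
  act-I g {Aco x}  {Bco y}  P∈L = I-AB⁺ (subst (_∈ A ⋆ B) (sym (shift x y g)) (I-AB⁻ P∈L))
  act-I g {Aco x}  {AMco y} P∈L = I-AAM⁺ (subst (_∈ AM) (sym (shift x y g)) (I-AAM⁻ P∈L))
  act-I g {BMco _} {L∞}     _   = tt
  act-I g {BMco x} {Bco y}  P∈L = I-BMB⁺ (subst (_∈ BM) (sym (shift y x g)) (I-BMB⁻ P∈L))

  act-I⁻ : ∀ g {P L} → actP g P I actL g L → P I L
  act-I⁻ g {P} {L} gP∈gL = subst₂ _I_ (actP-⁻¹ g P) (actL-⁻¹ g L) (act-I (g ⁻¹) gP∈gL)

  -- Collineations fixing L∞ pointwise

  record IncidenceMap : Set where
    field
      fP        : Point → Point
      fL        : Line → Line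
      preserves : ∀ {P L} → P I L → fP P I fL L
      reflects  : ∀ {P L} → fP P I fL L → P I L

  actMap : El → IncidenceMap
  actMap g = record { fP = actP g ; fL = actL g ; preserves = act-I g ; reflects = act-I⁻ g }

  collineationMap : Collineation → IncidenceMap
  collineationMap c = record
    { fP = fP ; fL = fL
    ; preserves = Equivalence.to (incid _ _) ; reflects = Equivalence.from (incid _ _) }
    where open Collineation c

  _⨾_ : IncidenceMap → IncidenceMap → IncidenceMap
  f ⨾ g = record
    { fP = λ P → g.fP (f.fP P) ; fL = λ L → g.fL (f.fL L)
    ; preserves = λ r → g.preserves (f.preserves r) ; reflects = λ r → f.reflects (g.reflects r) }
    where
    module f = IncidenceMap f
    module g = IncidenceMap g

  Affine : Point → Set
  Affine P = ¬ P I L∞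

  affine-line : ∀ {P L} → Affine P → P I L → ¬ L ≈L L∞
  affine-line P∉L∞ P∈L L≈L∞ = P∉L∞ (I-respʳ L≈L∞ P∈L)

  ideal≉affine : ∀ {P Q} → P I L∞ → Affine Q → ¬ Q ≈P P
  ideal≉affine P∈L∞ Q∉L∞ Q≈P = Q∉L∞ (I-respˡ (≈P-sym Q≈P) P∈L∞)

  ideal-point-unique : ∀ {L w w′} → ¬ L ≈L L∞ → w I L → w I L∞ → w′ I L → w′ I L∞ → w ≈P w′
  ideal-point-unique {w = w} {w′} L≉L∞ w∈L w∈L∞ w′∈L w′∈L∞ with w ≈P? w′
  ... | yes w≈w′ = w≈w′
  ... | no w≉w′  = ⊥-elim (L≉L∞ (unique-line w≉w′ w∈L w′∈L w∈L∞ w′∈L∞))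

  two-points-on : ∀ L → ∃ λ P → ∃ λ Q → ¬ P ≈P Q × P I L × Q I L
  two-points-on L∞       = ∞ , BMco e , (λ ()) , tt , tt
  two-points-on (Bco y)  = Aco y , BMco y , (λ ()) , Aco-on-Bco y , BMco-on-Bco y
  two-points-on (AMco y) = ∞ , Aco y , (λ ()) , tt , Aco-on-AMco y

  affine-point-on : ∀ L → ¬ L ≈L L∞ → ∃ λ x → Aco x I L
  affine-point-on L∞       L≉L∞ = ⊥-elim (L≉L∞ tt)
  affine-point-on (Bco y)  _    = y , Aco-on-Bco y
  affine-point-on (AMco y) _    = y , Aco-on-AMco y

  private
    nk<n²k : n * k < n ^ 2 * k
    nk<n²k = subst (n * k <_) (ring-solve 2 (λ n k → n :* k :* n := n :^ 2 :* k) refl n k) (m<m*n (n * k) n {{>-nonZero nk>0}} n>1)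

    k<nk : k < n * k
    k<nk = subst (k <_) (*-comm k n) (m<m*n k n {{>-nonZero k>0}} n>1)

    M⊈A : ∃ λ m → m ∈ M × m ∉ A
    M⊈A with ∣∣<⇒∃∈∖ {S = A} {T = AM} (subst₂ _<_ (sym ∣A∣≡nk) (sym ∣AM∣≡n²k) nk<n²k)
    ... | g , g∈AM , g∉A with ∈⋆⁻ g∈AM
    ...   | a , m , a∈A , m∈M , refl = m , m∈M , λ m∈A → g∉A (A.·∈ a∈A m∈A)

    B⊈A : ∃ λ b → b ∈ B × b ∉ A
    B⊈A with ∣∣<⇒∃∈∖ {S = A ∩ B} {T = B} (subst (k <_) (sym ∣B∣≡nk) k<nk)
    ... | b , b∈B , b∉A∩B = b , b∈B , λ b∈A → b∉A∩B (x∈p∩q⁺ (b∈A , b∈B))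

  A-point-off : ∀ L → ¬ L ≈L L∞ → ∃ λ x → ¬ Aco x I L
  A-point-off L∞       L≉L∞ = ⊥-elim (L≉L∞ tt)
  A-point-off (Bco y)  _ with M⊈A
  ... | m , m∈M , m∉A = m · y , λ Amy∈By → m∉AB (subst (_∈ A ⋆ B) (//-rightDividesʳ y m) (I-AB⁻ Amy∈By))
    where
    m∉AB : m ∉ A ⋆ B
    m∉AB m∈AB with ∈⋆⁻ m∈AB
    ... | a , b , a∈A , b∈B , refl = m∉A (A.·∈ a∈A (AM∩B⊆A (AM.∈-cancelˡ (A⊆AM a∈A) (M⊆AM m∈M)) b∈B))
  A-point-off (AMco y) _ with B⊈A
  ... | b , b∈B , b∉A = b · y , λ Aby∈AMy → b∉A (AM∩B⊆A (subst (_∈ AM) (//-rightDividesʳ y b) (I-AAM⁻ Aby∈AMy)) b∈B)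

  module Fixing (f : IncidenceMap) where
    open IncidenceMap f

    Fixes : Point → Set
    Fixes P = fP P ≈P P

    FixesL : Line → Set
    FixesL L = fL L ≈L L

    Axial : Set
    Axial = ∀ P → P I L∞ → Fixes P

    IsCenter : Point → Set
    IsCenter w = w I L∞ × (∀ L → w I L → FixesL L)

    line-fixed : ∀ {P Q L} → ¬ P ≈P Q → Fixes P → Fixes Q → P I L → Q I L → FixesL L
    line-fixed P≉Q fixP fixQ P∈L Q∈L = unique-line P≉Q (I-respˡ fixP (preserves P∈L)) (I-respˡ fixQ (preserves Q∈L)) P∈L Q∈L

    point-fixed : ∀ {K L P} → ¬ K ≈L L → FixesL K → FixesL L → P I K → P I L → Fixes P
    point-fixed {P = P} K≉L fixK fixL P∈K P∈L with fP P ≈P? P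
    ... | yes fixP = fixP
    ... | no ¬fixP = ⊥-elim (K≉L (unique-line ¬fixP (I-respʳ fixK (preserves P∈K)) P∈K (I-respʳ fixL (preserves P∈L)) P∈L))

    L∞-fixed : Axial → FixesL L∞
    L∞-fixed axial = line-fixed {∞} {BMco e} (λ ()) (axial ∞ tt) (axial (BMco e) tt) tt tt

    affine-image : Axial → ∀ {P} → Affine P → Affine (fP P)
    affine-image axial P∉L∞ fP∈L∞ = P∉L∞ (reflects (I-respʳ (≈L-sym (L∞-fixed axial)) fP∈L∞))

    -- fL L contains fP P and the fixed ideal point of L, both of which lie on L.
    join-to-image-fixed : Axial → ∀ {P L} → Affine P → P I L → fP P I L → FixesL L
    join-to-image-fixed axial {P} {L} P∉L∞ P∈L fP∈L with meet L L∞ (affine-line P∉L∞ P∈L)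
    ... | w , w∈L , w∈L∞ =
      unique-line (ideal≉affine w∈L∞ (affine-image axial P∉L∞)) (preserves P∈L) (I-respˡ (axial w w∈L∞) (preserves w∈L)) fP∈L w∈L

    module _ (axial : Axial) {w} (w-center : IsCenter w) where
      private
        fixed-off-line : ∀ {Q R m} → Affine Q → Affine R → Fixes R → Q I m → w I m → ¬ R I m → Fixes Q
        fixed-off-line {Q} {R} {m} _ R∉L∞ fixR Q∈m w∈m R∉m with join Q R (λ Q≈R → R∉m (I-respˡ Q≈R Q∈m))
        ... | ℓ , Q∈ℓ , R∈ℓ =
          point-fixed m≉ℓ (proj₂ w-center m w∈m) (join-to-image-fixed axial R∉L∞ R∈ℓ (I-respˡ (≈P-sym fixR) R∈ℓ)) Q∈m Q∈ℓ
          where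
          m≉ℓ : ¬ m ≈L ℓ
          m≉ℓ m≈ℓ = R∉m (I-respʳ (≈L-sym m≈ℓ) R∈ℓ)

      fixes-all : ∀ {P₀} → Affine P₀ → Fixes P₀ → ∀ Q → Fixes Q
      fixes-all {P₀} P₀∉L∞ fixP₀ Q with Q I? L∞
      ... | yes Q∈L∞ = axial Q Q∈L∞
      ... | no Q∉L∞ with join Q w (ideal≉affine (proj₁ w-center) Q∉L∞)
      ...   | m , Q∈m , w∈m with P₀ I? m
      ...     | no P₀∉m = fixed-off-line Q∉L∞ P₀∉L∞ fixP₀ Q∈m w∈m P₀∉m
      ...     | yes P₀∈m with A-point-off m (affine-line Q∉L∞ Q∈m)
      ...       | x , Ax∉m with join (Aco x) w (ideal≉affine (proj₁ w-center) (λ ()))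
      ...         | m′ , Ax∈m′ , w∈m′ = fixed-off-line Q∉L∞ (λ ()) fixAx Q∈m w∈m Ax∉m
        where
        P₀∉m′ : ¬ P₀ I m′
        P₀∉m′ P₀∈m′ = Ax∉m (I-respʳ (unique-line (ideal≉affine (proj₁ w-center) P₀∉L∞) P₀∈m′ w∈m′ P₀∈m w∈m) Ax∈m′)
        fixAx : Fixes (Aco x)
        fixAx = fixed-off-line (λ ()) P₀∉L∞ fixP₀ Ax∈m′ w∈m′ P₀∉m′

    fixes-all-lines : (∀ P → Fixes P) → ∀ L → FixesL L
    fixes-all-lines fix-all L with two-points-on L
    ... | P , Q , P≉Q , P∈L , Q∈L = line-fixed P≉Q (fix-all P) (fix-all Q) P∈L Q∈L

  -- The translations

  Fixes : El → Point → Set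
  Fixes t = Fixing.Fixes (actMap t)

  IsCenter : El → Point → Set
  IsCenter t = Fixing.IsCenter (actMap t)

  BM-axial : ∀ {t} → t ∈ BM → Fixing.Axial (actMap t)
  BM-axial t∈BM ∞        _ = tt
  BM-axial {t} t∈BM (BMco x) _ =
    BM.·⁻¹∈⇒CosetEq (subst (_∈ BM) (solve 2 (λ x t → x ⁻ ⁻ ⊗ t ⊗ x ⁻ ⊜ x ⊗ t ⊗ x ⁻) refl x t) (BM-normal (x ⁻¹) t t∈BM))

  -- The non-trivial elements of T fix no affine point (t fixes Aco x iff x t x⁻¹ ∈ A).
  InT : El → Set
  InT t = t ∈ BM × (∀ x → x · t · x ⁻¹ ∈ A → t ≡ e)

  inT? : Decidable InT
  inT? t = (t ∈? BM) ×-dec all? (λ x → (x · t · x ⁻¹ ∈? A) →-dec (t ≟ᶠ e))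

  T : SubsetG
  T = subsetOf inT?

  ∈T⁺ : ∀ {t} → InT t → t ∈ T
  ∈T⁺ = ∈subsetOf⁺ inT?

  ∈T⁻ : ∀ {t} → t ∈ T → InT t
  ∈T⁻ = ∈subsetOf⁻ inT?

  T⊆BM : T ⊆ BM
  T⊆BM t∈T = proj₁ (∈T⁻ t∈T)

  T-axial : ∀ {t} → t ∈ T → Fixing.Axial (actMap t)
  T-axial t∈T = BM-axial (T⊆BM t∈T)

  fixed-point-free : ∀ {t} → t ∈ T → t ≢ e → ∀ {P} → Affine P → ¬ Fixes t P
  fixed-point-free t∈T t≢e {∞}      P∉L∞ _ = P∉L∞ tt
  fixed-point-free t∈T t≢e {BMco _} P∉L∞ _ = P∉L∞ tt
  fixed-point-free t∈T t≢e {Aco x}  _ fix = t≢e (proj₂ (∈T⁻ t∈T) x (A.CosetEq⇒·⁻¹∈ fix))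

  module _ {t} (t∈T : t ∈ T) (t≢e : t ≢ e) where
    open Fixing (actMap t) using (FixesL; L∞-fixed; join-to-image-fixed; point-fixed)

    private
      trace : ∀ {P} → Affine P → ∃ λ ℓ → P I ℓ × FixesL ℓ
      trace {P} P∉L∞ = fixed (join P (actP t P) (λ P≈tP → fixed-point-free t∈T t≢e P∉L∞ (≈P-sym P≈tP)))
        where
        fixed : (∃ λ ℓ → P I ℓ × actP t P I ℓ) → ∃ λ ℓ → P I ℓ × FixesL ℓ
        fixed (ℓ , P∈ℓ , tP∈ℓ) = ℓ , P∈ℓ , join-to-image-fixed (T-axial t∈T) P∉L∞ P∈ℓ tP∈ℓ

      lines-through-ideal-point-fixed : ∀ {ℓ w} → ¬ ℓ ≈L L∞ → FixesL ℓ → w I ℓ → w I L∞ → ∀ L → w I L → FixesL L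
      lines-through-ideal-point-fixed {ℓ} {w} ℓ≉L∞ fixℓ w∈ℓ w∈L∞ L w∈L = by-cases (L ≈L? L∞)
        where
        by-cases : Dec (L ≈L L∞) → FixesL L
        by-cases (yes L≈L∞) = ≈L-trans (act-respL t L≈L∞) (≈L-trans (L∞-fixed (T-axial t∈T)) (≈L-sym L≈L∞))
        by-cases (no L≉L∞)  = through-affine (affine-point-on L L≉L∞)
          where
          through-affine : (∃ λ x → Aco x I L) → FixesL L
          through-affine (x , Q∈L) = compare (trace {Aco x} (λ ()))
            where
            compare : (∃ λ ℓ′ → Aco x I ℓ′ × FixesL ℓ′) → FixesL L
            compare (ℓ′ , Q∈ℓ′ , fixℓ′) = by-cases′ (ℓ′ ≈L? L)
              where
              by-cases′ : Dec (ℓ′ ≈L L) → FixesL L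
              by-cases′ (yes ℓ′≈L) = ≈L-trans (act-respL t (≈L-sym ℓ′≈L)) (≈L-trans fixℓ′ ℓ′≈L)
              by-cases′ (no ℓ′≉L)  = ⊥-elim (no-meet (meet ℓ′ ℓ ℓ′≉ℓ))
                where
                w∉ℓ′ : ¬ w I ℓ′
                w∉ℓ′ w∈ℓ′ = ℓ′≉L (unique-line (ideal≉affine w∈L∞ (λ ())) Q∈ℓ′ w∈ℓ′ Q∈L w∈L)
                ℓ′≉ℓ : ¬ ℓ′ ≈L ℓ
                ℓ′≉ℓ ℓ′≈ℓ = w∉ℓ′ (I-respʳ (≈L-sym ℓ′≈ℓ) w∈ℓ)
                no-meet : (∃ λ R → R I ℓ′ × R I ℓ) → ⊥
                no-meet (R , R∈ℓ′ , R∈ℓ) = ideal-or-affine (R I? L∞)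
                  where
                  ideal-or-affine : Dec (R I L∞) → ⊥
                  ideal-or-affine (yes R∈L∞) = w∉ℓ′ (I-respˡ (ideal-point-unique ℓ≉L∞ R∈ℓ R∈L∞ w∈ℓ w∈L∞) R∈ℓ′)
                  ideal-or-affine (no R∉L∞)  = fixed-point-free t∈T t≢e R∉L∞ (point-fixed ℓ′≉ℓ fixℓ′ fixℓ R∈ℓ′ R∈ℓ)

    -- The centre is the ideal point of the (fixed) line joining an affine point to its image.
    center : ∃ (IsCenter t)
    center = let ℓ , O∈ℓ , fixℓ = trace {Aco e} (λ ())
                 ℓ≉L∞ = affine-line (λ ()) O∈ℓ
                 w , w∈ℓ , w∈L∞ = meet ℓ L∞ ℓ≉L∞
             in w , w∈L∞ , lines-through-ideal-point-fixed ℓ≉L∞ fixℓ w∈ℓ w∈L∞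

  center-resp : ∀ {t w w′} → IsCenter t w → w ≈P w′ → IsCenter t w′
  center-resp (w∈L∞ , fix) w≈w′ = I-respˡ w≈w′ w∈L∞ , λ L w′∈L → fix L (I-respˡ (≈P-sym w≈w′) w′∈L)

  center-≡ : ∀ {s t w} → s ≡ t → IsCenter s w → IsCenter t w
  center-≡ refl c = c

  center-e : ∀ {w} → w I L∞ → IsCenter e w
  center-e w∈L∞ = w∈L∞ , λ L _ → ≈L-reflexive (actL-e L)

  center-· : ∀ {s t w} → IsCenter s w → IsCenter t w → IsCenter (s · t) w
  center-· {s} {t} (w∈L∞ , fix-s) (_ , fix-t) =
    w∈L∞ , λ L w∈L → ≈L-trans (≈L-reflexive (actL-· s t L)) (≈L-trans (act-respL t (fix-s L w∈L)) (fix-t L w∈L))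

  center-⁻¹ : ∀ {s w} → IsCenter s w → IsCenter (s ⁻¹) w
  center-⁻¹ {s} (w∈L∞ , fix) = w∈L∞ , λ L w∈L → ≈L-trans (act-respL (s ⁻¹) (≈L-sym (fix L w∈L))) (≈L-reflexive (actL-⁻¹ s L))

  -- Conjugating by v ∈ BM keeps w, since v fixes L∞ pointwise.
  center-conj : ∀ {s v w} → v ∈ BM → IsCenter s w → IsCenter (v ⁻¹ · s · v) w
  center-conj {s} {v} {w} v∈BM (w∈L∞ , fix) = w∈L∞ , λ L w∈L → begin
    actL (v ⁻¹ · s · v) L               ≈⟨ ≈L-reflexive (trans (actL-· (v ⁻¹ · s) v L) (cong (actL v) (actL-· (v ⁻¹) s L))) ⟩
    actL v (actL s (actL (v ⁻¹) L))     ≈⟨ act-respL v (fix _ (I-respˡ (BM-axial (BM.⁻¹∈ v∈BM) w w∈L∞) (act-I (v ⁻¹) w∈L))) ⟩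
    actL v (actL (v ⁻¹) L)              ≈⟨ ≈L-reflexive (actL-⁻¹′ v L) ⟩
    L                                   ∎
    where open LineReasoning

  center-^ᵍ : ∀ {t w} → IsCenter t w → ∀ i → IsCenter (t ^ᵍ i) w
  center-^ᵍ c zero    = center-e (proj₁ c)
  center-^ᵍ c (suc i) = center-· c (center-^ᵍ c i)

  two-centers⇒fixes-affine : ∀ {t w w′} → IsCenter t w → IsCenter t w′ → ¬ w ≈P w′ → ∀ {Q} → Affine Q → Fixes t Q
  two-centers⇒fixes-affine {t} {w} {w′} (w∈L∞ , fix) (w′∈L∞ , fix′) w≉w′ {Q} Q∉L∞
    with join Q w (ideal≉affine w∈L∞ Q∉L∞) | join Q w′ (ideal≉affine w′∈L∞ Q∉L∞)
  ... | m , Q∈m , w∈m | m′ , Q∈m′ , w′∈m′ = Fixing.point-fixed (actMap t) m≉m′ (fix m w∈m) (fix′ m′ w′∈m′) Q∈m Q∈m′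
    where
    m≉m′ : ¬ m ≈L m′
    m≉m′ m≈m′ = Q∉L∞ (I-respʳ (unique-line w≉w′ w∈m (I-respʳ (≈L-sym m≈m′) w′∈m′) w∈L∞ w′∈L∞) Q∈m)

  two-centers⇒trivial : ∀ {t w w′} → t ∈ T → IsCenter t w → IsCenter t w′ → ¬ w ≈P w′ → t ≡ e
  two-centers⇒trivial {t} t∈T c c′ w≉w′ with t ≟ᶠ e
  ... | yes t≡e = t≡e
  ... | no t≢e  = ⊥-elim (fixed-point-free t∈T t≢e {Aco e} (λ ()) (two-centers⇒fixes-affine c c′ w≉w′ {Aco e} (λ ())))

  e∈T : e ∈ T
  e∈T = ∈T⁺ (BM.e∈ , λ _ _ → refl)

  T-⁻¹ : ∀ {t} → t ∈ T → t ⁻¹ ∈ T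
  T-⁻¹ {t} t∈T = ∈T⁺ (BM.⁻¹∈ (T⊆BM t∈T) , λ x fix → trans (cong _⁻¹ (proj₂ (∈T⁻ t∈T) x (conj⁻¹ x fix))) ε⁻¹≈ε)
    where
    conj⁻¹ : ∀ x → x · t ⁻¹ · x ⁻¹ ∈ A → x · t · x ⁻¹ ∈ A
    conj⁻¹ x p = subst (_∈ A) (solve 2 (λ x t → (x ⊗ t ⁻ ⊗ x ⁻) ⁻ ⊜ x ⊗ t ⊗ x ⁻) refl x t) (A.⁻¹∈ p)

  T-conj : ∀ {t} v → t ∈ T → v ⁻¹ · t · v ∈ T
  T-conj {t} v t∈T = ∈T⁺ (BM-normal v t (T⊆BM t∈T) , λ x fix →
    trans (cong (λ u → v ⁻¹ · u · v) (proj₂ (∈T⁻ t∈T) (x · v ⁻¹) (subst (_∈ A) (regroup x) fix))) (solve 1 (λ v → v ⁻ ⊗ ι ⊗ v ⊜ ι) refl v))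
    where
    regroup : ∀ x → x · (v ⁻¹ · t · v) · x ⁻¹ ≡ x · v ⁻¹ · t · (x · v ⁻¹) ⁻¹
    regroup x = solve 3 (λ x v t → x ⊗ (v ⁻ ⊗ t ⊗ v) ⊗ x ⁻ ⊜ x ⊗ v ⁻ ⊗ t ⊗ (x ⊗ v ⁻) ⁻) refl x v t


  -- If s t fixes P then the centres of s and t both lie on the line P (s P), so they coincide.
  product-fixing-point-trivial : ∀ {s t} → s ∈ T → t ∈ T → s ≢ e → t ≢ e → ∀ {P} → Affine P → Fixes (s · t) P → s · t ≡ e
  product-fixing-point-trivial {s} {t} s∈T t∈T s≢e t≢e {P} P∉L∞ fixP = common-center (center s∈T s≢e) (center t∈T t≢e)
    where
    P≉sP : ¬ P ≈P actP s P
    P≉sP P≈sP = fixed-point-free s∈T s≢e P∉L∞ (≈P-sym P≈sP)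
    ℓ = proj₁ (join P (actP s P) P≉sP)
    P∈ℓ : P I ℓ
    P∈ℓ = proj₁ (proj₂ (join P (actP s P) P≉sP))
    sP∈ℓ : actP s P I ℓ
    sP∈ℓ = proj₂ (proj₂ (join P (actP s P) P≉sP))
    common-center : ∃ (IsCenter s) → ∃ (IsCenter t) → s · t ≡ e
    common-center (ws , cs) (wt , ct) = faithful (s · t) fixes-all (Fixing.fixes-all-lines (actMap (s · t)) fixes-all)
      where
      ws∈ℓ : ws I ℓ
      ws∈ℓ = let ms , P∈ms , ws∈ms = join P ws (ideal≉affine (proj₁ cs) P∉L∞) in
        I-respʳ (unique-line P≉sP P∈ms (I-respʳ (proj₂ cs ms ws∈ms) (act-I s P∈ms)) P∈ℓ sP∈ℓ) ws∈ms
      wt∈ℓ : wt I ℓ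
      wt∈ℓ = let mt , sP∈mt , wt∈mt = join (actP s P) wt (ideal≉affine (proj₁ ct) (Fixing.affine-image (actMap s) (T-axial s∈T) P∉L∞))
                 P∈mt = I-respˡ (≈P-trans (≈P-reflexive (sym (actP-· s t P))) fixP) (I-respʳ (proj₂ ct mt wt∈mt) (act-I t sP∈mt))
             in I-respʳ (unique-line P≉sP P∈mt sP∈mt P∈ℓ sP∈ℓ) wt∈mt
      ws≈wt : ws ≈P wt
      ws≈wt = ideal-point-unique (affine-line P∉L∞ P∈ℓ) ws∈ℓ (proj₁ cs) wt∈ℓ (proj₁ ct)
      fixes-all : ∀ Q → Fixes (s · t) Q
      fixes-all = Fixing.fixes-all (actMap (s · t)) (BM-axial (BM.·∈ (T⊆BM s∈T) (T⊆BM t∈T)))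
                    (center-· cs (center-resp ct (≈P-sym ws≈wt))) P∉L∞ fixP

  T-· : ∀ {s t} → s ∈ T → t ∈ T → s · t ∈ T
  T-· {s} {t} s∈T t∈T = ∈T⁺ (BM.·∈ (T⊆BM s∈T) (T⊆BM t∈T) , trivial-if-fixes)
    where
    trivial-if-fixes : ∀ x → x · (s · t) · x ⁻¹ ∈ A → s · t ≡ e
    trivial-if-fixes x fix with s ≟ᶠ e | t ≟ᶠ e
    ... | yes refl | _ = trans (idˡ t) (proj₂ (∈T⁻ t∈T) x (subst (λ u → x · u · x ⁻¹ ∈ A) (idˡ t) fix))
    ... | no _ | yes refl = trans (idʳ s) (proj₂ (∈T⁻ s∈T) x (subst (λ u → x · u · x ⁻¹ ∈ A) (idʳ s) fix))
    ... | no s≢e | no t≢e = product-fixing-point-trivial s∈T t∈T s≢e t≢e {Aco x} (λ ()) (A.·⁻¹∈⇒CosetEq fix)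

  T≤G : IsSubgroup T
  T≤G = e∈T , (λ _ _ → T-·) , (λ _ → T-⁻¹)

  module T = Subgroup T≤G

  -- The order of T

  private
    -- The number of x ∈ G such that t fixes the point Aco x.
    conjugates-in-A : El → ℕ
    conjugates-in-A t = ∑ (λ x → 𝟙 A (x · t · x ⁻¹))

    -- Double counting the pairs (t , x) with t ∈ BM and x t x⁻¹ ∈ A, using that BM is normal.
    ∑-conjugates-in-A : ∑ (λ t → 𝟙 BM t * conjugates-in-A t) ≡ order * k
    ∑-conjugates-in-A = begin
      ∑ (λ t → 𝟙 BM t * ∑ (λ x → 𝟙 A (x · t · x ⁻¹)))
        ≡⟨ sum-cong-≗ (λ t → *-distribˡ-sum (𝟙 BM t) (λ x → 𝟙 A (x · t · x ⁻¹))) ⟩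
      ∑ (λ t → ∑ (λ x → 𝟙 BM t * 𝟙 A (x · t · x ⁻¹)))     ≡⟨ ∑-comm (λ t x → 𝟙 BM t * 𝟙 A (x · t · x ⁻¹)) ⟩
      ∑ (λ x → ∑ (λ t → 𝟙 BM t * 𝟙 A (x · t · x ⁻¹)))     ≡⟨ sum-cong-≗ (λ x → sum-cong-≗ (in-A∩BM x)) ⟩
      ∑ (λ x → ∑ (λ t → 𝟙 (A ∩ BM) (x · t · x ⁻¹)))
        ≡⟨ sum-cong-≗ (λ x → trans (∑-conjugate (𝟙 (A ∩ BM)) x) (sym (∣∣≡∑𝟙 (A ∩ BM)))) ⟩
      ∑ (λ _ → ∣ A ∩ BM ∣)                                 ≡⟨ sum-const order _ ⟩
      order * ∣ A ∩ BM ∣                                   ≡⟨ cong (order *_) ∣A∩BM∣≡k ⟩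
      order * k                                            ∎
      where
      open ≡-Reasoning
      in-A∩BM : ∀ x t → 𝟙 BM t * 𝟙 A (x · t · x ⁻¹) ≡ 𝟙 (A ∩ BM) (x · t · x ⁻¹)
      in-A∩BM x t = begin
        𝟙 BM t * 𝟙 A (x · t · x ⁻¹)                  ≡⟨ *-comm (𝟙 BM t) _ ⟩
        𝟙 A (x · t · x ⁻¹) * 𝟙 BM t
          ≡⟨ cong (𝟙 A (x · t · x ⁻¹) *_) (𝟙-⇔ (conj x) (λ p → subst (_∈ BM) (back x t) (conj (x ⁻¹) p))) ⟩
        𝟙 A (x · t · x ⁻¹) * 𝟙 BM (x · t · x ⁻¹)     ≡⟨ 𝟙-∩ A BM _ ⟨
        𝟙 (A ∩ BM) (x · t · x ⁻¹)                    ∎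
        where
        conj : ∀ x {t} → t ∈ BM → x · t · x ⁻¹ ∈ BM
        conj x {t} t∈BM = subst (_∈ BM) (solve 2 (λ x t → x ⁻ ⁻ ⊗ t ⊗ x ⁻ ⊜ x ⊗ t ⊗ x ⁻) refl x t) (BM-normal (x ⁻¹) t t∈BM)
        back : ∀ x t → x ⁻¹ · (x · t · x ⁻¹) · x ⁻¹ ⁻¹ ≡ t
        back = solve 2 (λ x t → x ⁻ ⊗ (x ⊗ t ⊗ x ⁻) ⊗ x ⁻ ⁻ ⊜ t) refl

    conjugates-in-A-e : conjugates-in-A e ≡ order
    conjugates-in-A-e = begin
      ∑ (λ x → 𝟙 A (x · e · x ⁻¹))
        ≡⟨ sum-cong-≗ (λ x → 𝟙-∈ (subst (_∈ A) (sym (trans (cong (_· x ⁻¹) (idʳ x)) (invʳ x))) A.e∈)) ⟩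
      ∑ (λ _ → 1)                    ≡⟨ sum-const order 1 ⟩
      order * 1                      ≡⟨ *-identityʳ order ⟩
      order                          ∎
      where open ≡-Reasoning

    -- If x₀ t x₀⁻¹ ∈ A then x t x⁻¹ ∈ A for every x ∈ A · x₀.
    conjugates-in-A-outside-T : ∀ {t} → t ∈ BM → t ∉ T → n * k ≤ conjugates-in-A t
    conjugates-in-A-outside-T {t} t∈BM t∉T = from-witness (any? (λ x → (x · t · x ⁻¹ ∈? A) ×-dec ¬? (t ≟ᶠ e)))
      where
      from-witness : Dec (∃ λ x → x · t · x ⁻¹ ∈ A × t ≢ e) → n * k ≤ conjugates-in-A t
      from-witness (no none) = ⊥-elim (t∉T (∈T⁺ (t∈BM , trivial)))
        where
        trivial : ∀ x → x · t · x ⁻¹ ∈ A → t ≡ e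
        trivial x fix with t ≟ᶠ e
        ... | yes t≡e = t≡e
        ... | no t≢e  = ⊥-elim (none (x , fix , t≢e))
      from-witness (yes (x₀ , fix , _)) = begin
        n * k                              ≡⟨ ∣A∣≡nk ⟨
        ∣ A ∣                              ≡⟨ ∣∣≡∑𝟙 A ⟩
        ∑ (𝟙 A)                            ≡⟨ ∑-translateʳ (𝟙 A) (x₀ ⁻¹) ⟨
        ∑ (λ x → 𝟙 A (x · x₀ ⁻¹))
          ≤⟨ sum-mono-≤ (λ x → 𝟙-mono (λ p → subst (_∈ A) (regroup x) (A.·∈ (A.·∈ p fix) (A.⁻¹∈ p)))) ⟩
        ∑ (λ x → 𝟙 A (x · t · x ⁻¹))       ∎
        where
        open ≤-Reasoning
        regroup : ∀ x → x · x₀ ⁻¹ · (x₀ · t · x₀ ⁻¹) · (x · x₀ ⁻¹) ⁻¹ ≡ x · t · x ⁻¹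
        regroup x = solve 3 (λ x x₀ t → x ⊗ x₀ ⁻ ⊗ (x₀ ⊗ t ⊗ x₀ ⁻) ⊗ (x ⊗ x₀ ⁻) ⁻ ⊜ x ⊗ t ⊗ x ⁻) refl x x₀ t

    -- Summed over t this reads ∣G∣ + nk ∣BM∣ ≤ ∣G∣ k + nk ∣T∣, that is n² ≤ ∣T∣.
    pointwise-bound : ∀ t → order * 𝟙 ⁅ e ⁆ t + n * k * 𝟙 BM t ≤ 𝟙 BM t * conjugates-in-A t + n * k * 𝟙 T t
    pointwise-bound t = by-cases (t ≟ᶠ e) (t ∈? BM) (t ∈? T)
      where
      by-cases : Dec (t ≡ e) → Dec (t ∈ BM) → Dec (t ∈ T) →
                 order * 𝟙 ⁅ e ⁆ t + n * k * 𝟙 BM t ≤ 𝟙 BM t * conjugates-in-A t + n * k * 𝟙 T t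
      by-cases (yes refl) _ _ = begin
        order * 𝟙 ⁅ e ⁆ e + n * k * 𝟙 BM e
          ≡⟨ cong₂ (λ i j → order * i + n * k * j) (𝟙-∈ (x∈⁅x⁆ e)) (trans (𝟙-∈ BM.e∈) (sym (𝟙-∈ e∈T))) ⟩
        order * 1 + n * k * 𝟙 T e
          ≡⟨ cong (_+ n * k * 𝟙 T e) (trans (*-identityʳ order) (sym (trans (*-identityˡ _) conjugates-in-A-e))) ⟩
        1 * conjugates-in-A e + n * k * 𝟙 T e
          ≡⟨ cong (λ i → i * conjugates-in-A e + n * k * 𝟙 T e) (𝟙-∈ BM.e∈) ⟨
        𝟙 BM e * conjugates-in-A e + n * k * 𝟙 T e ∎
        where open ≤-Reasoning
      by-cases (no t≢e) (no t∉BM) _ = begin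
        order * 𝟙 ⁅ e ⁆ t + n * k * 𝟙 BM t
          ≡⟨ cong₂ (λ a b → order * a + n * k * b) (𝟙-∉ (λ p → t≢e (x∈⁅y⁆⇒x≡y e p))) (𝟙-∉ t∉BM) ⟩
        order * 0 + n * k * 0                 ≡⟨ cong₂ _+_ (*-zeroʳ order) (*-zeroʳ (n * k)) ⟩
        0                                     ≤⟨ z≤n ⟩
        _                                     ∎
        where open ≤-Reasoning
      by-cases (no t≢e) (yes t∈BM) (yes t∈T) = begin
        order * 𝟙 ⁅ e ⁆ t + n * k * 𝟙 BM t    ≡⟨ cong (λ a → order * a + n * k * 𝟙 BM t) (𝟙-∉ (λ p → t≢e (x∈⁅y⁆⇒x≡y e p))) ⟩
        order * 0 + n * k * 𝟙 BM t
          ≡⟨ cong₂ (λ a b → a + n * k * b) (*-zeroʳ order) (trans (𝟙-∈ t∈BM) (sym (𝟙-∈ t∈T))) ⟩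
        n * k * 𝟙 T t                         ≤⟨ m≤n+m _ _ ⟩
        𝟙 BM t * conjugates-in-A t + n * k * 𝟙 T t ∎
        where open ≤-Reasoning
      by-cases (no t≢e) (yes t∈BM) (no t∉T) = begin
        order * 𝟙 ⁅ e ⁆ t + n * k * 𝟙 BM t
          ≡⟨ cong₂ (λ a b → order * a + n * k * b) (𝟙-∉ (λ p → t≢e (x∈⁅y⁆⇒x≡y e p))) (𝟙-∈ t∈BM) ⟩
        order * 0 + n * k * 1                 ≡⟨ cong₂ _+_ (*-zeroʳ order) (*-identityʳ (n * k)) ⟩
        n * k                                 ≤⟨ conjugates-in-A-outside-T t∈BM t∉T ⟩
        conjugates-in-A t                     ≡⟨ *-identityˡ _ ⟨
        1 * conjugates-in-A t                 ≡⟨ cong (_* conjugates-in-A t) (𝟙-∈ t∈BM) ⟨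
        𝟙 BM t * conjugates-in-A t            ≤⟨ m≤m+n _ _ ⟩
        𝟙 BM t * conjugates-in-A t + n * k * 𝟙 T t ∎
        where open ≤-Reasoning

  n²≤∣T∣ : n ^ 2 ≤ ∣ T ∣
  n²≤∣T∣ = *-cancelˡ-≤ (n * k) {{>-nonZero nk>0}} (+-cancelˡ-≤ (n ^ 3 * k * k) _ _ (begin
    n ^ 3 * k * k + n * k * n ^ 2
      ≡⟨ ring-solve 2 (λ n k → n :^ 3 :* k :* k :+ n :* k :* n :^ 2 := n :^ 3 :* k :* con 1 :+ n :* k :* (n :^ 2 :* k)) refl n k ⟩
    n ^ 3 * k * 1 + n * k * (n ^ 2 * k)
      ≡⟨ cong₂ (λ a b → a * 1 + n * k * b) (sym ∣G∣≡n³k) (sym ∣BM∣≡n²k) ⟩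
    order * 1 + n * k * ∣ BM ∣
      ≡⟨ cong₂ (λ a b → order * a + n * k * b) (sym (∣⁅x⁆∣≡1 e)) (∣∣≡∑𝟙 BM) ⟩
    order * ∣ ⁅ e ⁆ ∣ + n * k * ∑ (𝟙 BM)
      ≡⟨ cong₂ _+_ (trans (cong (order *_) (∣∣≡∑𝟙 ⁅ e ⁆)) (*-distribˡ-sum order (𝟙 ⁅ e ⁆))) (*-distribˡ-sum (n * k) (𝟙 BM)) ⟩
    ∑ (λ t → order * 𝟙 ⁅ e ⁆ t) + ∑ (λ t → n * k * 𝟙 BM t) ≡⟨ ∑-distrib-+ (λ t → order * 𝟙 ⁅ e ⁆ t) (λ t → n * k * 𝟙 BM t) ⟨
    ∑ (λ t → order * 𝟙 ⁅ e ⁆ t + n * k * 𝟙 BM t)           ≤⟨ sum-mono-≤ pointwise-bound ⟩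
    ∑ (λ t → 𝟙 BM t * conjugates-in-A t + n * k * 𝟙 T t)
      ≡⟨ ∑-distrib-+ (λ t → 𝟙 BM t * conjugates-in-A t) (λ t → n * k * 𝟙 T t) ⟩
    ∑ (λ t → 𝟙 BM t * conjugates-in-A t) + ∑ (λ t → n * k * 𝟙 T t)
      ≡⟨ cong₂ _+_ ∑-conjugates-in-A (trans (sym (*-distribˡ-sum (n * k) (𝟙 T))) (cong (n * k *_) (sym (∣∣≡∑𝟙 T)))) ⟩
    order * k + n * k * ∣ T ∣                              ≡⟨ cong (λ a → a * k + n * k * ∣ T ∣) ∣G∣≡n³k ⟩
    n ^ 3 * k * k + n * k * ∣ T ∣                          ∎))
    where open ≤-Reasoning

  private
    ∣A·T∣≡nk∣T∣ : ∣ A ⋆ T ∣ ≡ n * k * ∣ T ∣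
    ∣A·T∣≡nk∣T∣ = begin
      ∣ A ⋆ T ∣                 ≡⟨ *-identityʳ _ ⟨
      ∣ A ⋆ T ∣ * 1             ≡⟨ cong (∣ A ⋆ T ∣ *_) ∣A∩T∣≡1 ⟨
      ∣ A ⋆ T ∣ * ∣ A ∩ T ∣     ≡⟨ product-formula A≤G T≤G ⟩
      ∣ A ∣ * ∣ T ∣             ≡⟨ cong (_* ∣ T ∣) ∣A∣≡nk ⟩
      n * k * ∣ T ∣             ∎
      where
      open ≡-Reasoning
      A∩T⊆⁅e⁆ : A ∩ T ⊆ ⁅ e ⁆
      A∩T⊆⁅e⁆ {a} p = let a∈A , a∈T = x∈p∩q⁻ A T p in
        subst (_∈ ⁅ e ⁆) (sym (proj₂ (∈T⁻ a∈T) e (subst (_∈ A) (solve 1 (λ a → a ⊜ ι ⊗ a ⊗ ι ⁻) refl a) a∈A))) (x∈⁅x⁆ e)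
      ∣A∩T∣≡1 : ∣ A ∩ T ∣ ≡ 1
      ∣A∩T∣≡1 = ≤-antisym (subst (∣ A ∩ T ∣ ≤_) (∣⁅x⁆∣≡1 e) (p⊆q⇒∣p∣≤∣q∣ A∩T⊆⁅e⁆)) (∈⇒∣∣>0 (x∈p∩q⁺ (A.e∈ , e∈T)))

    ∣G∣≡nk·n² : order ≡ n * k * n ^ 2
    ∣G∣≡nk·n² = trans ∣G∣≡n³k (ring-solve 2 (λ n k → n :^ 3 :* k := n :* k :* n :^ 2) refl n k)

  G≡A·T : ∀ g → g ∈ A ⋆ T
  G≡A·T g = m≤∣∣⇒∈ (begin
    order               ≡⟨ ∣G∣≡nk·n² ⟩
    n * k * n ^ 2       ≤⟨ *-monoʳ-≤ (n * k) n²≤∣T∣ ⟩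
    n * k * ∣ T ∣       ≡⟨ ∣A·T∣≡nk∣T∣ ⟨
    ∣ A ⋆ T ∣           ∎)
    where open ≤-Reasoning

  ∣T∣≡n² : ∣ T ∣ ≡ n ^ 2
  ∣T∣≡n² = ≤-antisym (*-cancelˡ-≤ (n * k) {{>-nonZero nk>0}} (begin
    n * k * ∣ T ∣       ≡⟨ ∣A·T∣≡nk∣T∣ ⟨
    ∣ A ⋆ T ∣           ≤⟨ ∣p∣≤n (A ⋆ T) ⟩
    order               ≡⟨ ∣G∣≡nk·n² ⟩
    n * k * n ^ 2       ∎)) n²≤∣T∣
    where open ≤-Reasoning

  T-transitive : ∀ x y → ∃ λ t → t ∈ T × actP t (Aco x) ≈P Aco y
  T-transitive x y = from-factorisation (∈⋆⁻ (G≡A·T (y · x ⁻¹)))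
    where
    from-factorisation : Factorisation A T (y · x ⁻¹) → ∃ λ t → t ∈ T × actP t (Aco x) ≈P Aco y
    from-factorisation (a , t , a∈A , t∈T , at≡yx⁻¹) =
      x ⁻¹ · t · x , T-conj x t∈T , A.·⁻¹∈⇒CosetEq (subst (_∈ A) a⁻¹≡ (A.⁻¹∈ a∈A))
      where
      a⁻¹≡ : a ⁻¹ ≡ x · (x ⁻¹ · t · x) · y ⁻¹
      a⁻¹≡ = begin
        a ⁻¹                          ≡⟨ solve 2 (λ a t → a ⁻ ⊜ t ⊗ (a ⊗ t) ⁻) refl a t ⟩
        t · (a · t) ⁻¹                ≡⟨ cong (λ u → t · u ⁻¹) at≡yx⁻¹ ⟩
        t · (y · x ⁻¹) ⁻¹             ≡⟨ solve 3 (λ x y t → t ⊗ (y ⊗ x ⁻) ⁻ ⊜ x ⊗ (x ⁻ ⊗ t ⊗ x) ⊗ y ⁻) refl x y t ⟩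
        x · (x ⁻¹ · t · x) · y ⁻¹     ∎
        where open ≡-Reasoning

  -- Elations with axis L∞

  T⊆Γ : ∀ {t} → t ∈ T → InΓ∞ t
  T⊆Γ {t} t∈T with t ≟ᶠ e
  ... | yes refl = ∞ , tt , T-axial t∈T , proj₂ (center-e tt)
  ... | no t≢e   = let w , w∈L∞ , fix = center t∈T t≢e in w , w∈L∞ , T-axial t∈T , fix

  Γ⊆BM : ∀ g → InΓ∞ g → g ∈ BM
  Γ⊆BM g (_ , _ , axial , _) = subst (_∈ BM) (solve 1 (λ g → ι ⊗ g ⊗ ι ⁻ ⊜ g) refl g) (BM.CosetEq⇒·⁻¹∈ (axial (BMco e) tt))

  actCollineation : El → Collineation
  actCollineation t = record
    { fP = actP t ; fL = actL t
    ; fP-resp = λ _ _ → act-respP t ; fL-resp = λ _ _ → act-respL t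
    ; fP-inj = λ P Q tP≈tQ → subst₂ _≈P_ (actP-⁻¹ t P) (actP-⁻¹ t Q) (act-respP (t ⁻¹) tP≈tQ)
    ; fL-inj = λ K L tK≈tL → subst₂ _≈L_ (actL-⁻¹ t K) (actL-⁻¹ t L) (act-respL (t ⁻¹) tK≈tL)
    ; fP-surj = λ Q → actP (t ⁻¹) Q , ≈P-reflexive (actP-⁻¹′ t Q)
    ; fL-surj = λ L → actL (t ⁻¹) L , ≈L-reflexive (actL-⁻¹′ t L)
    ; incid = λ _ _ → mk⇔ (act-I t) (act-I⁻ t) }

  translation-plane : IsTranslationPlane
  translation-plane ∞        _        P∉L∞ _    = ⊥-elim (P∉L∞ tt)
  translation-plane (BMco _) _        P∉L∞ _    = ⊥-elim (P∉L∞ tt)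
  translation-plane (Aco _)  ∞        _    Q∉L∞ = ⊥-elim (Q∉L∞ tt)
  translation-plane (Aco _)  (BMco _) _    Q∉L∞ = ⊥-elim (Q∉L∞ tt)
  translation-plane (Aco x)  (Aco y)  _    _    =
    let t , t∈T , tx≈y = T-transitive x y in actCollineation t , T⊆Γ t∈T , tx≈y

  affine-is-Aco : ∀ {P} → Affine P → ∃ λ y → P ≈P Aco y
  affine-is-Aco {∞}      P∉L∞ = ⊥-elim (P∉L∞ tt)
  affine-is-Aco {BMco _} P∉L∞ = ⊥-elim (P∉L∞ tt)
  affine-is-Aco {Aco y}  _    = y , ≈P-refl (Aco y)

  module _ (c : Collineation) {w} (w∈L∞ : w I L∞) (c-axial : Fixing.Axial (collineationMap c))
           (c-center : ∀ L → w I L → Collineation.fL c L ≈L L) where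
    open Collineation c using (fP; fL)

    private
      O : Point
      O = Aco e

    -- The line joining O to its image passes through the centres of both c and t.
    matching-translation-center : ∀ {t} → t ∈ T → fP O ≈P actP t O → IsCenter t w
    matching-translation-center {t} t∈T cO≈tO = by-cases (t ≟ᶠ e)
      where
      O≉cO : t ≢ e → ¬ O ≈P fP O
      O≉cO t≢e O≈cO = fixed-point-free t∈T t≢e {O} (λ ()) (≈P-sym {O} {actP t O} (≈P-trans {O} {fP O} O≈cO cO≈tO))
      w≈wt : t ≢ e → ∀ {wt} → IsCenter t wt → w ≈P wt
      w≈wt t≢e {wt} ct =
        let m , O∈m , w∈m = join O w (ideal≉affine w∈L∞ (λ ()))
            mt , O∈mt , wt∈mt = join O wt (ideal≉affine (proj₁ ct) (λ ()))
            cO∈m = I-respʳ (c-center m w∈m) (IncidenceMap.preserves (collineationMap c) O∈m)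
            cO∈mt = I-respˡ (≈P-sym cO≈tO) (I-respʳ (proj₂ ct mt wt∈mt) (act-I t O∈mt))
            m≈mt = unique-line (O≉cO t≢e) O∈m cO∈m O∈mt cO∈mt
        in ideal-point-unique (affine-line {O} (λ ()) O∈m) w∈m w∈L∞ (I-respʳ (≈L-sym m≈mt) wt∈mt) (proj₁ ct)
      by-cases : Dec (t ≡ e) → IsCenter t w
      by-cases (yes t≡e) = center-≡ (sym t≡e) (center-e w∈L∞)
      by-cases (no t≢e)  = let wt , ct = center t∈T t≢e in center-resp ct (≈P-sym (w≈wt t≢e ct))

    -- c followed by t⁻¹ is axial with centre w and fixes O, so it fixes everything.
    agrees-with-matching-translation : ∀ {t} → t ∈ T → fP O ≈P actP t O → (∀ P → fP P ≈P actP t P) × (∀ L → fL L ≈L actL t L)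
    agrees-with-matching-translation {t} t∈T cO≈tO =
      (λ P → ≈P-trans (≈P-reflexive (sym (actP-⁻¹′ t (fP P)))) (act-respP t (h-fixes-all P))) ,
      (λ L → ≈L-trans (≈L-reflexive (sym (actL-⁻¹′ t (fL L)))) (act-respL t (Fixing.fixes-all-lines h h-fixes-all L)))
      where
      h : IncidenceMap
      h = collineationMap c ⨾ actMap (t ⁻¹)
      h-axial : Fixing.Axial h
      h-axial P P∈L∞ = ≈P-trans (act-respP (t ⁻¹) (c-axial P P∈L∞)) (T-axial (T.⁻¹∈ t∈T) P P∈L∞)
      h-center : Fixing.IsCenter h w
      h-center = w∈L∞ , λ L w∈L →
        ≈L-trans (act-respL (t ⁻¹) (c-center L w∈L)) (proj₂ (center-⁻¹ (matching-translation-center t∈T cO≈tO)) L w∈L)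
      h-fixes-all : ∀ P → actP (t ⁻¹) (fP P) ≈P P
      h-fixes-all = Fixing.fixes-all h h-axial h-center {O} (λ ()) (≈P-trans (act-respP (t ⁻¹) cO≈tO) (≈P-reflexive (actP-⁻¹ t O)))

    matching-translation : ∃ λ t → t ∈ T × fP O ≈P actP t O
    matching-translation = from-image (affine-is-Aco (Fixing.affine-image (collineationMap c) c-axial {O} (λ ())))
      where
      from-image : (∃ λ y → fP O ≈P Aco y) → ∃ λ t → t ∈ T × fP O ≈P actP t O
      from-image (y , cO≈y) = let t , t∈T , tO≈y = T-transitive e y in t , t∈T , ≈P-trans {fP O} {Aco y} cO≈y (≈P-sym {actP t O} {Aco y} tO≈y)

  all-elations-in-Γ : AllElationsInΓ∞
  all-elations-in-Γ c (w , w∈L∞ , c-axial , c-center) =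
    let t , t∈T , cO≈tO = matching-translation c w∈L∞ c-axial c-center
    in t , T⊆Γ t∈T , agrees-with-matching-translation c w∈L∞ c-axial c-center t∈T cO≈tO

  -- T is elementary abelian

  unique-center : ∀ {t w w′} → t ∈ T → t ≢ e → IsCenter t w → IsCenter t w′ → w ≈P w′
  unique-center {w = w} {w′} t∈T t≢e c c′ with w ≈P? w′
  ... | yes w≈w′ = w≈w′
  ... | no w≉w′  = ⊥-elim (t≢e (two-centers⇒trivial t∈T c c′ w≉w′))

  center-cancelˡ : ∀ {s t w} → IsCenter s w → IsCenter (s · t) w → IsCenter t w
  center-cancelˡ {s} {t} cs cst = center-≡ (\\-leftDividesʳ s t) (center-· (center-⁻¹ cs) cst)

  -- The commutator s⁻¹ v⁻¹ s v has both centres, as s⁻¹ · (v⁻¹ s v) and as (s⁻¹ v⁻¹ s) · v.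
  distinct-centers⇒commute : ∀ {s v ws wv} → s ∈ T → v ∈ T → IsCenter s ws → IsCenter v wv → ¬ ws ≈P wv → s · v ≡ v · s
  distinct-centers⇒commute {s} {v} {ws} {wv} s∈T v∈T cs cv ws≉wv = begin
    s · v                                     ≡⟨ solve 2 (λ s v → s ⊗ v ⊜ v ⊗ s ⊗ (s ⁻ ⊗ v ⁻ ⊗ s ⊗ v)) refl s v ⟩
    v · s · (s ⁻¹ · v ⁻¹ · s · v)             ≡⟨ cong (v · s ·_) (two-centers⇒trivial commutator∈T c-ws c-wv ws≉wv) ⟩
    v · s · e                                 ≡⟨ idʳ _ ⟩
    v · s                                     ∎
    where
    open ≡-Reasoning
    commutator∈T : s ⁻¹ · v ⁻¹ · s · v ∈ T
    commutator∈T = T.·∈ (T.·∈ (T.·∈ (T.⁻¹∈ s∈T) (T.⁻¹∈ v∈T)) s∈T) v∈T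
    c-ws : IsCenter (s ⁻¹ · v ⁻¹ · s · v) ws
    c-ws = center-≡ (solve 2 (λ s v → s ⁻ ⊗ (v ⁻ ⊗ s ⊗ v) ⊜ s ⁻ ⊗ v ⁻ ⊗ s ⊗ v) refl s v)
                    (center-· (center-⁻¹ cs) (center-conj (T⊆BM v∈T) cs))
    c-wv : IsCenter (s ⁻¹ · v ⁻¹ · s · v) wv
    c-wv = center-· (center-conj (T⊆BM s∈T) (center-⁻¹ cv)) cv

  another-center : ∀ {w} → w I L∞ → ∃₂ λ v wv → v ∈ T × v ≢ e × IsCenter v wv × ¬ wv ≈P w
  another-center {w} w∈L∞ = through (join O w (ideal≉affine w∈L∞ (λ ())))
    where
    O = Aco e
    through : (∃ λ m → O I m × w I m) → ∃₂ λ v wv → v ∈ T × v ≢ e × IsCenter v wv × ¬ wv ≈P w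
    through (m , O∈m , w∈m) = off-line (A-point-off m (affine-line {O} (λ ()) O∈m))
      where
      off-line : (∃ λ x → ¬ Aco x I m) → ∃₂ λ v wv → v ∈ T × v ≢ e × IsCenter v wv × ¬ wv ≈P w
      off-line (x , Ax∉m) = translate (T-transitive e x)
        where
        translate : (∃ λ v → v ∈ T × actP v O ≈P Aco x) → ∃₂ λ v wv → v ∈ T × v ≢ e × IsCenter v wv × ¬ wv ≈P w
        translate (v , v∈T , vO≈Ax) = v , proj₁ (center v∈T v≢e) , v∈T , v≢e , proj₂ (center v∈T v≢e) , wv≉w (proj₂ (center v∈T v≢e))
          where
          v≢e : v ≢ e
          v≢e refl = Ax∉m (I-respˡ (≈P-trans {O} {actP e O} {Aco x} (≈P-reflexive (sym (actP-e O))) vO≈Ax) O∈m)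
          wv≉w : ∀ {wv} → IsCenter v wv → ¬ wv ≈P w
          wv≉w cv wv≈w = Ax∉m (I-respˡ vO≈Ax (I-respʳ (proj₂ (center-resp cv wv≈w) m w∈m) (act-I v O∈m)))

  private
    -- Otherwise v = t⁻¹ · (t · v) would have the two centres wv and w.
    product-center-differs : ∀ {t v w wv w′} → v ∈ T → v ≢ e → IsCenter t w → IsCenter v wv → ¬ wv ≈P w → IsCenter (t · v) w′ → ¬ w′ ≈P w
    product-center-differs v∈T v≢e ct cv wv≉w ctv w′≈w = wv≉w (unique-center v∈T v≢e cv (center-cancelˡ ct (center-resp ctv w′≈w)))

    product-nontrivial : ∀ {t v w wv} → v ∈ T → v ≢ e → IsCenter t w → IsCenter v wv → ¬ wv ≈P w → t · v ≢ e
    product-nontrivial {t} {v} v∈T v≢e ct cv wv≉w tv≡e =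
      wv≉w (unique-center v∈T v≢e cv (center-≡ (sym (inverseʳ-unique t v tv≡e)) (center-⁻¹ ct)))

  -- Compare s and s′ through an element v whose centre differs from their common one.
  same-center⇒commute : ∀ {s s′ w} → s ∈ T → s′ ∈ T → IsCenter s w → IsCenter s′ w → s · s′ ≡ s′ · s
  same-center⇒commute {s} {s′} {w} s∈T s′∈T cs cs′ = via (another-center (proj₁ cs))
    where
    via : (∃₂ λ v wv → v ∈ T × v ≢ e × IsCenter v wv × ¬ wv ≈P w) → s · s′ ≡ s′ · s
    via (v , wv , v∈T , v≢e , cv , wv≉w) = ∙-cancelʳ v _ _ (begin
      s · s′ · v        ≡⟨ assoc s s′ v ⟩
      s · (s′ · v)      ≡⟨ commutes-with (center s′v∈T s′v≢e) ⟩
      s′ · v · s        ≡⟨ assoc s′ v s ⟩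
      s′ · (v · s)      ≡⟨ cong (s′ ·_) (distinct-centers⇒commute s∈T v∈T cs cv (λ w≈wv → wv≉w (≈P-sym w≈wv))) ⟨
      s′ · (s · v)      ≡⟨ assoc s′ s v ⟨
      s′ · s · v        ∎)
      where
      open ≡-Reasoning
      s′v∈T = T.·∈ s′∈T v∈T
      s′v≢e = product-nontrivial v∈T v≢e cs′ cv wv≉w
      commutes-with : ∃ (IsCenter (s′ · v)) → s · (s′ · v) ≡ s′ · v · s
      commutes-with (w₃ , c₃) = distinct-centers⇒commute s∈T s′v∈T cs c₃
        (λ w≈w₃ → product-center-differs v∈T v≢e cs′ cv wv≉w c₃ (≈P-sym w≈w₃))

  T-abelian : ∀ {s s′} → s ∈ T → s′ ∈ T → s · s′ ≡ s′ · s
  T-abelian {s} {s′} s∈T s′∈T = by-cases (s ≟ᶠ e) (s′ ≟ᶠ e)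
    where
    compare : ∀ {ws ws′} → IsCenter s ws → IsCenter s′ ws′ → Dec (ws ≈P ws′) → s · s′ ≡ s′ · s
    compare cs cs′ (no ws≉ws′)  = distinct-centers⇒commute s∈T s′∈T cs cs′ ws≉ws′
    compare cs cs′ (yes ws≈ws′) = same-center⇒commute s∈T s′∈T cs (center-resp cs′ (≈P-sym ws≈ws′))
    by-cases : Dec (s ≡ e) → Dec (s′ ≡ e) → s · s′ ≡ s′ · s
    by-cases (yes refl) _          = trans (idˡ s′) (sym (idʳ s′))
    by-cases (no _)     (yes refl) = trans (idʳ s) (sym (idˡ s))
    by-cases (no s≢e)   (no s′≢e)  =
      let ws , cs = center s∈T s≢e
          ws′ , cs′ = center s′∈T s′≢e
      in compare cs cs′ (ws ≈P? ws′)

  module _ {u p} (u∈T : u ∈ T) (u≢e : u ≢ e) (uᵖ≡e : u ^ᵍ p ≡ e) where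
    private
      ^p-of-product : ∀ {s v} → s ∈ T → v ∈ T → v ^ᵍ p ≡ e → (s · v) ^ᵍ p ≡ s ^ᵍ p
      ^p-of-product {s} {v} s∈T v∈T vᵖ≡e =
        trans (^ᵍ-distrib-commuting s v (T-abelian s∈T v∈T) p) (trans (cong (s ^ᵍ p ·_) vᵖ≡e) (idʳ _))

      -- s^p has the centre of s and that of s·u, which differ.
      exponent-off-center : ∀ {s ws wu} → IsCenter u wu → s ∈ T → s ≢ e → IsCenter s ws → ¬ ws ≈P wu → s ^ᵍ p ≡ e
      exponent-off-center {s} {ws} {wu} cu s∈T s≢e cs ws≉wu = at (center (T.·∈ s∈T u∈T) (product-nontrivial u∈T u≢e cs cu wu≉ws))
        where
        wu≉ws : ¬ wu ≈P ws
        wu≉ws wu≈ws = ws≉wu (≈P-sym wu≈ws)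
        at : ∃ (IsCenter (s · u)) → s ^ᵍ p ≡ e
        at (w′ , c′) = two-centers⇒trivial (^ᵍ-∈ T≤G s∈T p) (center-^ᵍ cs p) (center-≡ (^p-of-product s∈T u∈T uᵖ≡e) (center-^ᵍ c′ p))
                         (λ ws≈w′ → product-center-differs u∈T u≢e cs cu wu≉ws c′ (≈P-sym ws≈w′))

      exponent-at-center : ∀ {s ws wu} → IsCenter u wu → s ∈ T → s ≢ e → IsCenter s ws → ws ≈P wu → s ^ᵍ p ≡ e
      exponent-at-center {s} {ws} {wu} cu s∈T s≢e cs ws≈wu = via (another-center (proj₁ cu))
        where
        cs′ : IsCenter s wu
        cs′ = center-resp cs ws≈wu
        via : (∃₂ λ v wv → v ∈ T × v ≢ e × IsCenter v wv × ¬ wv ≈P wu) → s ^ᵍ p ≡ e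
        via (v , wv , v∈T , v≢e , cv , wv≉wu) = at (center sv∈T sv≢e)
          where
          sv∈T = T.·∈ s∈T v∈T
          sv≢e = product-nontrivial v∈T v≢e cs′ cv wv≉wu
          at : ∃ (IsCenter (s · v)) → s ^ᵍ p ≡ e
          at (w″ , c″) = trans (sym (^p-of-product s∈T v∈T (exponent-off-center cu v∈T v≢e cv wv≉wu)))
                               (exponent-off-center cu sv∈T sv≢e c″ (product-center-differs v∈T v≢e cs′ cv wv≉wu c″))

    T-exponent : ∀ {s} → s ∈ T → s ^ᵍ p ≡ e
    T-exponent {s} s∈T = by-cases (s ≟ᶠ e)
      where
      compare : ∀ {ws wu} → s ≢ e → IsCenter s ws → IsCenter u wu → s ^ᵍ p ≡ e
      compare {ws} {wu} s≢e cs cu with ws ≈P? wu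
      ... | yes ws≈wu = exponent-at-center cu s∈T s≢e cs ws≈wu
      ... | no ws≉wu  = exponent-off-center cu s∈T s≢e cs ws≉wu
      by-cases : Dec (s ≡ e) → s ^ᵍ p ≡ e
      by-cases (yes refl) = e^ᵍ p
      by-cases (no s≢e)   = compare s≢e (proj₂ (center s∈T s≢e)) (proj₂ (center u∈T u≢e))

  T-nontrivial : ∃ λ t → t ∈ T × t ≢ e
  T-nontrivial = from-difference (∣∣<⇒∃∈∖ {S = ⁅ e ⁆} {T = T} (subst₂ _<_ (sym (∣⁅x⁆∣≡1 e)) (sym ∣T∣≡n²) 1<n²))
    where
    1<n² : 1 < n ^ 2
    1<n² = <-≤-trans n>1 (subst (n ≤_) (cong (n *_) (sym (*-identityʳ n))) (m≤m*n n n {{>-nonZero n>0}}))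
    from-difference : (∃ λ t → t ∈ T × t ∉ ⁅ e ⁆) → ∃ λ t → t ∈ T × t ≢ e
    from-difference (t , t∈T , t∉⁅e⁆) = t , t∈T , λ t≡e → t∉⁅e⁆ (subst (_∈ ⁅ e ⁆) (sym t≡e) (x∈⁅x⁆ e))

  -- ∣T∣ = n² and T is a p-group, for p the order of any element of prime order in T.
  n-prime-power : IsPrimePower n
  n-prime-power = from-element (prime-order-element T≤G (proj₁ (proj₂ T-nontrivial)) (proj₂ (proj₂ T-nontrivial)))
    where
    from-element : PrimeOrderElement T → IsPrimePower n
    from-element (u , p , p-prime , u∈T , u≢e , uᵖ≡e) = from-order (p-group T≤G T-abelian p-prime (T-exponent {p = p} u∈T u≢e uᵖ≡e))
      where
      from-order : (∃ λ r → ∣ T ∣ ≡ p ^ r) → IsPrimePower n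
      from-order (r , ∣T∣≡pʳ) =
        let j , n≡pʲ = divisor-of-prime-power p-prime r (divides n (trans (sym ∣T∣≡pʳ) (trans ∣T∣≡n² (cong (n *_) (*-identityʳ n)))))
        in p , j , p-prime , n≡pʲ

proposition3p1 : (G : FinGroup) (A B M : Subset (FinGroup.order G)) (n : ℕ) →
    let open FinGroup G
        open GroupNotions G
        open Plane G A B M
        k = ∣ A ∩ B ∣
    in 1 < n →
       IsSubgroup A → IsSubgroup B → IsSubgroup M →
       ∣ A ∣ ≡ n * k → ∣ B ∣ ≡ n * k → ∣ M ∣ ≡ n * k → order ≡ n ^ 3 * k →
       IsSubgroup AM → IsSubgroup BM → ∣ AM ∣ ≡ n ^ 2 * k → ∣ BM ∣ ≡ n ^ 2 * k →
       (∀ g → g ∈ (AM ⋆ B)) →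
       (∀ g → (g ∈ (A ⋆ B) × g ∈ (B ⋆ A)) ⇔ (g ∈ A ⊎ g ∈ B)) →
       Faithful →
       (∀ g → ⟨ Conj B A ⟩ g → g ∈ BM) →
       IsPrimePower n × IsNormal BM × IsTranslationPlane × AllElationsInΓ∞
         × (∀ g → InΓ∞ g → g ∈ BM)
proposition3p1 G A B M n n>1 A≤G B≤G M≤G ∣A∣≡nk ∣B∣≡nk ∣M∣≡nk ∣G∣≡n³k AM≤G BM≤G ∣AM∣≡n²k ∣BM∣≡n²k G≡AMB AB∩BA≡A∪B faithful ⟨Bᴬ⟩⊆BM =
  n-prime-power , BM-normal , translation-plane , all-elations-in-Γ , Γ⊆BM
  where
  open Setting (standing n>1 A≤G B≤G M≤G ∣A∣≡nk ∣B∣≡nk ∣M∣≡nk ∣G∣≡n³k AM≤G BM≤G ∣AM∣≡n²k ∣BM∣≡n²k G≡AMB AB∩BA≡A∪B faithful ⟨Bᴬ⟩⊆BM)
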